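{- For $n \geq 0$ let \[ H_n(p,q) := \sum_{w \in S_n} p^{\mathrm{inv}(w)} q^{\mathrm{maj}(w)}. \] There are constants $c_\mu \in \mathbb{Z}$ indexed by integer partitions $\mu$ such that \[ \frac{H_n(p,q)}{n!} = \frac{[n]_p!\,[n]_q!}{n!^2}\, F_n(p,q), \] where \[ F_n(p,q) = \sum_{d=0}^{n} \big[(1-p)(1-q)\big]^d \sum_{\substack{\mu \vdash n \\ \ell(\mu) = n-d}} \frac{c_\mu}{\prod_i [\mu_i]_p\,[\mu_i]_q}. \]
   Context: For a permutation $w = w_1\cdots w_n \in S_n$, $\mathrm{inv}(w) := \#\{i<j : w_i > w_j\}$ and $\mathrm{maj}(w) := \sum_{1 \le i \le n-1,\ w_i > w_{i+1}} i$. For a positive integer $c$, $[c]_p := 1 + p + \cdots + p^{c-1} = (1-p^c)/(1-p)$, and $[n]_p! := [n]_p [n-1]_p \cdots [1]_p$. For an integer partition $\mu = (\mu_1 \ge \mu_2 \ge \cdots)$ of $n$ (written $\mu \vdash n$), $\ell(\mu)$ denotes its number of parts. The identity is an identity of rational functions in $p, q$. -}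

module Defs where

open import Data.Nat as ℕ using (ℕ; zero; suc; _<ᵇ_; _≤ᵇ_; _≡ᵇ_)
open import Data.Nat using (_!)
open import Data.Integer using (ℤ; +_)
open import Data.Rational using (ℚ; 0ℚ; 1ℚ; _+_; _*_; _-_; _÷_; _/_; ≢-nonZero)
open import Data.Rational.Properties using (_≟_)
open import Data.Bool using (Bool; true; false; if_then_else_; _∧_)
open import Data.List using (List; []; _∷_; map; concatMap; filter; length; upTo; foldr)
open import Relation.Nullary using (yes; no)
open import Relation.Nullary.Decidable using (T?)

ℕtoℚ : ℕ → ℚ
ℕtoℚ n = + n / 1

ℤtoℚ : ℤ → ℚ
ℤtoℚ z = z / 1

_^ℚ_ : ℚ → ℕ → ℚ
x ^ℚ zero  = 1ℚ
x ^ℚ suc k = x * (x ^ℚ k)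

sumℚ : List ℚ → ℚ
sumℚ = foldr _+_ 0ℚ

prodℚ : List ℚ → ℚ
prodℚ = foldr _*_ 1ℚ

-- Total division: a / b for b ≠ 0 (returns 0 if b = 0; the theorem only
-- ever uses it under hypotheses guaranteeing nonzero denominators).
_div_ : ℚ → ℚ → ℚ
a div b with b ≟ 0ℚ
... | yes _ = 0ℚ
... | no b≢0 = _÷_ a b {{≢-nonZero b≢0}}

qint : ℚ → ℕ → ℚ
qint p c = sumℚ (map (p ^ℚ_) (upTo c))

qfact : ℚ → ℕ → ℚ
qfact p zero    = 1ℚ
qfact p (suc n) = qint p (suc n) * qfact p n

words : ℕ → ℕ → List (List ℕ)
words m zero    = [] ∷ []
words m (suc k) = concatMap (λ x → map (x ∷_) (words m k)) (upTo m)

notElem : ℕ → List ℕ → Bool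
notElem x []       = true
notElem x (y ∷ ys) = if x ≡ᵇ y then false else notElem x ys

distinct : List ℕ → Bool
distinct []       = true
distinct (x ∷ xs) = notElem x xs ∧ distinct xs

-- S_n: all permutations of {0,...,n-1} in one-line notation w_1 ... w_n
-- (words of length n over {0..n-1} with pairwise distinct letters)
Sn : ℕ → List (List ℕ)
Sn n = filter (λ w → T? (distinct w)) (words n n)

inv : List ℕ → ℕ
inv []       = 0
inv (x ∷ xs) = length (filter (λ y → T? (y <ᵇ x)) xs) ℕ.+ inv xs

-- majFrom i w = Σ over descents at (1-based) positions i, i+1, ...
majFrom : ℕ → List ℕ → ℕ
majFrom i []           = 0
majFrom i (x ∷ [])     = 0
majFrom i (x ∷ y ∷ ys) = (if y <ᵇ x then i else 0) ℕ.+ majFrom (suc i) (y ∷ ys)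

maj : List ℕ → ℕ
maj = majFrom 1

H : ℕ → ℚ → ℚ → ℚ
H n p q = sumℚ (map (λ w → (p ^ℚ inv w) * (q ^ℚ maj w)) (Sn n))

sumℕ : List ℕ → ℕ
sumℕ = foldr ℕ._+_ 0

allPos : List ℕ → Bool
allPos []       = true
allPos (x ∷ xs) = (1 ≤ᵇ x) ∧ allPos xs

weaklyDecr : List ℕ → Bool
weaklyDecr []           = true
weaklyDecr (x ∷ [])     = true
weaklyDecr (x ∷ y ∷ ys) = (y ≤ᵇ x) ∧ weaklyDecr (y ∷ ys)

isPartitionOf : ℕ → List ℕ → Bool
isPartitionOf n μ = allPos μ ∧ weaklyDecr μ ∧ (sumℕ μ ≡ᵇ n)

-- all partitions μ ⊢ n with exactly l parts (ℓ(μ) = l); parts are ≤ n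
partitionsWithLength : ℕ → ℕ → List (List ℕ)
partitionsWithLength n l = filter (λ μ → T? (isPartitionOf n μ)) (words (suc n) l)

F : (List ℕ → ℤ) → ℕ → ℚ → ℚ → ℚ
F c n p q =
  sumℚ (map (λ d → (((1ℚ - p) * (1ℚ - q)) ^ℚ d) *
                    sumℚ (map (λ μ → ℤtoℚ (c μ) div
                                      prodℚ (map (λ m → qint p m * qint q m) μ))
                              (partitionsWithLength n (n ℕ.∸ d))))
            (upTo (suc n)))

module Submission where

-- Expanding q^maj over ascending suffixes and gluing a permutation of {0..j-1} to an increasing
-- suffix gives the recurrence
--   H_{n+1} = Σ_{j ≤ n} q^j (q^{j+1}; q)_{n-j} [n+1 choose n+1-j]_p H_j.
-- Let A be the coefficients of exp (Σ_k a_k t^k), a_k = ((1-p)(1-q))^{k-1} / ([k]_p [k]_q), i.e.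
-- n A_n = Σ_i a_{n-i} A_i; comparing with the recurrence gives H_n = [n]_p! [n]_q! A_n.
-- The exponential formula writes n! A_n as a sum over compositions α of n of (number of permutations
-- with cycle lengths α) · Π_i a_{α_i}.  Grouping compositions by their sorted partition μ yields the
-- natural numbers c_μ, and Π_i a_{μ_i} = ((1-p)(1-q))^{n-ℓ(μ)} / Π_i [μ_i]_p [μ_i]_q.

open import Algebra.Bundles using (CommutativeSemiring; CommutativeRing)
import Algebra.Properties.CommutativeSemigroup as CommutativeSemigroupProperties
open import Data.Bool using (Bool; true; false; if_then_else_; _∧_; not; T)
import Data.Bool.Properties as Boolₚ
open import Data.Empty using (⊥-elim)
open import Data.Integer as ℤ using (ℤ)
import Data.Integer.Properties as ℤₚ
open import Data.List using (List; []; _∷_; _++_; _∷ʳ_; map; concatMap; filter; foldr; length; upTo; applyUpTo; take; drop; initLast; _∷ʳ′_)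
open import Data.List.Membership.Propositional using (_∈_; _∉_; find)
open import Data.List.Membership.Propositional.Properties using (∈-upTo⁺; ∈-upTo⁻; ∈-filter⁻; ∈-map⁻; ∈-concatMap⁻; ∈-++⁻)
open import Data.List.Properties using (≡-dec; ∷-injectiveˡ; ∷-injectiveʳ; length-upTo; map-upTo; length-map; length-++; length-drop; length-take; take++drop≡id; map-injective; ++-cancelʳ)
open import Data.List.Relation.Binary.Permutation.Propositional as ↭ using (_↭_; ↭-sym)
open import Data.List.Relation.Binary.Permutation.Propositional.Properties using (All-resp-↭; ↭-length; map⁺)
open import Data.List.Relation.Unary.All as All using (All; []; _∷_)
import Data.List.Relation.Unary.All.Properties as Allₚ
open import Data.List.Relation.Unary.AllPairs using (AllPairs; []; _∷_)
open import Data.List.Relation.Unary.Any using (here; there)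
open import Data.List.Relation.Unary.Linked using (Linked; []; [-]; _∷_)
import Data.List.Sort as Sort
open import Data.Nat as ℕ using (ℕ; zero; suc; _≤_; _<_; _∸_; _⊓_; _!; z≤n; s≤s; _<ᵇ_; _≤ᵇ_; _≡ᵇ_)
open import Data.Nat.Combinatorics using (_P_; nPk≡n!/[n∸k]!; [n∸k]!k!∣n!)
import Data.Nat.Coprimality as Coprimality
open import Data.Nat.DivMod using (m/n*n≡m)
open import Data.Nat.Divisibility using (∣-trans; m∣m*n)
open import Data.Nat.ListAction.Properties using (sum-↭)
import Data.Nat.Properties as ℕₚ
open import Data.Nat.Tactic.RingSolver using (solve-∀)
open import Data.Product using (∃; Σ; _×_; _,_; proj₁; proj₂)
open import Data.Sum using (_⊎_; inj₁; inj₂)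
open import Data.Unit using (tt)
open import Function using (_∘_; Injective)
open import Level using (0ℓ)
open import Relation.Binary.Core using (_Preserves_⟶_)
import Relation.Binary.Construct.Flip.EqAndOrd as Flip
open import Relation.Binary.Definitions using (DecidableEquality; tri<; tri≈; tri>)
open import Relation.Binary.PropositionalEquality using (_≡_; _≢_; refl; sym; trans; cong; cong₂; subst; module ≡-Reasoning)
import Relation.Binary.Reasoning.Setoid as SetoidReasoning
open import Relation.Nullary using (Dec; yes; no; does; ¬_)
open import Relation.Nullary.Decidable using (T?)

open import Defs

module Counting {B : Set} (_≟_ : DecidableEquality B) where

  δ : B → B → ℕ
  δ x y = if does (x ≟ y) then 1 else 0

  count : B → List B → ℕ
  count x []       = 0
  count x (y ∷ ys) = δ x y ℕ.+ count x ys

  δ-refl : ∀ x → δ x x ≡ 1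
  δ-refl x with x ≟ x
  ... | yes _   = refl
  ... | no x≢x = ⊥-elim (x≢x refl)

  δ-≢ : ∀ {x y} → x ≢ y → δ x y ≡ 0
  δ-≢ {x} {y} x≢y with x ≟ y
  ... | yes x≡y = ⊥-elim (x≢y x≡y)
  ... | no _    = refl

  δ-sym : ∀ x y → δ x y ≡ δ y x
  δ-sym x y with x ≟ y
  ... | yes refl = sym (δ-refl x)
  ... | no x≢y   = sym (δ-≢ (x≢y ∘ sym))

  count-++ : ∀ x xs ys → count x (xs ++ ys) ≡ count x xs ℕ.+ count x ys
  count-++ x []       ys = refl
  count-++ x (y ∷ xs) ys = trans (cong (δ x y ℕ.+_) (count-++ x xs ys)) (sym (ℕₚ.+-assoc (δ x y) _ _))

  count-∉ : ∀ {x} xs → x ∉ xs → count x xs ≡ 0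
  count-∉ []       _   = refl
  count-∉ (y ∷ xs) x∉ = cong₂ ℕ._+_ (δ-≢ (x∉ ∘ here)) (count-∉ xs (x∉ ∘ there))

  count-filter : (keep : B → Bool) → ∀ {x} xs → keep x ≡ true → count x (filter (T? ∘ keep) xs) ≡ count x xs
  count-filter keep     []       _  = refl
  count-filter keep {x} (y ∷ xs) keep-x with keep y in keep-y
  ... | true  = cong (δ x y ℕ.+_) (count-filter keep xs keep-x)
  ... | false with x ≟ y
  ...   | yes refl = ⊥-elim (true≢false (trans (sym keep-x) keep-y))
    where
    true≢false : true ≢ false
    true≢false ()
  ...   | no _     = count-filter keep xs keep-x

  count≡1⇒∈ : ∀ {x} xs → count x xs ≡ 1 → x ∈ xs
  count≡1⇒∈ {x} (y ∷ xs) count≡1 with x ≟ y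
  ... | yes refl = here refl
  ... | no _     = there (count≡1⇒∈ xs count≡1)

  count-map : {g : B → B} → Injective _≡_ _≡_ g → ∀ x ys → count (g x) (map g ys) ≡ count x ys
  count-map         g-inj x []       = refl
  count-map {g = g} g-inj x (y ∷ ys) = cong₂ ℕ._+_ δ-g (count-map g-inj x ys)
    where
    δ-g : δ (g x) (g y) ≡ δ x y
    δ-g with x ≟ y
    ... | yes refl = δ-refl (g x)
    ... | no x≢y   = δ-≢ (x≢y ∘ g-inj)

module ListSum (R : CommutativeSemiring 0ℓ 0ℓ) where

  open CommutativeSemiring R
    renaming (refl to ≈-refl; sym to ≈-sym; trans to ≈-trans; reflexive to ≈-reflexive)
  open CommutativeSemigroupProperties +-commutativeSemigroup using (interchange)
  open SetoidReasoning setoid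

  private
    variable
      B C : Set

  sum : (B → Carrier) → List B → Carrier
  sum f xs = foldr _+_ 0# (map f xs)

  sum-++ : (f : B → Carrier) (xs ys : List B) → sum f (xs ++ ys) ≈ sum f xs + sum f ys
  sum-++ f []       ys = ≈-sym (+-identityˡ _)
  sum-++ f (x ∷ xs) ys = ≈-trans (+-congˡ (sum-++ f xs ys)) (≈-sym (+-assoc (f x) _ _))

  sum-map : (f : B → Carrier) (g : C → B) (xs : List C) → sum f (map g xs) ≈ sum (f ∘ g) xs
  sum-map f g []       = ≈-refl
  sum-map f g (x ∷ xs) = +-congˡ (sum-map f g xs)

  sum-concatMap : (f : B → Carrier) (g : C → List B) (xs : List C) →
                  sum f (concatMap g xs) ≈ sum (λ x → sum f (g x)) xs
  sum-concatMap f g []       = ≈-refl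
  sum-concatMap f g (x ∷ xs) = ≈-trans (sum-++ f (g x) (concatMap g xs)) (+-congˡ (sum-concatMap f g xs))

  sum-cong : {f g : B → Carrier} (xs : List B) → (∀ x → x ∈ xs → f x ≈ g x) → sum f xs ≈ sum g xs
  sum-cong []       eq = ≈-refl
  sum-cong (x ∷ xs) eq = +-cong (eq x (here refl)) (sum-cong xs (λ y y∈xs → eq y (there y∈xs)))

  sum-+ : (f g : B → Carrier) (xs : List B) → sum (λ x → f x + g x) xs ≈ sum f xs + sum g xs
  sum-+ f g []       = ≈-sym (+-identityˡ 0#)
  sum-+ f g (x ∷ xs) = ≈-trans (+-congˡ (sum-+ f g xs)) (interchange (f x) (g x) _ _)

  sum-*ˡ : (c : Carrier) (f : B → Carrier) (xs : List B) → sum (λ x → c * f x) xs ≈ c * sum f xs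
  sum-*ˡ c f []       = ≈-sym (zeroʳ c)
  sum-*ˡ c f (x ∷ xs) = ≈-trans (+-congˡ (sum-*ˡ c f xs)) (≈-sym (distribˡ c (f x) _))

  sum-*ʳ : (c : Carrier) (f : B → Carrier) (xs : List B) → sum (λ x → f x * c) xs ≈ sum f xs * c
  sum-*ʳ c f xs = begin
    sum (λ x → f x * c) xs ≈⟨ sum-cong xs (λ x _ → *-comm (f x) c) ⟩
    sum (λ x → c * f x) xs ≈⟨ sum-*ˡ c f xs ⟩
    c * sum f xs           ≈⟨ *-comm c _ ⟩
    sum f xs * c           ∎

  sum-zero : (xs : List B) → sum (λ _ → 0#) xs ≈ 0#
  sum-zero []       = ≈-refl
  sum-zero (x ∷ xs) = ≈-trans (+-congˡ (sum-zero xs)) (+-identityˡ 0#)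

  sum-comm : (f : B → C → Carrier) (xs : List B) (ys : List C) →
             sum (λ x → sum (f x) ys) xs ≈ sum (λ y → sum (λ x → f x y) xs) ys
  sum-comm f []       ys = ≈-sym (sum-zero ys)
  sum-comm f (x ∷ xs) ys = ≈-trans (+-congˡ (sum-comm f xs ys)) (≈-sym (sum-+ (f x) _ ys))

  indicator : Bool → Carrier
  indicator true  = 1#
  indicator false = 0#

  indicator-∧ : ∀ a b → indicator (a ∧ b) ≈ indicator a * indicator b
  indicator-∧ true  b = ≈-sym (*-identityˡ (indicator b))
  indicator-∧ false b = ≈-sym (zeroˡ (indicator b))

  sum-filter : (keep : B → Bool) (f : B → Carrier) (xs : List B) →
               sum f (filter (T? ∘ keep) xs) ≈ sum (λ x → indicator (keep x) * f x) xs
  sum-filter keep f []       = ≈-refl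
  sum-filter keep f (x ∷ xs) with keep x
  ... | true  = +-cong (≈-sym (*-identityˡ (f x))) (sum-filter keep f xs)
  ... | false = ≈-trans (sum-filter keep f xs) (≈-sym (≈-trans (+-congʳ (zeroˡ (f x))) (+-identityˡ _)))

  sum-upTo-cong : {f g : ℕ → Carrier} (n : ℕ) → (∀ i → i < n → f i ≈ g i) → sum f (upTo n) ≈ sum g (upTo n)
  sum-upTo-cong n eq = sum-cong (upTo n) (λ i i∈ → eq i (∈-upTo⁻ i∈))

  sum-upTo-sucˡ : (f : ℕ → Carrier) (n : ℕ) → sum f (upTo (suc n)) ≈ f 0 + sum (f ∘ suc) (upTo n)
  sum-upTo-sucˡ f n = +-congˡ (≈-trans (≈-reflexive (cong (sum f) (sym (map-upTo suc n)))) (sum-map f suc (upTo n)))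

  sum-upTo-sucʳ : (f : ℕ → Carrier) (n : ℕ) → sum f (upTo (suc n)) ≈ sum f (upTo n) + f n
  sum-upTo-sucʳ f zero    = ≈-trans (+-identityʳ (f 0)) (≈-sym (+-identityˡ (f 0)))
  sum-upTo-sucʳ f (suc n) = begin
    sum f (upTo (suc (suc n)))                   ≈⟨ sum-upTo-sucˡ f (suc n) ⟩
    f 0 + sum (f ∘ suc) (upTo (suc n))           ≈⟨ +-congˡ (sum-upTo-sucʳ (f ∘ suc) n) ⟩
    f 0 + (sum (f ∘ suc) (upTo n) + f (suc n))   ≈⟨ ≈-sym (+-assoc (f 0) _ _) ⟩
    f 0 + sum (f ∘ suc) (upTo n) + f (suc n)     ≈⟨ +-congʳ (≈-sym (sum-upTo-sucˡ f n)) ⟩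
    sum f (upTo (suc n)) + f (suc n)             ∎

  sum-upTo-reverse : (f : ℕ → Carrier) (n : ℕ) → sum f (upTo (suc n)) ≈ sum (λ i → f (n ∸ i)) (upTo (suc n))
  sum-upTo-reverse f zero    = ≈-refl
  sum-upTo-reverse f (suc n) = begin
    sum f (upTo (suc (suc n)))                                ≈⟨ sum-upTo-sucˡ f (suc n) ⟩
    f 0 + sum (f ∘ suc) (upTo (suc n))                        ≈⟨ +-congˡ (sum-upTo-reverse (f ∘ suc) n) ⟩
    f 0 + sum (λ i → f (suc (n ∸ i))) (upTo (suc n))          ≈⟨ +-congˡ (sum-upTo-cong (suc n) suc-∸) ⟩
    f 0 + sum (λ i → f (suc n ∸ i)) (upTo (suc n))            ≈⟨ +-comm (f 0) _ ⟩
    sum (λ i → f (suc n ∸ i)) (upTo (suc n)) + f 0            ≈⟨ +-congˡ (≈-reflexive (cong f (sym (ℕₚ.n∸n≡0 (suc n))))) ⟩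
    sum (λ i → f (suc n ∸ i)) (upTo (suc n)) + f (suc n ∸ suc n) ≈⟨ ≈-sym (sum-upTo-sucʳ (λ i → f (suc n ∸ i)) (suc n)) ⟩
    sum (λ i → f (suc n ∸ i)) (upTo (suc (suc n)))            ∎
    where
    suc-∸ : ∀ i → i < suc n → f (suc (n ∸ i)) ≈ f (suc n ∸ i)
    suc-∸ i i<1+n = ≈-reflexive (cong f (sym (ℕₚ.+-∸-assoc 1 (ℕₚ.≤-pred i<1+n))))

  sum-upTo-triangle : (f : ℕ → ℕ → Carrier) (n : ℕ) →
                      sum (λ i → sum (f i) (upTo (suc i))) (upTo n)
                        ≈ sum (λ l → sum (λ s → f (l ℕ.+ s) l) (upTo (n ∸ l))) (upTo n)
  sum-upTo-triangle f zero    = ≈-refl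
  sum-upTo-triangle f (suc n) = begin
    sum (λ i → sum (f i) (upTo (suc i))) (upTo (suc n))
      ≈⟨ sum-upTo-sucʳ _ n ⟩
    sum (λ i → sum (f i) (upTo (suc i))) (upTo n) + sum (f n) (upTo (suc n))
      ≈⟨ +-cong (sum-upTo-triangle f n) (sum-upTo-sucʳ (f n) n) ⟩
    sum column (upTo n) + (sum (f n) (upTo n) + f n n)
      ≈⟨ ≈-sym (+-assoc _ _ _) ⟩
    sum column (upTo n) + sum (f n) (upTo n) + f n n
      ≈⟨ +-cong (≈-sym (sum-+ column (f n) (upTo n))) (≈-sym lastColumn) ⟩
    sum (λ l → column l + f n l) (upTo n) + column′ n
      ≈⟨ +-congʳ (sum-upTo-cong n extend) ⟩
    sum column′ (upTo n) + column′ n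
      ≈⟨ ≈-sym (sum-upTo-sucʳ column′ n) ⟩
    sum column′ (upTo (suc n)) ∎
    where
    column column′ : ℕ → Carrier
    column  l = sum (λ s → f (l ℕ.+ s) l) (upTo (n ∸ l))
    column′ l = sum (λ s → f (l ℕ.+ s) l) (upTo (suc n ∸ l))
    extend : ∀ l → l < n → column l + f n l ≈ column′ l
    extend l l<n = begin
      column l + f n l                                ≈⟨ +-congˡ (≈-reflexive (cong (λ k → f k l) (sym (ℕₚ.m+[n∸m]≡n (ℕₚ.<⇒≤ l<n))))) ⟩
      column l + f (l ℕ.+ (n ∸ l)) l                  ≈⟨ ≈-sym (sum-upTo-sucʳ (λ s → f (l ℕ.+ s) l) (n ∸ l)) ⟩
      sum (λ s → f (l ℕ.+ s) l) (upTo (suc (n ∸ l)))  ≡⟨ cong (λ k → sum (λ s → f (l ℕ.+ s) l) (upTo k)) (sym (ℕₚ.+-∸-assoc 1 (ℕₚ.<⇒≤ l<n))) ⟩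
      column′ l                                       ∎
    lastColumn : column′ n ≈ f n n
    lastColumn rewrite ℕₚ.+-∸-assoc 1 (ℕₚ.≤-refl {n}) | ℕₚ.n∸n≡0 n | ℕₚ.+-identityʳ n = +-identityʳ (f n n)

  fromℕ : ℕ → Carrier
  fromℕ zero    = 0#
  fromℕ (suc n) = 1# + fromℕ n

  fromℕ-+ : ∀ m n → fromℕ (m ℕ.+ n) ≈ fromℕ m + fromℕ n
  fromℕ-+ zero    n = ≈-sym (+-identityˡ _)
  fromℕ-+ (suc m) n = ≈-trans (+-congˡ (fromℕ-+ m n)) (≈-sym (+-assoc 1# _ _))

  fromℕ-* : ∀ m n → fromℕ (m ℕ.* n) ≈ fromℕ m * fromℕ n
  fromℕ-* zero    n = ≈-sym (zeroˡ (fromℕ n))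
  fromℕ-* (suc m) n = begin
    fromℕ (n ℕ.+ m ℕ.* n)               ≈⟨ fromℕ-+ n (m ℕ.* n) ⟩
    fromℕ n + fromℕ (m ℕ.* n)           ≈⟨ +-cong (≈-sym (*-identityˡ _)) (fromℕ-* m n) ⟩
    1# * fromℕ n + fromℕ m * fromℕ n    ≈⟨ ≈-sym (distribʳ (fromℕ n) 1# (fromℕ m)) ⟩
    (1# + fromℕ m) * fromℕ n            ∎

  fromℕ-1-* : ∀ a → fromℕ 1 * a ≈ a
  fromℕ-1-* a = ≈-trans (*-congʳ (+-identityʳ 1#)) (*-identityˡ a)

  module _ {B : Set} (_≟_ : DecidableEquality B) where

    open Counting _≟_

    sum-δ : (f : B → Carrier) (x : B) (ys : List B) → sum (λ y → fromℕ (δ x y) * f y) ys ≈ fromℕ (count x ys) * f x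
    sum-δ f x []       = ≈-sym (zeroˡ (f x))
    sum-δ f x (y ∷ ys) with x ≟ y
    ... | yes refl = begin
      (1# + 0#) * f x + sum (λ y → fromℕ (δ x y) * f y) ys  ≈⟨ +-congˡ (sum-δ f x ys) ⟩
      (1# + 0#) * f x + fromℕ (count x ys) * f x             ≈⟨ ≈-sym (distribʳ (f x) _ _) ⟩
      (1# + 0# + fromℕ (count x ys)) * f x                   ≈⟨ *-congʳ (≈-sym (fromℕ-+ 1 (count x ys))) ⟩
      fromℕ (1 ℕ.+ count x ys) * f x                         ∎
    ... | no _     = ≈-trans (+-cong (zeroˡ (f y)) (sum-δ f x ys)) (+-identityˡ _)

    sum-fromℕ-δ : (x : B) (ys : List B) → sum (λ y → fromℕ (δ y x)) ys ≈ fromℕ (count x ys)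
    sum-fromℕ-δ x []       = ≈-refl
    sum-fromℕ-δ x (y ∷ ys) = begin
      fromℕ (δ y x) + sum (λ y → fromℕ (δ y x)) ys   ≈⟨ +-cong (≈-reflexive (cong fromℕ (δ-sym y x))) (sum-fromℕ-δ x ys) ⟩
      fromℕ (δ x y) + fromℕ (count x ys)             ≈⟨ ≈-sym (fromℕ-+ (δ x y) (count x ys)) ⟩
      fromℕ (count x (y ∷ ys))                       ∎

    sum-by-count : (f : B → Carrier) (xs ys : List B) → (∀ x → x ∈ xs → count x ys ≡ 1) →
                   sum f xs ≈ sum (λ y → fromℕ (count y xs) * f y) ys
    sum-by-count f xs ys once-in-ys = begin
      sum f xs                                             ≈⟨ sum-cong xs (λ x x∈ → ≈-sym (pick x (once-in-ys x x∈))) ⟩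
      sum (λ x → sum (λ y → fromℕ (δ x y) * f y) ys) xs    ≈⟨ sum-comm (λ x y → fromℕ (δ x y) * f y) xs ys ⟩
      sum (λ y → sum (λ x → fromℕ (δ x y) * f y) xs) ys    ≈⟨ sum-cong ys (λ y _ → ≈-trans (sum-*ʳ (f y) _ xs) (*-congʳ (sum-fromℕ-δ y xs))) ⟩
      sum (λ y → fromℕ (count y xs) * f y) ys              ∎
      where
      pick : ∀ x → count x ys ≡ 1 → sum (λ y → fromℕ (δ x y) * f y) ys ≈ f x
      pick x once = ≈-trans (sum-δ f x ys) (≈-trans (*-congʳ (≈-reflexive (cong fromℕ once))) (fromℕ-1-* (f x)))

    sum-reindex : (f : B → Carrier) (xs ys : List B) →
                  (∀ x → x ∈ xs → count x ys ≡ 1) → (∀ y → y ∈ ys → count y xs ≡ 1) → sum f xs ≈ sum f ys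
    sum-reindex f xs ys once-in-ys once-in-xs = ≈-trans (sum-by-count f xs ys once-in-ys) (sum-cong ys once)
      where
      once : ∀ y → y ∈ ys → fromℕ (count y xs) * f y ≈ f y
      once y y∈ = ≈-trans (*-congʳ (≈-reflexive (cong fromℕ (once-in-xs y y∈)))) (fromℕ-1-* (f y))

open import Data.Rational using (ℚ; mkℚ; 0ℚ; 1ℚ; _+_; _*_; _-_; _/_; 1/_; ≢-nonZero)
import Data.Rational.Properties as ℚₚ
open import Data.Rational.Solver using (module +-*-Solver)

open ≡-Reasoning
open +-*-Solver using (solve; _:+_; _:*_; _:-_; _:=_; con)

module ℕΣ = ListSum ℕₚ.+-*-commutativeSemiring
module ℚΣ = ListSum (CommutativeRing.commutativeSemiring ℚₚ.+-*-commutativeRing)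
module Countℕ = Counting ℕ._≟_
module Countᴸ = Counting (≡-dec ℕ._≟_)

open ℚΣ

ℕΣ-fromℕ : ∀ n → ℕΣ.fromℕ n ≡ n
ℕΣ-fromℕ zero    = refl
ℕΣ-fromℕ (suc n) = cong suc (ℕΣ-fromℕ n)

ℕΣ-sum-by-count : (g : ℕ → ℕ) (xs ys : List ℕ) → (∀ x → x ∈ xs → Countℕ.count x ys ≡ 1) →
                  ℕΣ.sum g xs ≡ ℕΣ.sum (λ y → Countℕ.count y xs ℕ.* g y) ys
ℕΣ-sum-by-count g xs ys once = trans (ℕΣ.sum-by-count ℕ._≟_ g xs ys once)
  (ℕΣ.sum-cong ys (λ y _ → cong (ℕ._* g y) (ℕΣ-fromℕ (Countℕ.count y xs))))

count≡sum-δ : {B : Set} (_≟_ : DecidableEquality B) → ∀ x xs → Counting.count _≟_ x xs ≡ ℕΣ.sum (Counting.δ _≟_ x) xs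
count≡sum-δ _≟_ x []       = refl
count≡sum-δ _≟_ x (y ∷ xs) = cong (Counting.δ _≟_ x y ℕ.+_) (count≡sum-δ _≟_ x xs)

ℕΣ-sum-1 : {B : Set} (xs : List B) → ℕΣ.sum (λ _ → 1) xs ≡ length xs
ℕΣ-sum-1 []       = refl
ℕΣ-sum-1 (x ∷ xs) = cong suc (ℕΣ-sum-1 xs)

ℕΣ-sum≤length : {B : Set} (f : B → ℕ) (xs : List B) → (∀ x → x ∈ xs → f x ≤ 1) → ℕΣ.sum f xs ≤ length xs
ℕΣ-sum≤length f []       _   = z≤n
ℕΣ-sum≤length f (x ∷ xs) f≤1 = ℕₚ.+-mono-≤ (f≤1 x (here refl)) (ℕΣ-sum≤length f xs (λ y y∈ → f≤1 y (there y∈)))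

ℕΣ-sum≡length⇒≡1 : {B : Set} (f : B → ℕ) (xs : List B) → (∀ x → x ∈ xs → f x ≤ 1) →
                   ℕΣ.sum f xs ≡ length xs → ∀ x → x ∈ xs → f x ≡ 1
ℕΣ-sum≡length⇒≡1 f (y ∷ xs) f≤1 sum≡ x x∈ with ℕₚ.m≤n⇒m<n∨m≡n (f≤1 y (here refl))
... | inj₁ fy<1 = ⊥-elim (ℕₚ.<-irrefl refl (subst (_≤ length xs) rest≡ (ℕΣ-sum≤length f xs (λ z z∈ → f≤1 z (there z∈)))))
  where
  rest≡ : ℕΣ.sum f xs ≡ suc (length xs)
  rest≡ = trans (cong (ℕ._+ ℕΣ.sum f xs) (sym (ℕₚ.n<1⇒n≡0 fy<1))) sum≡
... | inj₂ fy≡1 with x∈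
...   | here refl = fy≡1
...   | there x∈xs = ℕΣ-sum≡length⇒≡1 f xs (λ z z∈ → f≤1 z (there z∈))
                      (ℕₚ.+-cancelˡ-≡ 1 _ _ (trans (cong (ℕ._+ ℕΣ.sum f xs) (sym fy≡1)) sum≡)) x x∈xs

T⇒≡true : ∀ {b} → T b → b ≡ true
T⇒≡true {true} _ = refl

≡true⇒T : ∀ {b} → b ≡ true → T b
≡true⇒T refl = tt

∧-true⁻ : ∀ {a b} → (a ∧ b) ≡ true → a ≡ true × b ≡ true
∧-true⁻ {true} {true} _ = refl , refl

∧-true⁺ : ∀ {a b} → a ≡ true → b ≡ true → (a ∧ b) ≡ true
∧-true⁺ refl refl = refl

<ᵇ-true : ∀ {a b} → a < b → (a <ᵇ b) ≡ true
<ᵇ-true a<b = T⇒≡true (ℕₚ.<⇒<ᵇ a<b)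

<ᵇ-false : ∀ {a b} → ¬ a < b → (a <ᵇ b) ≡ false
<ᵇ-false {a} {b} a≮b with a <ᵇ b in eq
... | true  = ⊥-elim (a≮b (ℕₚ.<ᵇ⇒< a b (≡true⇒T eq)))
... | false = refl

<ᵇ-true⁻ : ∀ {a b} → (a <ᵇ b) ≡ true → a < b
<ᵇ-true⁻ {a} {b} eq = ℕₚ.<ᵇ⇒< a b (≡true⇒T eq)

<ᵇ-false⁻ : ∀ {a b} → (a <ᵇ b) ≡ false → ¬ a < b
<ᵇ-false⁻ eq a<b = subst T eq (ℕₚ.<⇒<ᵇ a<b)

≡ᵇ-refl : ∀ a → (a ≡ᵇ a) ≡ true
≡ᵇ-refl a = T⇒≡true (ℕₚ.≡⇒≡ᵇ a a refl)

≡ᵇ-false : ∀ {a b} → a ≢ b → (a ≡ᵇ b) ≡ false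
≡ᵇ-false {a} {b} a≢b with a ≡ᵇ b in eq
... | true  = ⊥-elim (a≢b (ℕₚ.≡ᵇ⇒≡ a b (≡true⇒T eq)))
... | false = refl

range : ℕ → ℕ → List ℕ
range a zero    = []
range a (suc k) = a ∷ range (suc a) k

length-range : ∀ a k → length (range a k) ≡ k
length-range a zero    = refl
length-range a (suc k) = cong suc (length-range (suc a) k)

upTo≡range : ∀ n → upTo n ≡ range 0 n
upTo≡range = shifted 0
  where
  applyUpTo-cong : {f g : ℕ → ℕ} (n : ℕ) → (∀ i → f i ≡ g i) → applyUpTo f n ≡ applyUpTo g n
  applyUpTo-cong zero    _   = refl
  applyUpTo-cong (suc n) f≗g = cong₂ _∷_ (f≗g 0) (applyUpTo-cong n (f≗g ∘ suc))
  shifted : ∀ a n → applyUpTo (a ℕ.+_) n ≡ range a n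
  shifted a zero    = refl
  shifted a (suc n) = cong₂ _∷_ (ℕₚ.+-identityʳ a) (trans (applyUpTo-cong n (ℕₚ.+-suc a)) (shifted (suc a) n))

∈-range⁻ : ∀ {a k x} → x ∈ range a k → a ≤ x × x < a ℕ.+ k
∈-range⁻ {a} {suc k} (here refl) = ℕₚ.≤-refl , ℕₚ.m<m+n a (s≤s z≤n)
∈-range⁻ {a} {suc k} {x} (there x∈) with ∈-range⁻ {suc a} {k} x∈
... | a<x , x<1+a+k = ℕₚ.<⇒≤ a<x , subst (x <_) (sym (ℕₚ.+-suc a k)) x<1+a+k

count-range : ∀ {a k x} → a ≤ x → x < a ℕ.+ k → Countℕ.count x (range a k) ≡ 1
count-range {a} {zero}  {x} a≤x x<a+0 = ⊥-elim (ℕₚ.<-irrefl refl (ℕₚ.≤-trans x<a+0 (subst (_≤ x) (sym (ℕₚ.+-identityʳ a)) a≤x)))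
count-range {a} {suc k} {x} a≤x x<a+k with x ℕ.≟ a
... | yes refl = cong₂ ℕ._+_ (Countℕ.δ-refl x) (Countℕ.count-∉ (range (suc x) k) (λ x∈ → ℕₚ.<-irrefl refl (proj₁ (∈-range⁻ x∈))))
... | no x≢a  = trans (cong (ℕ._+ Countℕ.count x (range (suc a) k)) (Countℕ.δ-≢ x≢a))
                      (count-range (ℕₚ.≤∧≢⇒< a≤x (x≢a ∘ sym)) (subst (x <_) (ℕₚ.+-suc a k) x<a+k))

count-upTo : ∀ {n x} → x < n → Countℕ.count x (upTo n) ≡ 1
count-upTo {n} x<n = trans (cong (Countℕ.count _) (upTo≡range n)) (count-range z≤n x<n)

∈-words⁻ : ∀ m k {w} → w ∈ words m k → length w ≡ k × All (_< m) w
∈-words⁻ m zero    (here refl) = refl , []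
∈-words⁻ m (suc k) w∈ with find (∈-concatMap⁻ (λ x → map (x ∷_) (words m k)) {xs = upTo m} w∈)
... | x , x∈ , w∈′ with ∈-map⁻ (x ∷_) w∈′
... | v , v∈ , refl with ∈-words⁻ m k v∈
... | length≡ , v<m = cong suc length≡ , (∈-upTo⁻ x∈ ∷ v<m)

count-concatMap : {B : Set} (w : List ℕ) (g : B → List (List ℕ)) (xs : List B) →
                  Countᴸ.count w (concatMap g xs) ≡ ℕΣ.sum (λ y → Countᴸ.count w (g y)) xs
count-concatMap w g []       = refl
count-concatMap w g (y ∷ xs) = trans (Countᴸ.count-++ w (g y) (concatMap g xs)) (cong (Countᴸ.count w (g y) ℕ.+_) (count-concatMap w g xs))

count-map-∷ : ∀ x y w (ws : List (List ℕ)) → Countᴸ.count (x ∷ w) (map (y ∷_) ws) ≡ Countℕ.δ x y ℕ.* Countᴸ.count w ws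
count-map-∷ x y w []       = sym (ℕₚ.*-zeroʳ (Countℕ.δ x y))
count-map-∷ x y w (v ∷ ws) =
  trans (cong₂ ℕ._+_ (δ-∷ (x ℕ.≟ y) (≡-dec ℕ._≟_ w v)) (count-map-∷ x y w ws))
        (sym (ℕₚ.*-distribˡ-+ (Countℕ.δ x y) (Countᴸ.δ w v) _))
  where
  δ-∷ : Dec (x ≡ y) → Dec (w ≡ v) → Countᴸ.δ (x ∷ w) (y ∷ v) ≡ Countℕ.δ x y ℕ.* Countᴸ.δ w v
  δ-∷ (yes refl) (yes refl) = trans (Countᴸ.δ-refl (x ∷ w)) (sym (cong₂ ℕ._*_ (Countℕ.δ-refl x) (Countᴸ.δ-refl w)))
  δ-∷ (yes refl) (no w≢v)   = trans (Countᴸ.δ-≢ {x ∷ w} {x ∷ v} (w≢v ∘ ∷-injectiveʳ)) (sym (cong₂ ℕ._*_ (Countℕ.δ-refl x) (Countᴸ.δ-≢ w≢v)))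
  δ-∷ (no x≢y)   _          = trans (Countᴸ.δ-≢ {x ∷ w} {y ∷ v} (x≢y ∘ ∷-injectiveˡ)) (sym (cong (ℕ._* Countᴸ.δ w v) (Countℕ.δ-≢ x≢y)))

count-words : ∀ m k {w} → length w ≡ k → All (_< m) w → Countᴸ.count w (words m k) ≡ 1
count-words m zero    {[]}    refl [] = refl
count-words m (suc k) {x ∷ w} refl (x<m ∷ w<m) = begin
  Countᴸ.count (x ∷ w) (concatMap (λ y → map (y ∷_) (words m k)) (upTo m))
    ≡⟨ count-concatMap (x ∷ w) (λ y → map (y ∷_) (words m k)) (upTo m) ⟩
  ℕΣ.sum (λ y → Countᴸ.count (x ∷ w) (map (y ∷_) (words m k))) (upTo m)
    ≡⟨ ℕΣ.sum-cong (upTo m) (λ y _ → count-map-∷ x y w (words m k)) ⟩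
  ℕΣ.sum (λ y → Countℕ.δ x y ℕ.* Countᴸ.count w (words m k)) (upTo m)
    ≡⟨ ℕΣ.sum-*ʳ (Countᴸ.count w (words m k)) (Countℕ.δ x) (upTo m) ⟩
  ℕΣ.sum (Countℕ.δ x) (upTo m) ℕ.* Countᴸ.count w (words m k)
    ≡⟨ cong (ℕ._* _) (sym (count≡sum-δ ℕ._≟_ x (upTo m))) ⟩
  Countℕ.count x (upTo m) ℕ.* Countᴸ.count w (words m k)
    ≡⟨ cong₂ ℕ._*_ (count-upTo x<m) (count-words m k refl w<m) ⟩
  1 ∎

notElem⇒count≡0 : ∀ x xs → notElem x xs ≡ true → Countℕ.count x xs ≡ 0
notElem⇒count≡0 x []       _ = refl
notElem⇒count≡0 x (y ∷ ys) h with x ≡ᵇ y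
... | false = notElem⇒count≡0 x ys h

distinct⇒count≤1 : ∀ w → distinct w ≡ true → ∀ x → Countℕ.count x w ≤ 1
distinct⇒count≤1 []       _ x = z≤n
distinct⇒count≤1 (y ∷ ys) h x with ∧-true⁻ {notElem y ys} h
... | y∉ys , ys-distinct with x ℕ.≟ y
...   | yes refl = ℕₚ.≤-reflexive (cong₂ ℕ._+_ (Countℕ.δ-refl x) (notElem⇒count≡0 x ys y∉ys))
...   | no x≢y   = subst (_≤ 1) (sym (cong (ℕ._+ Countℕ.count x ys) (Countℕ.δ-≢ x≢y))) (distinct⇒count≤1 ys ys-distinct x)

∈-Sn⁻ : ∀ n {w} → w ∈ Sn n → distinct w ≡ true × length w ≡ n × All (_< n) w
∈-Sn⁻ n w∈ with ∈-filter⁻ (T? ∘ distinct) {xs = words n n} w∈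
... | w∈words , w-distinct with ∈-words⁻ n n w∈words
... | length≡ , w<n = T⇒≡true w-distinct , length≡ , w<n

count-Sn : ∀ n {w} → distinct w ≡ true → length w ≡ n → All (_< n) w → Countᴸ.count w (Sn n) ≡ 1
count-Sn n {w} w-distinct length≡ w<n =
  trans (Countᴸ.count-filter distinct (words n n) w-distinct) (count-words n n length≡ w<n)

count-letter-Sn : ∀ n {w} → w ∈ Sn n → ∀ x → x < n → Countℕ.count x w ≡ 1
count-letter-Sn n {w} w∈ x x<n with ∈-Sn⁻ n w∈
... | w-distinct , length≡ , w<n =
  ℕΣ-sum≡length⇒≡1 (λ x → Countℕ.count x w) (upTo n) (λ z _ → distinct⇒count≤1 w w-distinct z) total x (∈-upTo⁺ x<n)
  where
  total : ℕΣ.sum (λ x → Countℕ.count x w) (upTo n) ≡ length (upTo n)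
  total = begin
    ℕΣ.sum (λ x → Countℕ.count x w) (upTo n)          ≡⟨ ℕΣ.sum-cong (upTo n) (λ x _ → sym (ℕₚ.*-identityʳ _)) ⟩
    ℕΣ.sum (λ x → Countℕ.count x w ℕ.* 1) (upTo n)    ≡⟨ sym (ℕΣ-sum-by-count (λ _ → 1) w (upTo n) (λ y y∈ → count-upTo (All.lookup w<n y∈))) ⟩
    ℕΣ.sum (λ _ → 1) w                                ≡⟨ ℕΣ-sum-1 w ⟩
    length w                                          ≡⟨ trans length≡ (sym (length-upTo n)) ⟩
    length (upTo n)                                   ∎

^ℚ-+ : ∀ x a b → x ^ℚ (a ℕ.+ b) ≡ x ^ℚ a * x ^ℚ b
^ℚ-+ x zero    b = sym (ℚₚ.*-identityˡ _)
^ℚ-+ x (suc a) b = trans (cong (x *_) (^ℚ-+ x a b)) (sym (ℚₚ.*-assoc x _ _))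

ascending : List ℕ → Bool
ascending []           = true
ascending (x ∷ [])     = true
ascending (x ∷ y ∷ ys) = not (y <ᵇ x) ∧ ascending (y ∷ ys)

qPochhammer : ℚ → ℕ → ℕ → ℚ
qPochhammer q a zero    = 1ℚ
qPochhammer q a (suc k) = qPochhammer q a k * (1ℚ - q ^ℚ (a ℕ.+ k))

ascendingSuffixTerm : ℚ → List ℕ → ℕ → ℕ → ℚ
ascendingSuffixTerm q w n j =
  indicator (ascending (drop j w)) * (q ^ℚ maj (take j w) * (q ^ℚ j * qPochhammer q (suc j) (n ∸ j)))

module _ {A : Set} where

  take-∷ʳ : ∀ j (xs : List A) y → j ≤ length xs → take j (xs ∷ʳ y) ≡ take j xs
  take-∷ʳ zero    xs       y _         = refl
  take-∷ʳ (suc j) (x ∷ xs) y (s≤s j≤) = cong (x ∷_) (take-∷ʳ j xs y j≤)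

  drop-∷ʳ : ∀ j (xs : List A) y → j ≤ length xs → drop j (xs ∷ʳ y) ≡ drop j xs ∷ʳ y
  drop-∷ʳ zero    xs       y _         = refl
  drop-∷ʳ (suc j) (x ∷ xs) y (s≤s j≤) = drop-∷ʳ j xs y j≤

  take-length-++ : ∀ (xs ys : List A) → take (length xs) (xs ++ ys) ≡ xs
  take-length-++ []       ys = refl
  take-length-++ (x ∷ xs) ys = cong (x ∷_) (take-length-++ xs ys)

  drop-length-++ : ∀ (xs ys : List A) → drop (length xs) (xs ++ ys) ≡ ys
  drop-length-++ []       ys = refl
  drop-length-++ (x ∷ xs) ys = drop-length-++ xs ys

  length-∷ʳ : ∀ (xs : List A) y → length (xs ∷ʳ y) ≡ suc (length xs)
  length-∷ʳ xs y = trans (length-++ xs) (ℕₚ.+-comm (length xs) 1)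

ascending-∷ʳ : ∀ (zs : List ℕ) x y → ascending (zs ∷ʳ x ∷ʳ y) ≡ ascending (zs ∷ʳ x) ∧ not (y <ᵇ x)
ascending-∷ʳ []            x y = Boolₚ.∧-identityʳ (not (y <ᵇ x))
ascending-∷ʳ (z ∷ [])      x y = trans (cong (not (x <ᵇ z) ∧_) (ascending-∷ʳ [] x y)) (sym (Boolₚ.∧-assoc (not (x <ᵇ z)) _ _))
ascending-∷ʳ (z ∷ z′ ∷ zs) x y = trans (cong (not (z′ <ᵇ z) ∧_) (ascending-∷ʳ (z′ ∷ zs) x y)) (sym (Boolₚ.∧-assoc (not (z′ <ᵇ z)) _ _))

majFrom-∷ʳ : ∀ i (zs : List ℕ) x y →
             majFrom i (zs ∷ʳ x ∷ʳ y) ≡ majFrom i (zs ∷ʳ x) ℕ.+ (if y <ᵇ x then i ℕ.+ length zs else 0)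
majFrom-∷ʳ i [] x y with y <ᵇ x
... | true  = trans (ℕₚ.+-identityʳ i) (sym (ℕₚ.+-identityʳ i))
... | false = refl
majFrom-∷ʳ i (z ∷ []) x y = trans (cong (d ℕ.+_) (trans (majFrom-∷ʳ (suc i) [] x y) (cong (0 ℕ.+_) (shift (y <ᵇ x)))))
                                  (sym (ℕₚ.+-assoc d 0 _))
  where
  d = if x <ᵇ z then i else 0
  shift : ∀ b → (if b then suc i ℕ.+ 0 else 0) ≡ (if b then i ℕ.+ 1 else 0)
  shift true  = trans (ℕₚ.+-identityʳ (suc i)) (ℕₚ.+-comm 1 i)
  shift false = refl
majFrom-∷ʳ i (z ∷ z′ ∷ zs) x y =
  trans (cong (d ℕ.+_) (trans (majFrom-∷ʳ (suc i) (z′ ∷ zs) x y) (cong (majFrom (suc i) (z′ ∷ zs ∷ʳ x) ℕ.+_) (shift (y <ᵇ x)))))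
        (sym (ℕₚ.+-assoc d _ _))
  where
  d = if z′ <ᵇ z then i else 0
  shift : ∀ b → (if b then suc i ℕ.+ length (z′ ∷ zs) else 0) ≡ (if b then i ℕ.+ length (z ∷ z′ ∷ zs) else 0)
  shift true  = sym (ℕₚ.+-suc i (length (z′ ∷ zs)))
  shift false = refl

module DescentExpansion (q : ℚ) where

  private
    term = ascendingSuffixTerm q

  term-∷ʳ : ∀ zs x y j → j ≤ length zs →
            term (zs ∷ʳ x ∷ʳ y) (suc (length zs)) j
              ≡ indicator (not (y <ᵇ x)) * (1ℚ - q ^ℚ suc (length zs)) * term (zs ∷ʳ x) (length zs) j
  term-∷ʳ zs x y j j≤n = begin
    indicator (ascending (drop j (xs ∷ʳ y))) * (q ^ℚ maj (take j (xs ∷ʳ y)) * (q ^ℚ j * qPochhammer q (suc j) (suc n ∸ j)))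
      ≡⟨ cong₂ (λ a t → indicator a * (q ^ℚ maj t * (q ^ℚ j * qPochhammer q (suc j) (suc n ∸ j)))) ascending-drop
               (take-∷ʳ j xs y j≤length-xs) ⟩
    indicator (ascending (drop j xs) ∧ not (y <ᵇ x)) * (q ^ℚ maj (take j xs) * (q ^ℚ j * qPochhammer q (suc j) (suc n ∸ j)))
      ≡⟨ cong₂ (λ i k → i * (q ^ℚ maj (take j xs) * (q ^ℚ j * k))) (indicator-∧ (ascending (drop j xs)) _) qPochhammer-suc ⟩
    indicator (ascending (drop j xs)) * indicator (not (y <ᵇ x))
      * (q ^ℚ maj (take j xs) * (q ^ℚ j * (qPochhammer q (suc j) (n ∸ j) * (1ℚ - q ^ℚ suc n))))
      ≡⟨ solve 6 (λ a b c d e r → (a :* b) :* (c :* (d :* (e :* (con 1ℚ :- r)))) := b :* (con 1ℚ :- r) :* (a :* (c :* (d :* e)))) refl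
           (indicator (ascending (drop j xs))) (indicator (not (y <ᵇ x))) (q ^ℚ maj (take j xs)) (q ^ℚ j) (qPochhammer q (suc j) (n ∸ j)) (q ^ℚ suc n) ⟩
    indicator (not (y <ᵇ x)) * (1ℚ - q ^ℚ suc n) * term xs n j ∎
    where
    open +-*-Solver
    n = length zs
    xs = zs ∷ʳ x
    j≤length-xs : j ≤ length xs
    j≤length-xs = subst (j ≤_) (sym (length-∷ʳ zs x)) (ℕₚ.m≤n⇒m≤1+n j≤n)
    ascending-drop : ascending (drop j (xs ∷ʳ y)) ≡ ascending (drop j xs) ∧ not (y <ᵇ x)
    ascending-drop = begin
      ascending (drop j (xs ∷ʳ y))        ≡⟨ cong ascending (drop-∷ʳ j xs y j≤length-xs) ⟩
      ascending (drop j xs ∷ʳ y)          ≡⟨ cong (λ v → ascending (v ∷ʳ y)) (drop-∷ʳ j zs x j≤n) ⟩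
      ascending (drop j zs ∷ʳ x ∷ʳ y)     ≡⟨ ascending-∷ʳ (drop j zs) x y ⟩
      ascending (drop j zs ∷ʳ x) ∧ not (y <ᵇ x) ≡⟨ cong (λ v → ascending v ∧ not (y <ᵇ x)) (sym (drop-∷ʳ j zs x j≤n)) ⟩
      ascending (drop j xs) ∧ not (y <ᵇ x) ∎
    qPochhammer-suc : qPochhammer q (suc j) (suc n ∸ j) ≡ qPochhammer q (suc j) (n ∸ j) * (1ℚ - q ^ℚ suc n)
    qPochhammer-suc rewrite ℕₚ.+-∸-assoc 1 j≤n | ℕₚ.m+[n∸m]≡n j≤n = refl

  term-last : ∀ zs x y → term (zs ∷ʳ x ∷ʳ y) (suc (length zs)) (suc (length zs)) ≡ q ^ℚ maj (zs ∷ʳ x) * q ^ℚ suc (length zs)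
  term-last zs x y = begin
    indicator (ascending (drop (suc n) (xs ∷ʳ y))) * (q ^ℚ maj (take (suc n) (xs ∷ʳ y)) * (q ^ℚ suc n * qPochhammer q (2 ℕ.+ n) (n ∸ n)))
      ≡⟨ cong₂ (λ d t → indicator (ascending d) * (q ^ℚ maj t * (q ^ℚ suc n * qPochhammer q (2 ℕ.+ n) (n ∸ n))))
               (subst (λ k → drop k (xs ∷ʳ y) ≡ y ∷ []) (length-∷ʳ zs x) (drop-length-++ xs (y ∷ [])))
               (subst (λ k → take k (xs ∷ʳ y) ≡ xs) (length-∷ʳ zs x) (take-length-++ xs (y ∷ []))) ⟩
    1ℚ * (q ^ℚ maj xs * (q ^ℚ suc n * qPochhammer q (2 ℕ.+ n) (n ∸ n)))
      ≡⟨ cong (λ k → 1ℚ * (q ^ℚ maj xs * (q ^ℚ suc n * qPochhammer q (2 ℕ.+ n) k))) (ℕₚ.n∸n≡0 n) ⟩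
    1ℚ * (q ^ℚ maj xs * (q ^ℚ suc n * 1ℚ))
      ≡⟨ solve 2 (λ m r → con 1ℚ :* (m :* (r :* con 1ℚ)) := m :* r) refl (q ^ℚ maj xs) (q ^ℚ suc n) ⟩
    q ^ℚ maj xs * q ^ℚ suc n ∎
    where
    open +-*-Solver
    n = length zs
    xs = zs ∷ʳ x

  new-descent : ∀ b m n → indicator (not b) * (1ℚ - q ^ℚ suc n) * q ^ℚ m + q ^ℚ m * q ^ℚ suc n
                            ≡ q ^ℚ (m ℕ.+ (if b then suc n else 0))
  new-descent true  m n = trans (solve 2 (λ r t → con 0ℚ :* (con 1ℚ :- r) :* t :+ t :* r := t :* r) refl (q ^ℚ suc n) (q ^ℚ m))
                                (sym (^ℚ-+ q m (suc n)))
    where open +-*-Solver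
  new-descent false m n = trans (solve 2 (λ r t → con 1ℚ :* (con 1ℚ :- r) :* t :+ t :* r := t) refl (q ^ℚ suc n) (q ^ℚ m))
                                (cong (q ^ℚ_) (sym (ℕₚ.+-identityʳ m)))
    where open +-*-Solver

  expansion-∷ʳ : ∀ zs x y →
                 q ^ℚ maj (zs ∷ʳ x) ≡ sum (term (zs ∷ʳ x) (length zs)) (upTo (suc (length zs))) →
                 q ^ℚ maj (zs ∷ʳ x ∷ʳ y) ≡ sum (term (zs ∷ʳ x ∷ʳ y) (suc (length zs))) (upTo (2 ℕ.+ length zs))
  expansion-∷ʳ zs x y IH = begin
    q ^ℚ maj (xs ∷ʳ y)
      ≡⟨ cong (q ^ℚ_) (majFrom-∷ʳ 1 zs x y) ⟩
    q ^ℚ (maj xs ℕ.+ (if y <ᵇ x then suc n else 0))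
      ≡⟨ sym (new-descent (y <ᵇ x) (maj xs) n) ⟩
    a * q ^ℚ maj xs + q ^ℚ maj xs * q ^ℚ suc n
      ≡⟨ cong₂ _+_ (cong (a *_) IH) (sym (term-last zs x y)) ⟩
    a * sum (term xs n) (upTo (suc n)) + term (xs ∷ʳ y) (suc n) (suc n)
      ≡⟨ cong (_+ term (xs ∷ʳ y) (suc n) (suc n)) (sym (sum-*ˡ a (term xs n) (upTo (suc n)))) ⟩
    sum (λ j → a * term xs n j) (upTo (suc n)) + term (xs ∷ʳ y) (suc n) (suc n)
      ≡⟨ cong (_+ term (xs ∷ʳ y) (suc n) (suc n))
              (sum-upTo-cong (suc n) (λ j j<1+n → sym (term-∷ʳ zs x y j (ℕₚ.≤-pred j<1+n)))) ⟩
    sum (term (xs ∷ʳ y) (suc n)) (upTo (suc n)) + term (xs ∷ʳ y) (suc n) (suc n)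
      ≡⟨ sym (sum-upTo-sucʳ (term (xs ∷ʳ y) (suc n)) (suc n)) ⟩
    sum (term (xs ∷ʳ y) (suc n)) (upTo (2 ℕ.+ n)) ∎
    where
    n = length zs
    xs = zs ∷ʳ x
    a = indicator (not (y <ᵇ x)) * (1ℚ - q ^ℚ suc n)

  -- Appending y after x multiplies the old terms by [x ≤ y] (1 - q^{n+1}) and adds the term j = n + 1.
  q^maj-expansion : ∀ n w → length w ≡ suc n → q ^ℚ maj w ≡ sum (term w n) (upTo (suc n))
  q^maj-expansion zero    (y ∷ []) refl = refl
  q^maj-expansion (suc n) w length≡ with initLast w
  ... | xs ∷ʳ′ y with initLast xs
  ...   | [] = ⊥-elim (ℕₚ.0≢1+n (ℕₚ.suc-injective length≡))
  ...   | zs ∷ʳ′ x =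
    subst (λ k → q ^ℚ maj (zs ∷ʳ x ∷ʳ y) ≡ sum (term (zs ∷ʳ x ∷ʳ y) (suc k)) (upTo (2 ℕ.+ k))) length-zs
          (expansion-∷ʳ zs x y (subst (λ k → q ^ℚ maj (zs ∷ʳ x) ≡ sum (term (zs ∷ʳ x) k) (upTo (suc k))) (sym length-zs) IH))
    where
    length-xs : length (zs ∷ʳ x) ≡ suc n
    length-xs = ℕₚ.suc-injective (trans (sym (length-∷ʳ (zs ∷ʳ x) y)) length≡)
    length-zs : length zs ≡ n
    length-zs = ℕₚ.suc-injective (trans (sym (length-∷ʳ zs x)) length-xs)
    IH : q ^ℚ maj (zs ∷ʳ x) ≡ sum (term (zs ∷ʳ x) n) (upTo (suc n))
    IH = q^maj-expansion n (zs ∷ʳ x) length-xs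

countLess : ℕ → List ℕ → ℕ
countLess x ys = length (filter (λ y → T? (y <ᵇ x)) ys)

module _ {f : ℕ → ℕ} (f-mono : f Preserves _<_ ⟶ _<_) where

  <ᵇ-preserved : ∀ a b → (f a <ᵇ f b) ≡ (a <ᵇ b)
  <ᵇ-preserved a b with ℕₚ.<-cmp a b
  ... | tri< a<b _ _    = trans (<ᵇ-true (f-mono a<b)) (sym (<ᵇ-true a<b))
  ... | tri≈ _ refl _   = trans (<ᵇ-false {f a} (ℕₚ.<-irrefl refl)) (sym (<ᵇ-false {a} (ℕₚ.<-irrefl refl)))
  ... | tri> _ _ b<a    = trans (<ᵇ-false (ℕₚ.<-asym (f-mono b<a))) (sym (<ᵇ-false (ℕₚ.<-asym b<a)))

  strictlyMonotone-injective : ∀ {a b} → f a ≡ f b → a ≡ b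
  strictlyMonotone-injective {a} {b} fa≡fb with ℕₚ.<-cmp a b
  ... | tri< a<b _ _ = ⊥-elim (ℕₚ.<-irrefl fa≡fb (f-mono a<b))
  ... | tri≈ _ a≡b _ = a≡b
  ... | tri> _ _ b<a = ⊥-elim (ℕₚ.<-irrefl (sym fa≡fb) (f-mono b<a))

  countLess-map : ∀ x ys → countLess (f x) (map f ys) ≡ countLess x ys
  countLess-map x []       = refl
  countLess-map x (y ∷ ys) rewrite <ᵇ-preserved y x with y <ᵇ x
  ... | true  = cong suc (countLess-map x ys)
  ... | false = countLess-map x ys

  inv-map : ∀ u → inv (map f u) ≡ inv u
  inv-map []      = refl
  inv-map (x ∷ u) = cong₂ ℕ._+_ (countLess-map x u) (inv-map u)

  majFrom-map : ∀ i u → majFrom i (map f u) ≡ majFrom i u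
  majFrom-map i []          = refl
  majFrom-map i (x ∷ [])    = refl
  majFrom-map i (x ∷ y ∷ u) = cong₂ ℕ._+_ (cong (λ b → if b then i else 0) (<ᵇ-preserved y x)) (majFrom-map (suc i) (y ∷ u))

skip : ℕ → ℕ → ℕ
skip v i = if i <ᵇ v then i else suc i

skip-cases : ∀ v i → (i < v × skip v i ≡ i) ⊎ (v ≤ i × skip v i ≡ suc i)
skip-cases v i with i <ᵇ v in eq
... | true  = inj₁ (<ᵇ-true⁻ eq , refl)
... | false = inj₂ (ℕₚ.≮⇒≥ (<ᵇ-false⁻ eq) , refl)

skip-mono : ∀ v → skip v Preserves _<_ ⟶ _<_
skip-mono v {a} {b} a<b with skip-cases v a | skip-cases v b
... | inj₁ (_ , eqa)   | inj₁ (_ , eqb)   rewrite eqa | eqb = a<b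
... | inj₁ (_ , eqa)   | inj₂ (_ , eqb)   rewrite eqa | eqb = ℕₚ.m<n⇒m<1+n a<b
... | inj₂ (v≤a , _)   | inj₁ (b<v , _)   = ⊥-elim (ℕₚ.<-asym (ℕₚ.≤-<-trans v≤a a<b) b<v)
... | inj₂ (_ , eqa)   | inj₂ (_ , eqb)   rewrite eqa | eqb = s≤s a<b

skip≤suc : ∀ v i → skip v i ≤ suc i
skip≤suc v i with skip-cases v i
... | inj₁ (_ , eq) rewrite eq = ℕₚ.n≤1+n i
... | inj₂ (_ , eq) rewrite eq = ℕₚ.≤-refl

≤-skip : ∀ v i → i ≤ skip v i
≤-skip v i with skip-cases v i
... | inj₁ (_ , eq) rewrite eq = ℕₚ.≤-refl
... | inj₂ (_ , eq) rewrite eq = ℕₚ.n≤1+n i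

-- skipping V enumerates ℕ ∖ V in increasing order when V is strictly increasing.
skipping : List ℕ → ℕ → ℕ
skipping []      i = i
skipping (v ∷ V) i = skipping V (skip v i)

skipping-mono : ∀ V → skipping V Preserves _<_ ⟶ _<_
skipping-mono []      i<j = i<j
skipping-mono (v ∷ V) i<j = skipping-mono V (skip-mono v i<j)

skipping-injective : ∀ V {i j} → skipping V i ≡ skipping V j → i ≡ j
skipping-injective V = strictlyMonotone-injective (skipping-mono V)

skipping≤ : ∀ V i → skipping V i ≤ i ℕ.+ length V
skipping≤ []      i = ℕₚ.≤-reflexive (sym (ℕₚ.+-identityʳ i))
skipping≤ (v ∷ V) i = ℕₚ.≤-trans (skipping≤ V (skip v i))
  (ℕₚ.≤-trans (ℕₚ.+-monoˡ-≤ (length V) (skip≤suc v i)) (ℕₚ.≤-reflexive (sym (ℕₚ.+-suc i (length V)))))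

≤-skipping : ∀ V i → i ≤ skipping V i
≤-skipping []      i = ℕₚ.≤-refl
≤-skipping (v ∷ V) i = ℕₚ.≤-trans (≤-skip v i) (≤-skipping V (skip v i))

skipping-below : ∀ V i → All (i <_) V → skipping V i ≡ i
skipping-below []      i _              = refl
skipping-below (v ∷ V) i (i<v ∷ i<V) with skip-cases v i
... | inj₁ (_ , eq) rewrite eq = skipping-below V i i<V
... | inj₂ (v≤i , _) = ⊥-elim (ℕₚ.<-irrefl refl (ℕₚ.<-≤-trans i<v v≤i))

skipping-∉ : ∀ V → AllPairs _<_ V → ∀ i → All (skipping V i ≢_) V
skipping-∉ []      _                i = []
skipping-∉ (v ∷ V) (v<V ∷ V-inc) i = skipping-≢-v ∷ skipping-∉ V V-inc (skip v i)
  where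
  skipping-≢-v : skipping V (skip v i) ≢ v
  skipping-≢-v eq with skip-cases v i
  ... | inj₁ (i<v , skip≡) = ℕₚ.<-irrefl (trans (sym (trans (cong (skipping V) skip≡) (skipping-below V i (All.map (ℕₚ.<-trans i<v) v<V)))) eq) i<v
  ... | inj₂ (v≤i , skip≡) = ℕₚ.<-irrefl (sym eq) (ℕₚ.<-≤-trans (s≤s v≤i) (ℕₚ.≤-trans (ℕₚ.≤-reflexive (sym skip≡)) (≤-skipping V (skip v i))))

head+length≤ : ∀ n v V → AllPairs _<_ (v ∷ V) → All (_< n) (v ∷ V) → v ℕ.+ length (v ∷ V) ≤ n
head+length≤ n v []      _                     (v<n ∷ [])  = subst (_≤ n) (ℕₚ.+-comm 1 v) v<n
head+length≤ n v (w ∷ V) ((v<w ∷ _) ∷ w∷V-inc) (_ ∷ w∷V<n) =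
  ℕₚ.≤-trans (ℕₚ.≤-reflexive (ℕₚ.+-suc v (length (w ∷ V))))
    (ℕₚ.≤-trans (ℕₚ.+-monoˡ-≤ (length (w ∷ V)) v<w) (head+length≤ n w V w∷V-inc w∷V<n))

skipping-surjective : ∀ n V → AllPairs _<_ V → All (_< n) V → ∀ x → x < n → All (x ≢_) V →
                      Σ ℕ (λ i → i ℕ.+ length V < n × skipping V i ≡ x)
skipping-surjective n []      _                 _           x x<n _ = x , subst (_< n) (sym (ℕₚ.+-identityʳ x)) x<n , refl
skipping-surjective n (v ∷ V) (v<V ∷ V-inc) (v<n ∷ V<n) x x<n (x≢v ∷ x∉V)
  with skipping-surjective n V V-inc V<n x x<n x∉V
... | j , j+|V|<n , skipping-j≡x with ℕₚ.<-cmp j v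
...   | tri< j<v _ _ = j , ℕₚ.<-≤-trans (ℕₚ.+-monoˡ-< (length (v ∷ V)) j<v) (head+length≤ n v V (v<V ∷ V-inc) (v<n ∷ V<n)) ,
                       trans (cong (skipping V) skip-j) skipping-j≡x
  where
  skip-j : skip v j ≡ j
  skip-j with skip-cases v j
  ... | inj₁ (_ , eq)  = eq
  ... | inj₂ (v≤j , _) = ⊥-elim (ℕₚ.<-irrefl refl (ℕₚ.<-≤-trans j<v v≤j))
...   | tri≈ _ refl _ = ⊥-elim (x≢v (trans (sym skipping-j≡x) (skipping-below V j v<V)))
...   | tri> _ _ v<j with j
...     | suc j′ = j′ , subst (_< n) (sym (ℕₚ.+-suc j′ (length V))) j+|V|<n , trans (cong (skipping V) skip-j′) skipping-j≡x
  where
  skip-j′ : skip v j′ ≡ suc j′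
  skip-j′ with skip-cases v j′
  ... | inj₂ (_ , eq)  = eq
  ... | inj₁ (j′<v , _) = ⊥-elim (ℕₚ.<-irrefl refl (ℕₚ.<-≤-trans j′<v (ℕₚ.≤-pred v<j)))

skipping-preimage : ∀ n V → AllPairs _<_ V → All (_< n) V → ∀ xs → All (_< n) xs → All (λ x → All (x ≢_) V) xs →
                    Σ (List ℕ) (λ us → map (skipping V) us ≡ xs × All (λ i → i ℕ.+ length V < n) us)
skipping-preimage n V V-inc V<n []       _           _            = [] , refl , []
skipping-preimage n V V-inc V<n (x ∷ xs) (x<n ∷ xs<n) (x∉V ∷ xs∉V)
  with skipping-surjective n V V-inc V<n x x<n x∉V | skipping-preimage n V V-inc V<n xs xs<n xs∉V
... | i , i+|V|<n , skipping-i≡x | us , map≡xs , us-bound = (i ∷ us) , cong₂ _∷_ skipping-i≡x map≡xs , (i+|V|<n ∷ us-bound)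

qBinomial : ℚ → ℕ → ℕ → ℚ
qBinomial p zero    zero    = 1ℚ
qBinomial p zero    (suc m) = 0ℚ
qBinomial p (suc k) zero    = 1ℚ
qBinomial p (suc k) (suc m) = p ^ℚ (k ∸ m) * qBinomial p k m + qBinomial p k (suc m)

InRange : ℕ → ℕ → ℕ → Set
InRange a k x = a ≤ x × x < a ℕ.+ k

InRange-suc : ∀ {a k x} → InRange (suc a) k x → InRange a (suc k) x
InRange-suc {a} {k} {x} (a<x , x<) = ℕₚ.<⇒≤ a<x , subst (x <_) (sym (ℕₚ.+-suc a k)) x<

InRange-pred : ∀ {a k x} → a < x → InRange a (suc k) x → InRange (suc a) k x
InRange-pred {a} {k} {x} a<x (_ , x<) = a<x , subst (x <_) (ℕₚ.+-suc a k) x<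

-- the m-element subsets of [a, a + k), each listed in increasing order
subsets : ℕ → ℕ → ℕ → List (List ℕ)
subsets a zero    zero    = [] ∷ []
subsets a zero    (suc m) = []
subsets a (suc k) zero    = [] ∷ []
subsets a (suc k) (suc m) = map (a ∷_) (subsets (suc a) k m) ++ subsets (suc a) k (suc m)

IsSubset : ℕ → ℕ → ℕ → List ℕ → Set
IsSubset a k m V = AllPairs _<_ V × All (InRange a k) V × length V ≡ m

∈-subsets⁻ : ∀ a k m {V} → V ∈ subsets a k m → IsSubset a k m V
∈-subsets⁻ a zero    zero    (here refl) = [] , [] , refl
∈-subsets⁻ a (suc k) zero    (here refl) = [] , [] , refl
∈-subsets⁻ a (suc k) (suc m) V∈ with ∈-++⁻ (map (a ∷_) (subsets (suc a) k m)) V∈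
... | inj₁ V∈₁ with ∈-map⁻ (a ∷_) V∈₁
...   | V′ , V′∈ , refl with ∈-subsets⁻ (suc a) k m V′∈
...     | V′-inc , V′-range , |V′| = (All.map proj₁ V′-range ∷ V′-inc) ,
                                   ((ℕₚ.≤-refl , ℕₚ.m<m+n a (s≤s z≤n)) ∷ All.map InRange-suc V′-range) , cong suc |V′|
∈-subsets⁻ a (suc k) (suc m) V∈ | inj₂ V∈₂ with ∈-subsets⁻ (suc a) k (suc m) V∈₂
... | V-inc , V-range , |V| = V-inc , All.map InRange-suc V-range , |V|

count-subsets : ∀ a k m {V} → IsSubset a k m V → Countᴸ.count V (subsets a k m) ≡ 1
count-subsets a zero    zero    {[]}    _ = refl
count-subsets a zero    (suc m) {x ∷ V} (_ , (a≤x , x<a+0) ∷ _ , _) =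
  ⊥-elim (ℕₚ.<-irrefl refl (ℕₚ.<-≤-trans (subst (x <_) (ℕₚ.+-identityʳ a) x<a+0) a≤x))
count-subsets a (suc k) zero    {[]}    _ = refl
count-subsets a (suc k) (suc m) {x ∷ V} ((a<V ∷ V-inc) , (x-range ∷ V-range) , |V|) = begin
  Countᴸ.count (x ∷ V) (map (a ∷_) S₁ ++ S₂)                              ≡⟨ Countᴸ.count-++ (x ∷ V) (map (a ∷_) S₁) S₂ ⟩
  Countᴸ.count (x ∷ V) (map (a ∷_) S₁) ℕ.+ Countᴸ.count (x ∷ V) S₂         ≡⟨ cong (ℕ._+ Countᴸ.count (x ∷ V) S₂) (count-map-∷ x a V S₁) ⟩
  Countℕ.δ x a ℕ.* Countᴸ.count V S₁ ℕ.+ Countᴸ.count (x ∷ V) S₂          ≡⟨ by-head (x ℕ.≟ a) ⟩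
  1                                                                       ∎
  where
  S₁ = subsets (suc a) k m
  S₂ = subsets (suc a) k (suc m)
  by-head : Dec (x ≡ a) → Countℕ.δ x a ℕ.* Countᴸ.count V S₁ ℕ.+ Countᴸ.count (x ∷ V) S₂ ≡ 1
  by-head (yes refl) = cong₂ ℕ._+_
    (trans (cong (ℕ._* Countᴸ.count V S₁) (Countℕ.δ-refl x)) (trans (ℕₚ.+-identityʳ _)
      (count-subsets (suc x) k m (V-inc , All.zipWith (λ (x<y , y-range) → InRange-pred x<y y-range) (a<V , V-range) , ℕₚ.suc-injective |V|))))
    (Countᴸ.count-∉ S₂ (λ x∷V∈ → ℕₚ.<-irrefl refl (proj₁ (All.head (proj₁ (proj₂ (∈-subsets⁻ (suc x) k (suc m) x∷V∈)))))))
  by-head (no x≢a) = trans (cong (λ d → d ℕ.* Countᴸ.count V S₁ ℕ.+ Countᴸ.count (x ∷ V) S₂) (Countℕ.δ-≢ x≢a))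
    (count-subsets (suc a) k (suc m) ((a<V ∷ V-inc) , InRange-pred a<x x-range ∷ All.zipWith (λ (x<y , y-range) → InRange-pred (ℕₚ.<-trans a<x x<y) y-range) (a<V , V-range) , |V|))
    where
    a<x : a < x
    a<x = ℕₚ.≤∧≢⇒< (proj₁ x-range) (x≢a ∘ sym)

increasing⇒count≤1 : ∀ V → AllPairs _<_ V → ∀ x → Countℕ.count x V ≤ 1
increasing⇒count≤1 []      _               x = z≤n
increasing⇒count≤1 (v ∷ V) (v<V ∷ V-inc) x with x ℕ.≟ v
... | yes refl = ℕₚ.≤-reflexive (cong₂ ℕ._+_ (Countℕ.δ-refl x) (Countℕ.count-∉ V (λ x∈ → ℕₚ.<-irrefl refl (All.lookup v<V x∈))))
... | no x≢v   = subst (_≤ 1) (sym (cong (ℕ._+ Countℕ.count x V) (Countℕ.δ-≢ x≢v))) (increasing⇒count≤1 V V-inc x)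

-- the inversions between V and the rest of [a, a + k): pairs x ∉ V, y ∈ V with y < x
crossInversions : ℕ → ℕ → List ℕ → ℕ
crossInversions a k V = ℕΣ.sum (λ x → (1 ∸ Countℕ.count x V) ℕ.* countLess x V) (range a k)

countLess-∷-< : ∀ {a x} V → a < x → countLess x (a ∷ V) ≡ suc (countLess x V)
countLess-∷-< V a<x rewrite <ᵇ-true a<x = refl

countLess-≤ : ∀ a V → All (a ≤_) V → countLess a V ≡ 0
countLess-≤ a []      _              = refl
countLess-≤ a (y ∷ V) (a≤y ∷ a≤V) rewrite <ᵇ-false {y} {a} (ℕₚ.≤⇒≯ a≤y) = countLess-≤ a V a≤V

sum-complement : ∀ a k m {V} → IsSubset a k m V → ℕΣ.sum (λ x → 1 ∸ Countℕ.count x V) (range a k) ≡ k ∸ m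
sum-complement a k m {V} (V-inc , V-range , |V|) = begin
  outside                   ≡⟨ sym (ℕₚ.m+n∸n≡m outside m) ⟩
  (outside ℕ.+ m) ∸ m       ≡⟨ cong (λ t → (outside ℕ.+ t) ∸ m) (sym inside≡m) ⟩
  (outside ℕ.+ inside) ∸ m  ≡⟨ cong (_∸ m) outside+inside≡k ⟩
  k ∸ m                     ∎
  where
  outside = ℕΣ.sum (λ x → 1 ∸ Countℕ.count x V) (range a k)
  inside  = ℕΣ.sum (λ x → Countℕ.count x V) (range a k)
  outside+inside≡k : outside ℕ.+ inside ≡ k
  outside+inside≡k = begin
    outside ℕ.+ inside                                              ≡⟨ sym (ℕΣ.sum-+ _ _ (range a k)) ⟩
    ℕΣ.sum (λ x → (1 ∸ Countℕ.count x V) ℕ.+ Countℕ.count x V) (range a k) ≡⟨ ℕΣ.sum-cong (range a k) (λ x _ → ℕₚ.m∸n+n≡m (increasing⇒count≤1 V V-inc x)) ⟩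
    ℕΣ.sum (λ _ → 1) (range a k)                                    ≡⟨ ℕΣ-sum-1 (range a k) ⟩
    length (range a k)                                              ≡⟨ length-range a k ⟩
    k                                                               ∎
  inside≡m : inside ≡ m
  inside≡m = begin
    inside                                                ≡⟨ ℕΣ.sum-cong (range a k) (λ x _ → sym (ℕₚ.*-identityʳ _)) ⟩
    ℕΣ.sum (λ x → Countℕ.count x V ℕ.* 1) (range a k)     ≡⟨ sym (ℕΣ-sum-by-count (λ _ → 1) V (range a k) (λ y y∈ → let (a≤y , y<) = All.lookup V-range y∈ in count-range a≤y y<)) ⟩
    ℕΣ.sum (λ _ → 1) V                                    ≡⟨ ℕΣ-sum-1 V ⟩
    length V                                              ≡⟨ |V| ⟩
    m                                                     ∎

crossInversions-[] : ∀ a k → crossInversions a k [] ≡ 0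
crossInversions-[] a k = ℕΣ.sum-zero (range a k)

crossInversions-head : ∀ a k m {V} → IsSubset (suc a) k m V → crossInversions a (suc k) (a ∷ V) ≡ (k ∸ m) ℕ.+ crossInversions (suc a) k V
crossInversions-head a k m {V} V-subset = begin
  (1 ∸ Countℕ.count a (a ∷ V)) ℕ.* countLess a (a ∷ V) ℕ.+ ℕΣ.sum (λ x → (1 ∸ Countℕ.count x (a ∷ V)) ℕ.* countLess x (a ∷ V)) (range (suc a) k)
    ≡⟨ cong₂ ℕ._+_ a-term (ℕΣ.sum-cong (range (suc a) k) later-term) ⟩
  0 ℕ.+ ℕΣ.sum (λ x → (1 ∸ Countℕ.count x V) ℕ.+ (1 ∸ Countℕ.count x V) ℕ.* countLess x V) (range (suc a) k)
    ≡⟨ ℕΣ.sum-+ _ _ (range (suc a) k) ⟩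
  ℕΣ.sum (λ x → 1 ∸ Countℕ.count x V) (range (suc a) k) ℕ.+ crossInversions (suc a) k V
    ≡⟨ cong (ℕ._+ crossInversions (suc a) k V) (sum-complement (suc a) k m V-subset) ⟩
  (k ∸ m) ℕ.+ crossInversions (suc a) k V ∎
  where
  a-term : (1 ∸ Countℕ.count a (a ∷ V)) ℕ.* countLess a (a ∷ V) ≡ 0
  a-term = trans (cong (λ c → (1 ∸ (c ℕ.+ Countℕ.count a V)) ℕ.* countLess a (a ∷ V)) (Countℕ.δ-refl a))
                 (cong (ℕ._* countLess a (a ∷ V)) (ℕₚ.0∸n≡0 (Countℕ.count a V)))
  later-term : ∀ x → x ∈ range (suc a) k →
               (1 ∸ Countℕ.count x (a ∷ V)) ℕ.* countLess x (a ∷ V) ≡ (1 ∸ Countℕ.count x V) ℕ.+ (1 ∸ Countℕ.count x V) ℕ.* countLess x V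
  later-term x x∈ = begin
    (1 ∸ Countℕ.count x (a ∷ V)) ℕ.* countLess x (a ∷ V)
      ≡⟨ cong₂ ℕ._*_ (cong (λ c → 1 ∸ (c ℕ.+ Countℕ.count x V)) (Countℕ.δ-≢ (λ x≡a → ℕₚ.<-irrefl (sym x≡a) a<x))) (countLess-∷-< V a<x) ⟩
    (1 ∸ Countℕ.count x V) ℕ.* suc (countLess x V)
      ≡⟨ ℕₚ.*-suc (1 ∸ Countℕ.count x V) (countLess x V) ⟩
    (1 ∸ Countℕ.count x V) ℕ.+ (1 ∸ Countℕ.count x V) ℕ.* countLess x V ∎
    where
    a<x : a < x
    a<x = proj₁ (∈-range⁻ x∈)

crossInversions-skip : ∀ a k m {V} → IsSubset (suc a) k m V → crossInversions a (suc k) V ≡ crossInversions (suc a) k V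
crossInversions-skip a k m {V} (_ , V-range , _) = cong (ℕ._+ crossInversions (suc a) k V)
  (trans (cong ((1 ∸ Countℕ.count a V) ℕ.*_) (countLess-≤ a V (All.map (ℕₚ.<⇒≤ ∘ proj₁) V-range))) (ℕₚ.*-zeroʳ (1 ∸ Countℕ.count a V)))

qBinomial-subsets : ∀ p a k m → sum (λ V → p ^ℚ crossInversions a k V) (subsets a k m) ≡ qBinomial p k m
qBinomial-subsets p a zero    zero    = ℚₚ.+-identityʳ 1ℚ
qBinomial-subsets p a zero    (suc m) = refl
qBinomial-subsets p a (suc k) zero    = trans (cong (λ c → p ^ℚ c + 0ℚ) (crossInversions-[] a (suc k))) (ℚₚ.+-identityʳ 1ℚ)
qBinomial-subsets p a (suc k) (suc m) = begin
  sum f (map (a ∷_) S₁ ++ S₂)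
    ≡⟨ sum-++ f (map (a ∷_) S₁) S₂ ⟩
  sum f (map (a ∷_) S₁) + sum f S₂
    ≡⟨ cong₂ _+_ (trans (sum-map f (a ∷_) S₁) (sum-cong S₁ (λ V V∈ → with-a V (∈-subsets⁻ (suc a) k m V∈))))
                 (sum-cong S₂ (λ V V∈ → cong (p ^ℚ_) (crossInversions-skip a k (suc m) (∈-subsets⁻ (suc a) k (suc m) V∈)))) ⟩
  sum (λ V → p ^ℚ (k ∸ m) * p ^ℚ crossInversions (suc a) k V) S₁ + sum (λ V → p ^ℚ crossInversions (suc a) k V) S₂
    ≡⟨ cong₂ _+_ (trans (sum-*ˡ (p ^ℚ (k ∸ m)) _ S₁) (cong (p ^ℚ (k ∸ m) *_) (qBinomial-subsets p (suc a) k m)))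
                 (qBinomial-subsets p (suc a) k (suc m)) ⟩
  qBinomial p (suc k) (suc m) ∎
  where
  f : List ℕ → ℚ
  f V = p ^ℚ crossInversions a (suc k) V
  S₁ = subsets (suc a) k m
  S₂ = subsets (suc a) k (suc m)
  with-a : ∀ V → IsSubset (suc a) k m V → f (a ∷ V) ≡ p ^ℚ (k ∸ m) * p ^ℚ crossInversions (suc a) k V
  with-a V V-subset = trans (cong (p ^ℚ_) (crossInversions-head a k m V-subset)) (^ℚ-+ p (k ∸ m) _)

notElem-++ : ∀ x xs ys → notElem x (xs ++ ys) ≡ notElem x xs ∧ notElem x ys
notElem-++ x []       ys = refl
notElem-++ x (y ∷ xs) ys with x ≡ᵇ y
... | true  = refl
... | false = notElem-++ x xs ys

All≢⇒notElem : ∀ x ys → All (x ≢_) ys → notElem x ys ≡ true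
All≢⇒notElem x []       _              = refl
All≢⇒notElem x (y ∷ ys) (x≢y ∷ x∉ys) rewrite ≡ᵇ-false x≢y = All≢⇒notElem x ys x∉ys

notElem⇒All≢ : ∀ x ys → notElem x ys ≡ true → All (x ≢_) ys
notElem⇒All≢ x []       _  = []
notElem⇒All≢ x (y ∷ ys) x∉ with x ≡ᵇ y in eq
... | false = (λ x≡y → subst T eq (ℕₚ.≡⇒≡ᵇ x y x≡y)) ∷ notElem⇒All≢ x ys x∉

distinct-++⁺ : ∀ xs ys → distinct xs ≡ true → distinct ys ≡ true → All (λ x → notElem x ys ≡ true) xs → distinct (xs ++ ys) ≡ true
distinct-++⁺ []       ys _          ys-distinct _             = ys-distinct
distinct-++⁺ (x ∷ xs) ys x∷xs-dist ys-distinct (x∉ys ∷ xs∉ys) with ∧-true⁻ {notElem x xs} x∷xs-dist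
... | x∉xs , xs-distinct = ∧-true⁺ (trans (notElem-++ x xs ys) (∧-true⁺ x∉xs x∉ys)) (distinct-++⁺ xs ys xs-distinct ys-distinct xs∉ys)

distinct-++⁻ : ∀ xs ys → distinct (xs ++ ys) ≡ true →
               distinct xs ≡ true × distinct ys ≡ true × All (λ x → notElem x ys ≡ true) xs
distinct-++⁻ []       ys d = refl , d , []
distinct-++⁻ (x ∷ xs) ys d with ∧-true⁻ {notElem x (xs ++ ys)} d
... | x∉xs++ys , rest with distinct-++⁻ xs ys rest | ∧-true⁻ {notElem x xs} (trans (sym (notElem-++ x xs ys)) x∉xs++ys)
... | xs-distinct , ys-distinct , xs∉ys | x∉xs , x∉ys = ∧-true⁺ x∉xs xs-distinct , ys-distinct , (x∉ys ∷ xs∉ys)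

module _ {f : ℕ → ℕ} (f-injective : Injective _≡_ _≡_ f) where

  notElem-map : ∀ x xs → notElem (f x) (map f xs) ≡ notElem x xs
  notElem-map x []       = refl
  notElem-map x (y ∷ xs) with x ℕ.≟ y
  ... | yes refl rewrite ≡ᵇ-refl (f x) | ≡ᵇ-refl x = refl
  ... | no x≢y   rewrite ≡ᵇ-false (x≢y ∘ f-injective) | ≡ᵇ-false x≢y = notElem-map x xs

  distinct-map : ∀ xs → distinct (map f xs) ≡ distinct xs
  distinct-map []       = refl
  distinct-map (x ∷ xs) = cong₂ _∧_ (notElem-map x xs) (distinct-map xs)

ascending⇒head≤ : ∀ x ys → ascending (x ∷ ys) ≡ true → All (x ≤_) ys
ascending⇒head≤ x []       _   = []
ascending⇒head≤ x (y ∷ ys) asc with ∧-true⁻ {not (y <ᵇ x)} asc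
... | y≮x , y∷ys-asc = x≤y ∷ All.map (ℕₚ.≤-trans x≤y) (ascending⇒head≤ y ys y∷ys-asc)
  where
  x≤y : x ≤ y
  x≤y = ℕₚ.≮⇒≥ (λ y<x → false≢true (trans (sym (cong not (<ᵇ-true y<x))) y≮x))
    where
    false≢true : false ≢ true
    false≢true ()

ascending-tail : ∀ x ys → ascending (x ∷ ys) ≡ true → ascending ys ≡ true
ascending-tail x []       _   = refl
ascending-tail x (y ∷ ys) asc = proj₂ (∧-true⁻ {not (y <ᵇ x)} asc)

ascending∧distinct⇒increasing : ∀ V → ascending V ≡ true → distinct V ≡ true → AllPairs _<_ V
ascending∧distinct⇒increasing []       _   _ = []
ascending∧distinct⇒increasing (x ∷ ys) asc d with ∧-true⁻ {notElem x ys} d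
... | x∉ys , ys-distinct =
  All.zipWith (λ (x≤y , x≢y) → ℕₚ.≤∧≢⇒< x≤y x≢y) (ascending⇒head≤ x ys asc , notElem⇒All≢ x ys x∉ys)
  ∷ ascending∧distinct⇒increasing ys (ascending-tail x ys asc) ys-distinct

increasing⇒distinct : ∀ V → AllPairs _<_ V → distinct V ≡ true
increasing⇒distinct []       _                = refl
increasing⇒distinct (x ∷ ys) (x<ys ∷ ys-inc) =
  ∧-true⁺ (All≢⇒notElem x ys (All.map (λ x<y x≡y → ℕₚ.<-irrefl x≡y x<y) x<ys)) (increasing⇒distinct ys ys-inc)

increasing⇒ascending : ∀ V → AllPairs _<_ V → ascending V ≡ true
increasing⇒ascending []           _                           = refl
increasing⇒ascending (x ∷ [])     _                           = refl
increasing⇒ascending (x ∷ y ∷ ys) ((x<y ∷ _) ∷ y∷ys-inc) =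
  ∧-true⁺ (cong not (<ᵇ-false {y} {x} (ℕₚ.<⇒≯ x<y))) (increasing⇒ascending (y ∷ ys) y∷ys-inc)

countLess-++ : ∀ x xs ys → countLess x (xs ++ ys) ≡ countLess x xs ℕ.+ countLess x ys
countLess-++ x []       ys = refl
countLess-++ x (y ∷ xs) ys with y <ᵇ x
... | true  = cong suc (countLess-++ x xs ys)
... | false = countLess-++ x xs ys

inv-++ : ∀ xs ys → inv (xs ++ ys) ≡ inv xs ℕ.+ ℕΣ.sum (λ x → countLess x ys) xs ℕ.+ inv ys
inv-++ []       ys = refl
inv-++ (x ∷ xs) ys = begin
  countLess x (xs ++ ys) ℕ.+ inv (xs ++ ys)
    ≡⟨ cong₂ ℕ._+_ (countLess-++ x xs ys) (inv-++ xs ys) ⟩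
  countLess x xs ℕ.+ countLess x ys ℕ.+ (inv xs ℕ.+ ℕΣ.sum (λ x → countLess x ys) xs ℕ.+ inv ys)
    ≡⟨ regroup (countLess x xs) (countLess x ys) (inv xs) _ (inv ys) ⟩
  countLess x xs ℕ.+ inv xs ℕ.+ (countLess x ys ℕ.+ ℕΣ.sum (λ x → countLess x ys) xs) ℕ.+ inv ys ∎
  where
  regroup : ∀ a b c d e → a ℕ.+ b ℕ.+ (c ℕ.+ d ℕ.+ e) ≡ a ℕ.+ c ℕ.+ (b ℕ.+ d) ℕ.+ e
  regroup = solve-∀

inv-increasing : ∀ V → AllPairs _<_ V → inv V ≡ 0
inv-increasing []       _                = refl
inv-increasing (x ∷ ys) (x<ys ∷ ys-inc) = cong₂ ℕ._+_ (countLess-≤ x ys (All.map ℕₚ.<⇒≤ x<ys)) (inv-increasing ys ys-inc)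

-- A word with strictly increasing suffix V and prefix order-isomorphic to u.
glue : List ℕ → List ℕ → List ℕ
glue V u = map (skipping V) u ++ V

module AscendingSuffix (n j : ℕ) (j≤n : j ≤ n) where

  m : ℕ
  m = n ∸ j

  j+m≡n : j ℕ.+ m ≡ n
  j+m≡n = ℕₚ.m+[n∸m]≡n j≤n

  glued : List (List ℕ)
  glued = concatMap (λ V → map (glue V) (Sn j)) (subsets 0 n m)

  withAscendingSuffix : List (List ℕ)
  withAscendingSuffix = filter (T? ∘ ascending ∘ drop j) (Sn n)

  module Glued {V u : List ℕ} (V-subset : IsSubset 0 n m V) (u∈Sj : u ∈ Sn j) where

    private
      V-inc = proj₁ V-subset
      V-range = proj₁ (proj₂ V-subset)
      |V| = proj₂ (proj₂ V-subset)
      u-distinct = proj₁ (∈-Sn⁻ j u∈Sj)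
      |u| = proj₁ (proj₂ (∈-Sn⁻ j u∈Sj))
      u<j = proj₂ (proj₂ (∈-Sn⁻ j u∈Sj))
      |map-u| : length (map (skipping V) u) ≡ j
      |map-u| = trans (length-map (skipping V) u) |u|

    drop-glue : drop j (glue V u) ≡ V
    drop-glue = subst (λ k → drop k (glue V u) ≡ V) |map-u| (drop-length-++ (map (skipping V) u) V)

    take-glue : take j (glue V u) ≡ map (skipping V) u
    take-glue = subst (λ k → take k (glue V u) ≡ map (skipping V) u) |map-u| (take-length-++ (map (skipping V) u) V)

    private
      length-glue : length (glue V u) ≡ n
      length-glue = trans (length-++ (map (skipping V) u)) (trans (cong₂ ℕ._+_ |map-u| |V|) j+m≡n)

      glue<n : All (_< n) (glue V u)
      glue<n = Allₚ.++⁺ (Allₚ.map⁺ (All.map skipped<n u<j)) (All.map proj₂ V-range)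
        where
        skipped<n : ∀ {i} → i < j → skipping V i < n
        skipped<n {i} i<j = ℕₚ.≤-<-trans (skipping≤ V i)
          (subst (i ℕ.+ length V <_) (trans (cong (j ℕ.+_) |V|) j+m≡n) (ℕₚ.+-monoˡ-< (length V) i<j))

      glue-distinct : distinct (glue V u) ≡ true
      glue-distinct = distinct-++⁺ (map (skipping V) u) V
        (trans (distinct-map (skipping-injective V) u) u-distinct) (increasing⇒distinct V V-inc)
        (Allₚ.map⁺ (All.universal (λ i → All≢⇒notElem (skipping V i) V (skipping-∉ V V-inc i)) u))

    count-glue-Sn : Countᴸ.count (glue V u) (Sn n) ≡ 1
    count-glue-Sn = count-Sn n glue-distinct length-glue glue<n

    count-glue-withAscendingSuffix : Countᴸ.count (glue V u) withAscendingSuffix ≡ 1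
    count-glue-withAscendingSuffix =
      trans (Countᴸ.count-filter (ascending ∘ drop j) (Sn n) (trans (cong ascending drop-glue) (increasing⇒ascending V V-inc)))
            count-glue-Sn

    crossInversions-glue : ℕΣ.sum (λ x → countLess x V) (map (skipping V) u) ≡ crossInversions 0 n V
    crossInversions-glue = begin
      ℕΣ.sum (λ x → countLess x V) (map (skipping V) u)
        ≡⟨ ℕΣ-sum-by-count (λ x → countLess x V) _ (range 0 n)
             (λ x x∈ → count-range z≤n (All.lookup (Allₚ.++⁻ˡ (map (skipping V) u) glue<n) x∈)) ⟩
      ℕΣ.sum (λ x → Countℕ.count x (map (skipping V) u) ℕ.* countLess x V) (range 0 n)
        ≡⟨ ℕΣ.sum-cong (range 0 n) (λ x x∈ → cong (ℕ._* countLess x V) (count-complement x (proj₂ (∈-range⁻ x∈)))) ⟩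
      crossInversions 0 n V ∎
      where
      count-complement : ∀ x → x < n → Countℕ.count x (map (skipping V) u) ≡ 1 ∸ Countℕ.count x V
      count-complement x x<n = begin
        Countℕ.count x (map (skipping V) u)                                   ≡⟨ sym (ℕₚ.m+n∸n≡m _ (Countℕ.count x V)) ⟩
        Countℕ.count x (map (skipping V) u) ℕ.+ Countℕ.count x V ∸ Countℕ.count x V ≡⟨ cong (_∸ Countℕ.count x V) (sym (Countℕ.count-++ x (map (skipping V) u) V)) ⟩
        Countℕ.count x (glue V u) ∸ Countℕ.count x V                          ≡⟨ cong (_∸ Countℕ.count x V) (count-letter-Sn n (Countᴸ.count≡1⇒∈ (Sn n) count-glue-Sn) x x<n) ⟩
        1 ∸ Countℕ.count x V                                                  ∎

    inv-glue : inv (glue V u) ≡ crossInversions 0 n V ℕ.+ inv u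
    inv-glue = begin
      inv (glue V u)
        ≡⟨ inv-++ (map (skipping V) u) V ⟩
      inv (map (skipping V) u) ℕ.+ ℕΣ.sum (λ x → countLess x V) (map (skipping V) u) ℕ.+ inv V
        ≡⟨ cong₂ (λ a b → a ℕ.+ b ℕ.+ inv V) (inv-map (skipping-mono V) u) crossInversions-glue ⟩
      inv u ℕ.+ crossInversions 0 n V ℕ.+ inv V
        ≡⟨ cong (inv u ℕ.+ crossInversions 0 n V ℕ.+_) (inv-increasing V V-inc) ⟩
      inv u ℕ.+ crossInversions 0 n V ℕ.+ 0
        ≡⟨ trans (ℕₚ.+-identityʳ _) (ℕₚ.+-comm (inv u) _) ⟩
      crossInversions 0 n V ℕ.+ inv u ∎

    maj-take-glue : maj (take j (glue V u)) ≡ maj u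
    maj-take-glue = trans (cong maj take-glue) (majFrom-map (skipping-mono V) 1 u)

  count-withAscendingSuffix : ∀ w → w ∈ glued → Countᴸ.count w withAscendingSuffix ≡ 1
  count-withAscendingSuffix w w∈ with find (∈-concatMap⁻ (λ V → map (glue V) (Sn j)) {xs = subsets 0 n m} w∈)
  ... | V , V∈ , w∈′ with ∈-map⁻ (glue V) w∈′
  ... | u , u∈ , refl = Glued.count-glue-withAscendingSuffix (∈-subsets⁻ 0 n m V∈) u∈

  unglue : ∀ {w} → w ∈ withAscendingSuffix →
           IsSubset 0 n m (drop j w) × Σ (List ℕ) (λ u → Countᴸ.count u (Sn j) ≡ 1 × glue (drop j w) u ≡ w)
  unglue {w} w∈ with ∈-filter⁻ (T? ∘ ascending ∘ drop j) {xs = Sn n} w∈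
  ... | w∈Sn , suffix-asc with ∈-Sn⁻ n w∈Sn
  ... | w-distinct , |w| , w<n = V₀-subset , u₀ , count-Sn j u₀-distinct |u₀| u₀<j , trans (cong (_++ V₀) map-u₀) split
    where
    prefix = take j w
    V₀ = drop j w
    split : prefix ++ V₀ ≡ w
    split = take++drop≡id j w
    split-distinct = distinct-++⁻ prefix V₀ (trans (cong distinct split) w-distinct)
    V₀-subset : IsSubset 0 n m V₀
    V₀-subset = ascending∧distinct⇒increasing V₀ (T⇒≡true suffix-asc) (proj₁ (proj₂ split-distinct)) ,
                All.map (z≤n ,_) (Allₚ.drop⁺ j w<n) ,
                trans (length-drop j w) (cong (_∸ j) |w|)
    preimage = skipping-preimage n V₀ (proj₁ V₀-subset) (All.map proj₂ (proj₁ (proj₂ V₀-subset))) prefix (Allₚ.take⁺ j w<n)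
                 (All.map (λ {x} → notElem⇒All≢ x V₀) (proj₂ (proj₂ split-distinct)))
    u₀ = proj₁ preimage
    map-u₀ : map (skipping V₀) u₀ ≡ prefix
    map-u₀ = proj₁ (proj₂ preimage)
    |u₀| : length u₀ ≡ j
    |u₀| = trans (sym (length-map (skipping V₀) u₀))
             (trans (cong length map-u₀) (trans (length-take j w) (trans (cong (j ⊓_) |w|) (ℕₚ.m≤n⇒m⊓n≡m j≤n))))
    u₀<j : All (_< j) u₀
    u₀<j = All.map (λ {i} i+|V₀|<n → ℕₚ.+-cancelʳ-< m i j
             (subst (i ℕ.+ m <_) (sym j+m≡n) (subst (λ k → i ℕ.+ k < n) (proj₂ (proj₂ V₀-subset)) i+|V₀|<n)))
             (proj₂ (proj₂ preimage))
    u₀-distinct : distinct u₀ ≡ true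
    u₀-distinct = trans (sym (distinct-map (skipping-injective V₀) u₀)) (trans (cong distinct map-u₀) (proj₁ split-distinct))

  count-glued : ∀ w → w ∈ withAscendingSuffix → Countᴸ.count w glued ≡ 1
  count-glued w w∈ with unglue w∈
  ... | V₀-subset , u₀ , count-u₀ , glue-u₀ = begin
    Countᴸ.count w glued                                                ≡⟨ count-concatMap w (λ V → map (glue V) (Sn j)) (subsets 0 n m) ⟩
    ℕΣ.sum (λ V → Countᴸ.count w (map (glue V) (Sn j))) (subsets 0 n m) ≡⟨ ℕΣ.sum-cong (subsets 0 n m) count-per-suffix ⟩
    ℕΣ.sum (λ V → Countᴸ.δ V₀ V ℕ.* 1) (subsets 0 n m)                 ≡⟨ ℕΣ.sum-*ʳ 1 (Countᴸ.δ V₀) (subsets 0 n m) ⟩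
    ℕΣ.sum (Countᴸ.δ V₀) (subsets 0 n m) ℕ.* 1                         ≡⟨ cong (ℕ._* 1) (sym (count≡sum-δ (≡-dec ℕ._≟_) V₀ (subsets 0 n m))) ⟩
    Countᴸ.count V₀ (subsets 0 n m) ℕ.* 1                              ≡⟨ cong (ℕ._* 1) (count-subsets 0 n m V₀-subset) ⟩
    1                                                                  ∎
    where
    V₀ = drop j w
    glue-injective : ∀ {a b} → glue V₀ a ≡ glue V₀ b → a ≡ b
    glue-injective {a} {b} eq = map-injective (skipping-injective V₀) (++-cancelʳ V₀ (map (skipping V₀) a) (map (skipping V₀) b) eq)
    count-per-suffix : ∀ V → V ∈ subsets 0 n m → Countᴸ.count w (map (glue V) (Sn j)) ≡ Countᴸ.δ V₀ V ℕ.* 1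
    count-per-suffix V V∈ with ≡-dec ℕ._≟_ V₀ V
    ... | yes refl = begin
      Countᴸ.count w (map (glue V₀) (Sn j))            ≡⟨ cong (λ x → Countᴸ.count x (map (glue V₀) (Sn j))) (sym glue-u₀) ⟩
      Countᴸ.count (glue V₀ u₀) (map (glue V₀) (Sn j)) ≡⟨ Countᴸ.count-map glue-injective u₀ (Sn j) ⟩
      Countᴸ.count u₀ (Sn j)                           ≡⟨ count-u₀ ⟩
      1                                                ∎
    ... | no V₀≢V = Countᴸ.count-∉ _ w∉
      where
      w∉ : ¬ w ∈ map (glue V) (Sn j)
      w∉ w∈′ with ∈-map⁻ (glue V) w∈′
      ... | u , u∈ , w≡ = V₀≢V (trans (cong (drop j) w≡) (Glued.drop-glue (∈-subsets⁻ 0 n m V∈) u∈))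

  sum-withAscendingSuffix : ∀ p q →
    sum (λ w → indicator (ascending (drop j w)) * (p ^ℚ inv w * q ^ℚ maj (take j w))) (Sn n) ≡ qBinomial p n m * H j p q
  sum-withAscendingSuffix p q = begin
    sum (λ w → indicator (ascending (drop j w)) * weight w) (Sn n)
      ≡⟨ sym (sum-filter (ascending ∘ drop j) weight (Sn n)) ⟩
    sum weight withAscendingSuffix
      ≡⟨ sym (sum-reindex (≡-dec ℕ._≟_) weight glued withAscendingSuffix count-withAscendingSuffix count-glued) ⟩
    sum weight glued
      ≡⟨ sum-concatMap weight (λ V → map (glue V) (Sn j)) (subsets 0 n m) ⟩
    sum (λ V → sum weight (map (glue V) (Sn j))) (subsets 0 n m)
      ≡⟨ sum-cong (subsets 0 n m) (λ V V∈ → trans (sum-map weight (glue V) (Sn j)) (sum-cong (Sn j) (weight-glue V∈))) ⟩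
    sum (λ V → sum (λ u → p ^ℚ crossInversions 0 n V * (p ^ℚ inv u * q ^ℚ maj u)) (Sn j)) (subsets 0 n m)
      ≡⟨ sum-cong (subsets 0 n m) (λ V _ → sum-*ˡ (p ^ℚ crossInversions 0 n V) (λ u → p ^ℚ inv u * q ^ℚ maj u) (Sn j)) ⟩
    sum (λ V → p ^ℚ crossInversions 0 n V * H j p q) (subsets 0 n m)
      ≡⟨ sum-*ʳ (H j p q) (λ V → p ^ℚ crossInversions 0 n V) (subsets 0 n m) ⟩
    sum (λ V → p ^ℚ crossInversions 0 n V) (subsets 0 n m) * H j p q
      ≡⟨ cong (_* H j p q) (qBinomial-subsets p 0 n m) ⟩
    qBinomial p n m * H j p q ∎
    where
    weight : List ℕ → ℚ
    weight w = p ^ℚ inv w * q ^ℚ maj (take j w)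
    weight-glue : ∀ {V} → V ∈ subsets 0 n m → ∀ u → u ∈ Sn j → weight (glue V u) ≡ p ^ℚ crossInversions 0 n V * (p ^ℚ inv u * q ^ℚ maj u)
    weight-glue {V} V∈ u u∈ = begin
      p ^ℚ inv (glue V u) * q ^ℚ maj (take j (glue V u))       ≡⟨ cong₂ (λ a b → p ^ℚ a * q ^ℚ b) inv-glue maj-take-glue ⟩
      p ^ℚ (crossInversions 0 n V ℕ.+ inv u) * q ^ℚ maj u     ≡⟨ cong (_* q ^ℚ maj u) (^ℚ-+ p (crossInversions 0 n V) (inv u)) ⟩
      p ^ℚ crossInversions 0 n V * p ^ℚ inv u * q ^ℚ maj u    ≡⟨ ℚₚ.*-assoc (p ^ℚ crossInversions 0 n V) (p ^ℚ inv u) (q ^ℚ maj u) ⟩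
      p ^ℚ crossInversions 0 n V * (p ^ℚ inv u * q ^ℚ maj u)  ∎
      where open Glued (∈-subsets⁻ 0 n m V∈) u∈

H-recurrence : ∀ p q n →
  H (suc n) p q ≡ sum (λ j → q ^ℚ j * qPochhammer q (suc j) (n ∸ j) * (qBinomial p (suc n) (suc n ∸ j) * H j p q)) (upTo (suc n))
H-recurrence p q n = begin
  sum (λ w → p ^ℚ inv w * q ^ℚ maj w) (Sn (suc n))
    ≡⟨ sum-cong (Sn (suc n)) (λ w w∈ → cong (p ^ℚ inv w *_) (q^maj-expansion n w (proj₁ (proj₂ (∈-Sn⁻ (suc n) w∈))))) ⟩
  sum (λ w → p ^ℚ inv w * sum (term w) (upTo (suc n))) (Sn (suc n))
    ≡⟨ sum-cong (Sn (suc n)) (λ w _ → sym (sum-*ˡ (p ^ℚ inv w) (term w) (upTo (suc n)))) ⟩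
  sum (λ w → sum (λ j → p ^ℚ inv w * term w j) (upTo (suc n))) (Sn (suc n))
    ≡⟨ sum-comm (λ w j → p ^ℚ inv w * term w j) (Sn (suc n)) (upTo (suc n)) ⟩
  sum (λ j → sum (λ w → p ^ℚ inv w * term w j) (Sn (suc n))) (upTo (suc n))
    ≡⟨ sum-upTo-cong (suc n) (λ j j<1+n → sum-over-j j (ℕₚ.m≤n⇒m≤1+n (ℕₚ.≤-pred j<1+n))) ⟩
  sum (λ j → q ^ℚ j * qPochhammer q (suc j) (n ∸ j) * (qBinomial p (suc n) (suc n ∸ j) * H j p q)) (upTo (suc n)) ∎
  where
  open DescentExpansion q
  term : List ℕ → ℕ → ℚ
  term w = ascendingSuffixTerm q w n
  sum-over-j : ∀ j → j ≤ suc n →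
    sum (λ w → p ^ℚ inv w * term w j) (Sn (suc n)) ≡ q ^ℚ j * qPochhammer q (suc j) (n ∸ j) * (qBinomial p (suc n) (suc n ∸ j) * H j p q)
  sum-over-j j j≤1+n = begin
    sum (λ w → p ^ℚ inv w * term w j) (Sn (suc n))
      ≡⟨ sum-cong (Sn (suc n)) (λ w _ → solve 5 (λ a b c d e → e :* (a :* (b :* (c :* d))) := (c :* d) :* (a :* (e :* b))) refl
                                         (indicator (ascending (drop j w))) (q ^ℚ maj (take j w)) (q ^ℚ j) (qPochhammer q (suc j) (n ∸ j)) (p ^ℚ inv w)) ⟩
    sum (λ w → c * (indicator (ascending (drop j w)) * (p ^ℚ inv w * q ^ℚ maj (take j w)))) (Sn (suc n))
      ≡⟨ sum-*ˡ c _ (Sn (suc n)) ⟩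
    c * sum (λ w → indicator (ascending (drop j w)) * (p ^ℚ inv w * q ^ℚ maj (take j w))) (Sn (suc n))
      ≡⟨ cong (c *_) (AscendingSuffix.sum-withAscendingSuffix (suc n) j j≤1+n p q) ⟩
    c * (qBinomial p (suc n) (suc n ∸ j) * H j p q) ∎
    where
    c = q ^ℚ j * qPochhammer q (suc j) (n ∸ j)

*-cancelʳ-≢0 : ∀ {x y} b → b ≢ 0ℚ → x * b ≡ y * b → x ≡ y
*-cancelʳ-≢0 {x} {y} b b≢0 eq = begin
  x                    ≡⟨ solve 2 (λ x i → x := x :* con 1ℚ) refl x (1/ b) ⟩
  x * 1ℚ               ≡⟨ cong (x *_) (sym b*b⁻¹≡1) ⟩
  x * (b * 1/ b)       ≡⟨ sym (ℚₚ.*-assoc x b _) ⟩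
  x * b * 1/ b         ≡⟨ cong (_* 1/ b) eq ⟩
  y * b * 1/ b         ≡⟨ ℚₚ.*-assoc y b _ ⟩
  y * (b * 1/ b)       ≡⟨ cong (y *_) b*b⁻¹≡1 ⟩
  y * 1ℚ               ≡⟨ ℚₚ.*-identityʳ y ⟩
  y                    ∎
  where
  instance _ = ≢-nonZero b≢0
  b*b⁻¹≡1 : b * 1/ b ≡ 1ℚ
  b*b⁻¹≡1 = ℚₚ.*-inverseʳ b

*-cancelˡ-≢0 : ∀ {x y} c → c ≢ 0ℚ → c * x ≡ c * y → x ≡ y
*-cancelˡ-≢0 {x} {y} c c≢0 eq = *-cancelʳ-≢0 c c≢0 (trans (ℚₚ.*-comm x c) (trans eq (ℚₚ.*-comm c y)))

*-≢0 : ∀ {a b} → a ≢ 0ℚ → b ≢ 0ℚ → a * b ≢ 0ℚ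
*-≢0 {a} {b} a≢0 b≢0 a*b≡0 = a≢0 (*-cancelʳ-≢0 b b≢0 (trans a*b≡0 (sym (ℚₚ.*-zeroˡ b))))

div-*-cancel : ∀ a b → b ≢ 0ℚ → (a div b) * b ≡ a
div-*-cancel a b b≢0 with b ℚₚ.≟ 0ℚ
... | yes b≡0 = ⊥-elim (b≢0 b≡0)
... | no _    = begin
  a * 1/ b * b    ≡⟨ ℚₚ.*-assoc a _ b ⟩
  a * (1/ b * b)  ≡⟨ cong (a *_) (ℚₚ.*-inverseˡ b) ⟩
  a * 1ℚ          ≡⟨ ℚₚ.*-identityʳ a ⟩
  a               ∎
  where instance _ = ≢-nonZero b≢0

div-unique : ∀ {x} a b → b ≢ 0ℚ → x * b ≡ a → a div b ≡ x
div-unique a b b≢0 eq = *-cancelʳ-≢0 b b≢0 (trans (div-*-cancel a b b≢0) (sym eq))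

ℕtoℚ≡mkℚ : ∀ k → ℕtoℚ k ≡ mkℚ (ℤ.+ k) 0 (Coprimality.sym (Coprimality.1-coprimeTo k))
ℕtoℚ≡mkℚ k = ℚₚ.↥p/↧p≡p (mkℚ (ℤ.+ k) 0 (Coprimality.sym (Coprimality.1-coprimeTo k)))

ℕtoℚ-suc : ∀ k → ℕtoℚ (suc k) ≡ 1ℚ + ℕtoℚ k
ℕtoℚ-suc k = sym (trans (cong (1ℚ +_) (ℕtoℚ≡mkℚ k))
                        (cong (λ z → (ℤ.+ 1 ℤ.* ℤ.+ 1 ℤ.+ z) / 1) (ℤₚ.*-identityʳ (ℤ.+ k))))

fromℕ≡ℕtoℚ : ∀ k → fromℕ k ≡ ℕtoℚ k
fromℕ≡ℕtoℚ zero    = refl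
fromℕ≡ℕtoℚ (suc k) = trans (cong (1ℚ +_) (fromℕ≡ℕtoℚ k)) (sym (ℕtoℚ-suc k))

ℕtoℚ-suc≢0 : ∀ k → ℕtoℚ (suc k) ≢ 0ℚ
ℕtoℚ-suc≢0 k eq with trans (sym (ℕtoℚ≡mkℚ (suc k))) eq
... | ()

fromℕ-suc≢0 : ∀ k → fromℕ (suc k) ≢ 0ℚ
fromℕ-suc≢0 k eq = ℕtoℚ-suc≢0 k (trans (sym (fromℕ≡ℕtoℚ (suc k))) eq)

fromℕ-!≢0 : ∀ n → fromℕ (n !) ≢ 0ℚ
fromℕ-!≢0 n with n ! | ℕₚ.1≤n! n
... | suc k | _ = fromℕ-suc≢0 k

^ℚ-distrib-* : ∀ a b m → (a * b) ^ℚ m ≡ a ^ℚ m * b ^ℚ m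
^ℚ-distrib-* a b zero    = sym (ℚₚ.*-identityˡ 1ℚ)
^ℚ-distrib-* a b (suc m) = trans (cong (a * b *_) (^ℚ-distrib-* a b m))
  (solve 4 (λ a b c d → (a :* b) :* (c :* d) := (a :* c) :* (b :* d)) refl a b (a ^ℚ m) (b ^ℚ m))

qint-suc : ∀ p k → qint p (suc k) ≡ 1ℚ + p * qint p k
qint-suc p k = trans (sum-upTo-sucˡ (p ^ℚ_) k) (cong (1ℚ +_) (sum-*ˡ p (p ^ℚ_) (upTo k)))

qint-+ : ∀ p a b → qint p (a ℕ.+ b) ≡ qint p a + p ^ℚ a * qint p b
qint-+ p zero    b = sym (trans (ℚₚ.+-identityˡ _) (ℚₚ.*-identityˡ _))
qint-+ p (suc a) b = begin
  qint p (suc (a ℕ.+ b))                         ≡⟨ qint-suc p (a ℕ.+ b) ⟩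
  1ℚ + p * qint p (a ℕ.+ b)                      ≡⟨ cong (λ z → 1ℚ + p * z) (qint-+ p a b) ⟩
  1ℚ + p * (qint p a + p ^ℚ a * qint p b)        ≡⟨ solve 4 (λ p x y z → con 1ℚ :+ p :* (x :+ y :* z) := (con 1ℚ :+ p :* x) :+ p :* y :* z) refl
                                                      p (qint p a) (p ^ℚ a) (qint p b) ⟩
  (1ℚ + p * qint p a) + p * p ^ℚ a * qint p b    ≡⟨ cong (_+ p * p ^ℚ a * qint p b) (sym (qint-suc p a)) ⟩
  qint p (suc a) + p * p ^ℚ a * qint p b         ∎

1-^ℚ : ∀ p i → 1ℚ - p ^ℚ i ≡ (1ℚ - p) * qint p i
1-^ℚ p zero    = sym (ℚₚ.*-zeroʳ (1ℚ - p))
1-^ℚ p (suc i) = begin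
  1ℚ - p * p ^ℚ i                       ≡⟨ solve 2 (λ p y → con 1ℚ :- p :* y := (con 1ℚ :- p) :+ p :* (con 1ℚ :- y)) refl p (p ^ℚ i) ⟩
  (1ℚ - p) + p * (1ℚ - p ^ℚ i)          ≡⟨ cong (λ z → (1ℚ - p) + p * z) (1-^ℚ p i) ⟩
  (1ℚ - p) + p * ((1ℚ - p) * qint p i)  ≡⟨ solve 2 (λ p y → (con 1ℚ :- p) :+ p :* ((con 1ℚ :- p) :* y) := (con 1ℚ :- p) :* (con 1ℚ :+ p :* y)) refl p (qint p i) ⟩
  (1ℚ - p) * (1ℚ + p * qint p i)        ≡⟨ cong ((1ℚ - p) *_) (sym (qint-suc p i)) ⟩
  (1ℚ - p) * qint p (suc i)             ∎

QIntsNonZero : ℚ → ℕ → Set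
QIntsNonZero p N = ∀ k → 1 ≤ k → k ≤ N → qint p k ≢ 0ℚ

qfact-≢0 : ∀ {p N} → QIntsNonZero p N → ∀ k → k ≤ N → qfact p k ≢ 0ℚ
qfact-≢0 nz zero    _     = λ ()
qfact-≢0 nz (suc k) 1+k≤N = *-≢0 (nz (suc k) (s≤s z≤n) 1+k≤N) (qfact-≢0 nz k (ℕₚ.≤-trans (ℕₚ.n≤1+n k) 1+k≤N))

qPochhammer-qfact : ∀ q j k → qPochhammer q (suc j) k * qfact q j ≡ (1ℚ - q) ^ℚ k * qfact q (j ℕ.+ k)
qPochhammer-qfact q j zero    = trans (ℚₚ.*-identityˡ _) (sym (trans (ℚₚ.*-identityˡ _) (cong (qfact q) (ℕₚ.+-identityʳ j))))
qPochhammer-qfact q j (suc k) = begin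
  qPochhammer q (suc j) k * (1ℚ - q ^ℚ (suc j ℕ.+ k)) * qfact q j
    ≡⟨ solve 3 (λ a b c → a :* b :* c := (a :* c) :* b) refl (qPochhammer q (suc j) k) _ (qfact q j) ⟩
  qPochhammer q (suc j) k * qfact q j * (1ℚ - q ^ℚ (suc j ℕ.+ k))
    ≡⟨ cong₂ _*_ (qPochhammer-qfact q j k) (1-^ℚ q (suc j ℕ.+ k)) ⟩
  (1ℚ - q) ^ℚ k * qfact q (j ℕ.+ k) * ((1ℚ - q) * qint q (suc j ℕ.+ k))
    ≡⟨ solve 4 (λ a b c d → (a :* b) :* (c :* d) := (c :* a) :* (d :* b)) refl ((1ℚ - q) ^ℚ k) (qfact q (j ℕ.+ k)) (1ℚ - q) (qint q (suc j ℕ.+ k)) ⟩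
  (1ℚ - q) ^ℚ suc k * qfact q (suc (j ℕ.+ k))
    ≡⟨ cong (λ z → (1ℚ - q) ^ℚ suc k * qfact q z) (sym (ℕₚ.+-suc j k)) ⟩
  (1ℚ - q) ^ℚ suc k * qfact q (j ℕ.+ suc k) ∎

qBinomial-> : ∀ p N K → N < K → qBinomial p N K ≡ 0ℚ
qBinomial-> p zero    (suc K) _         = refl
qBinomial-> p (suc N) (suc K) (s≤s N<K) = begin
  p ^ℚ (N ∸ K) * qBinomial p N K + qBinomial p N (suc K)
    ≡⟨ cong₂ (λ a b → p ^ℚ (N ∸ K) * a + b) (qBinomial-> p N K N<K) (qBinomial-> p N (suc K) (ℕₚ.m<n⇒m<1+n N<K)) ⟩
  p ^ℚ (N ∸ K) * 0ℚ + 0ℚ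
    ≡⟨ trans (ℚₚ.+-identityʳ _) (ℚₚ.*-zeroʳ (p ^ℚ (N ∸ K))) ⟩
  0ℚ ∎

qBinomial-qfact : ∀ p N K → K ≤ N → qBinomial p N K * qfact p K * qfact p (N ∸ K) ≡ qfact p N
qBinomial-qfact p zero    zero    _         = refl
qBinomial-qfact p (suc n) zero    _         = trans (cong (_* qfact p (suc n)) (ℚₚ.*-identityˡ 1ℚ)) (ℚₚ.*-identityˡ _)
qBinomial-qfact p (suc n) (suc k) (s≤s k≤n) = begin
  (p ^ℚ (n ∸ k) * qBinomial p n k + qBinomial p n (suc k)) * (qint p (suc k) * qfact p k) * qfact p (n ∸ k)
    ≡⟨ solve 6 (λ a b c d e f → (a :* b :+ c) :* (d :* e) :* f := a :* d :* (b :* e :* f) :+ c :* d :* e :* f) refl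
         (p ^ℚ (n ∸ k)) (qBinomial p n k) (qBinomial p n (suc k)) (qint p (suc k)) (qfact p k) (qfact p (n ∸ k)) ⟩
  p ^ℚ (n ∸ k) * qint p (suc k) * (qBinomial p n k * qfact p k * qfact p (n ∸ k))
    + qBinomial p n (suc k) * qint p (suc k) * qfact p k * qfact p (n ∸ k)
    ≡⟨ cong₂ _+_ (cong (p ^ℚ (n ∸ k) * qint p (suc k) *_) (qBinomial-qfact p n k k≤n)) (next-term (ℕₚ.m≤n⇒m<n∨m≡n k≤n)) ⟩
  p ^ℚ (n ∸ k) * qint p (suc k) * qfact p n + qint p (n ∸ k) * qfact p n
    ≡⟨ solve 4 (λ a b c d → a :* b :* c :+ d :* c := (d :+ a :* b) :* c) refl (p ^ℚ (n ∸ k)) (qint p (suc k)) (qfact p n) (qint p (n ∸ k)) ⟩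
  (qint p (n ∸ k) + p ^ℚ (n ∸ k) * qint p (suc k)) * qfact p n
    ≡⟨ cong (_* qfact p n) (sym (qint-+ p (n ∸ k) (suc k))) ⟩
  qint p (n ∸ k ℕ.+ suc k) * qfact p n
    ≡⟨ cong (λ z → qint p z * qfact p n) (trans (ℕₚ.+-suc (n ∸ k) k) (cong suc (ℕₚ.m∸n+n≡m k≤n))) ⟩
  qint p (suc n) * qfact p n ∎
  where
  next-term : k < n ⊎ k ≡ n → qBinomial p n (suc k) * qint p (suc k) * qfact p k * qfact p (n ∸ k) ≡ qint p (n ∸ k) * qfact p n
  next-term (inj₂ refl) = begin
    qBinomial p k (suc k) * qint p (suc k) * qfact p k * qfact p (k ∸ k)
      ≡⟨ cong (λ z → z * qint p (suc k) * qfact p k * qfact p (k ∸ k)) (qBinomial-> p k (suc k) (ℕₚ.n<1+n k)) ⟩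
    0ℚ * qint p (suc k) * qfact p k * qfact p (k ∸ k)
      ≡⟨ solve 3 (λ a b c → con 0ℚ :* a :* b :* c := con 0ℚ) refl (qint p (suc k)) (qfact p k) (qfact p (k ∸ k)) ⟩
    0ℚ
      ≡⟨ sym (trans (cong (λ z → qint p z * qfact p k) (ℕₚ.n∸n≡0 k)) (ℚₚ.*-zeroˡ (qfact p k))) ⟩
    qint p (k ∸ k) * qfact p k ∎
  next-term (inj₁ k<n) = begin
    qBinomial p n (suc k) * qint p (suc k) * qfact p k * qfact p (n ∸ k)
      ≡⟨ cong (λ z → qBinomial p n (suc k) * qint p (suc k) * qfact p k * qfact p z) n∸k≡1+n∸1+k ⟩
    qBinomial p n (suc k) * qint p (suc k) * qfact p k * (qint p (suc (n ∸ suc k)) * qfact p (n ∸ suc k))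
      ≡⟨ solve 5 (λ a b c d e → a :* b :* c :* (d :* e) := d :* (a :* (b :* c) :* e)) refl
           (qBinomial p n (suc k)) (qint p (suc k)) (qfact p k) (qint p (suc (n ∸ suc k))) (qfact p (n ∸ suc k)) ⟩
    qint p (suc (n ∸ suc k)) * (qBinomial p n (suc k) * qfact p (suc k) * qfact p (n ∸ suc k))
      ≡⟨ cong₂ _*_ (cong (qint p) (sym n∸k≡1+n∸1+k)) (qBinomial-qfact p n (suc k) k<n) ⟩
    qint p (n ∸ k) * qfact p n ∎
    where
    n∸k≡1+n∸1+k : n ∸ k ≡ suc (n ∸ suc k)
    n∸k≡1+n∸1+k = ℕₚ.+-∸-assoc 1 k<n

infixl 7 _⋆_

_⋆_ : (ℕ → ℚ) → (ℕ → ℚ) → ℕ → ℚ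
(f ⋆ g) n = sum (λ i → f (n ∸ i) * g i) (upTo (suc n))

e₀ : ℕ → ℚ
e₀ zero    = 1ℚ
e₀ (suc k) = 0ℚ

module _ (f g : ℕ → ℚ) where

  ⋆-comm : ∀ n → (f ⋆ g) n ≡ (g ⋆ f) n
  ⋆-comm n = begin
    sum (λ i → f (n ∸ i) * g i) (upTo (suc n))              ≡⟨ sum-upTo-reverse (λ i → f (n ∸ i) * g i) n ⟩
    sum (λ i → f (n ∸ (n ∸ i)) * g (n ∸ i)) (upTo (suc n))  ≡⟨ sum-upTo-cong (suc n) (λ i i<1+n →
                                                                 trans (cong (λ k → f k * g (n ∸ i)) (ℕₚ.m∸[m∸n]≡n (ℕₚ.≤-pred i<1+n))) (ℚₚ.*-comm (f i) _)) ⟩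
    sum (λ i → g (n ∸ i) * f i) (upTo (suc n))              ∎

  ⋆-leibniz : ∀ n → fromℕ n * (f ⋆ g) n ≡ ((λ k → fromℕ k * f k) ⋆ g) n + (f ⋆ (λ k → fromℕ k * g k)) n
  ⋆-leibniz n = begin
    fromℕ n * sum (λ i → f (n ∸ i) * g i) (upTo (suc n))
      ≡⟨ sym (sum-*ˡ (fromℕ n) _ (upTo (suc n))) ⟩
    sum (λ i → fromℕ n * (f (n ∸ i) * g i)) (upTo (suc n))
      ≡⟨ sum-upTo-cong (suc n) split ⟩
    sum (λ i → fromℕ (n ∸ i) * f (n ∸ i) * g i + f (n ∸ i) * (fromℕ i * g i)) (upTo (suc n))
      ≡⟨ sum-+ (λ i → fromℕ (n ∸ i) * f (n ∸ i) * g i) (λ i → f (n ∸ i) * (fromℕ i * g i)) (upTo (suc n)) ⟩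
    ((λ k → fromℕ k * f k) ⋆ g) n + (f ⋆ (λ k → fromℕ k * g k)) n ∎
    where
    split : ∀ i → i < suc n → fromℕ n * (f (n ∸ i) * g i) ≡ fromℕ (n ∸ i) * f (n ∸ i) * g i + f (n ∸ i) * (fromℕ i * g i)
    split i i<1+n = begin
      fromℕ n * (f (n ∸ i) * g i)                  ≡⟨ cong (λ k → fromℕ k * (f (n ∸ i) * g i)) (sym (ℕₚ.m∸n+n≡m (ℕₚ.≤-pred i<1+n))) ⟩
      fromℕ (n ∸ i ℕ.+ i) * (f (n ∸ i) * g i)      ≡⟨ cong (_* (f (n ∸ i) * g i)) (fromℕ-+ (n ∸ i) i) ⟩
      (fromℕ (n ∸ i) + fromℕ i) * (f (n ∸ i) * g i) ≡⟨ solve 4 (λ a b x y → (a :+ b) :* (x :* y) := a :* x :* y :+ x :* (b :* y)) refl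
                                                          (fromℕ (n ∸ i)) (fromℕ i) (f (n ∸ i)) (g i) ⟩
      fromℕ (n ∸ i) * f (n ∸ i) * g i + f (n ∸ i) * (fromℕ i * g i) ∎

  ⋆-scale : ∀ q n → q ^ℚ n * (f ⋆ g) n ≡ ((λ k → q ^ℚ k * f k) ⋆ (λ k → q ^ℚ k * g k)) n
  ⋆-scale q n = begin
    q ^ℚ n * sum (λ i → f (n ∸ i) * g i) (upTo (suc n))      ≡⟨ sym (sum-*ˡ (q ^ℚ n) _ (upTo (suc n))) ⟩
    sum (λ i → q ^ℚ n * (f (n ∸ i) * g i)) (upTo (suc n))    ≡⟨ sum-upTo-cong (suc n) split ⟩
    ((λ k → q ^ℚ k * f k) ⋆ (λ k → q ^ℚ k * g k)) n           ∎
    where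
    split : ∀ i → i < suc n → q ^ℚ n * (f (n ∸ i) * g i) ≡ q ^ℚ (n ∸ i) * f (n ∸ i) * (q ^ℚ i * g i)
    split i i<1+n = begin
      q ^ℚ n * (f (n ∸ i) * g i)                   ≡⟨ cong (λ k → q ^ℚ k * (f (n ∸ i) * g i)) (sym (ℕₚ.m∸n+n≡m (ℕₚ.≤-pred i<1+n))) ⟩
      q ^ℚ (n ∸ i ℕ.+ i) * (f (n ∸ i) * g i)       ≡⟨ cong (_* (f (n ∸ i) * g i)) (^ℚ-+ q (n ∸ i) i) ⟩
      q ^ℚ (n ∸ i) * q ^ℚ i * (f (n ∸ i) * g i)    ≡⟨ solve 4 (λ a b x y → (a :* b) :* (x :* y) := (a :* x) :* (b :* y)) refl
                                                        (q ^ℚ (n ∸ i)) (q ^ℚ i) (f (n ∸ i)) (g i) ⟩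
      q ^ℚ (n ∸ i) * f (n ∸ i) * (q ^ℚ i * g i)    ∎

⋆-assoc : ∀ f g h n → (f ⋆ (g ⋆ h)) n ≡ ((f ⋆ g) ⋆ h) n
⋆-assoc f g h n = begin
  sum (λ i → f (n ∸ i) * (g ⋆ h) i) (upTo (suc n))
    ≡⟨ sum-cong (upTo (suc n)) (λ i _ → sym (sum-*ˡ (f (n ∸ i)) (λ l → g (i ∸ l) * h l) (upTo (suc i)))) ⟩
  sum (λ i → sum (λ l → f (n ∸ i) * (g (i ∸ l) * h l)) (upTo (suc i))) (upTo (suc n))
    ≡⟨ sum-upTo-triangle (λ i l → f (n ∸ i) * (g (i ∸ l) * h l)) (suc n) ⟩
  sum (λ l → sum (λ s → f (n ∸ (l ℕ.+ s)) * (g (l ℕ.+ s ∸ l) * h l)) (upTo (suc n ∸ l))) (upTo (suc n))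
    ≡⟨ sum-upTo-cong (suc n) column ⟩
  sum (λ l → (f ⋆ g) (n ∸ l) * h l) (upTo (suc n)) ∎
  where
  column : ∀ l → l < suc n → sum (λ s → f (n ∸ (l ℕ.+ s)) * (g (l ℕ.+ s ∸ l) * h l)) (upTo (suc n ∸ l)) ≡ (f ⋆ g) (n ∸ l) * h l
  column l l<1+n = begin
    sum (λ s → f (n ∸ (l ℕ.+ s)) * (g (l ℕ.+ s ∸ l) * h l)) (upTo (suc n ∸ l))
      ≡⟨ cong (λ k → sum (λ s → f (n ∸ (l ℕ.+ s)) * (g (l ℕ.+ s ∸ l) * h l)) (upTo k)) (ℕₚ.+-∸-assoc 1 (ℕₚ.≤-pred l<1+n)) ⟩
    sum (λ s → f (n ∸ (l ℕ.+ s)) * (g (l ℕ.+ s ∸ l) * h l)) (upTo (suc (n ∸ l)))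
      ≡⟨ sum-cong (upTo (suc (n ∸ l))) (λ s _ → trans (cong₂ (λ a b → f a * (g b * h l)) (sym (ℕₚ.∸-+-assoc n l s)) (ℕₚ.m+n∸m≡n l s))
                                                      (sym (ℚₚ.*-assoc (f (n ∸ l ∸ s)) (g s) (h l)))) ⟩
    sum (λ s → f (n ∸ l ∸ s) * g s * h l) (upTo (suc (n ∸ l)))
      ≡⟨ sum-*ʳ (h l) (λ s → f (n ∸ l ∸ s) * g s) (upTo (suc (n ∸ l))) ⟩
    (f ⋆ g) (n ∸ l) * h l ∎

⋆-cong : ∀ {f f′ g g′} n → (∀ k → k ≤ n → f k ≡ f′ k) → (∀ k → k ≤ n → g k ≡ g′ k) → (f ⋆ g) n ≡ (f′ ⋆ g′) n
⋆-cong n f≗f′ g≗g′ = sum-upTo-cong (suc n) (λ i i<1+n → cong₂ _*_ (f≗f′ _ (ℕₚ.m∸n≤m n i)) (g≗g′ i (ℕₚ.≤-pred i<1+n)))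

⋆-congʳ-< : ∀ f {g g′} n → f 0 ≡ 0ℚ → (∀ k → k < n → g k ≡ g′ k) → (f ⋆ g) n ≡ (f ⋆ g′) n
⋆-congʳ-< f {g} {g′} n f0≡0 g≗g′ = sum-upTo-cong (suc n) termwise
  where
  termwise : ∀ i → i < suc n → f (n ∸ i) * g i ≡ f (n ∸ i) * g′ i
  termwise i i<1+n with ℕₚ.m≤n⇒m<n∨m≡n (ℕₚ.≤-pred i<1+n)
  ... | inj₁ i<n  = cong (f (n ∸ i) *_) (g≗g′ i i<n)
  ... | inj₂ refl = begin
    f (i ∸ i) * g i   ≡⟨ cong (λ k → f k * g i) (ℕₚ.n∸n≡0 i) ⟩
    f 0 * g i         ≡⟨ cong (_* g i) f0≡0 ⟩
    0ℚ * g i          ≡⟨ trans (ℚₚ.*-zeroˡ (g i)) (sym (ℚₚ.*-zeroˡ (g′ i))) ⟩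
    0ℚ * g′ i         ≡⟨ cong (_* g′ i) (sym f0≡0) ⟩
    f 0 * g′ i        ≡⟨ cong (λ k → f k * g′ i) (sym (ℕₚ.n∸n≡0 i)) ⟩
    f (i ∸ i) * g′ i  ∎

⋆-distribˡ-+ : ∀ f g g′ n → (f ⋆ (λ k → g k + g′ k)) n ≡ (f ⋆ g) n + (f ⋆ g′) n
⋆-distribˡ-+ f g g′ n = trans (sum-cong (upTo (suc n)) (λ i _ → ℚₚ.*-distribˡ-+ (f (n ∸ i)) (g i) (g′ i))) (sum-+ (λ i → f (n ∸ i) * g i) (λ i → f (n ∸ i) * g′ i) (upTo (suc n)))

⋆-*ˡ : ∀ c f g n → (f ⋆ (λ k → c * g k)) n ≡ c * (f ⋆ g) n
⋆-*ˡ c f g n = trans (sum-cong (upTo (suc n)) (λ i _ → solve 3 (λ c a b → a :* (c :* b) := c :* (a :* b)) refl c (f (n ∸ i)) (g i)))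
                     (sum-*ˡ c (λ i → f (n ∸ i) * g i) (upTo (suc n)))

⋆-identityʳ : ∀ f n → (f ⋆ e₀) n ≡ f n
⋆-identityʳ f n = begin
  (f ⋆ e₀) n                                            ≡⟨ sum-upTo-sucˡ (λ i → f (n ∸ i) * e₀ i) n ⟩
  f n * 1ℚ + sum (λ i → f (n ∸ suc i) * 0ℚ) (upTo n)    ≡⟨ cong₂ _+_ (ℚₚ.*-identityʳ (f n)) (trans (sum-cong (upTo n) (λ i _ → ℚₚ.*-zeroʳ (f (n ∸ suc i)))) (sum-zero (upTo n))) ⟩
  f n + 0ℚ                                              ≡⟨ ℚₚ.+-identityʳ (f n) ⟩
  f n                                                   ∎

τ : ℚ → ℕ → ℕ → ℚ
τ p r k = (p ^ℚ (r ∸ k) * (qfact p r * (1ℚ - p) ^ℚ k)) div qfact p (r ∸ k)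

ω : ℚ → ℕ → ℕ → ℚ
ω p n k = ((1ℚ - p) ^ℚ k * qfact p (suc n)) div (qint p (suc k) * qfact p (n ∸ k))

module _ {p : ℚ} {N : ℕ} (nz : QIntsNonZero p N) where

  private
    qint≢0 : ∀ k → k < N → qint p (suc k) ≢ 0ℚ
    qint≢0 k k<N = nz (suc k) (s≤s z≤n) k<N
    qfact≢0 : ∀ k → k ≤ N → qfact p k ≢ 0ℚ
    qfact≢0 = qfact-≢0 nz

  sum-τ : ∀ r → r ≤ N → sum (τ p r) (upTo (suc r)) ≡ 1ℚ
  sum-τ zero    _     = cong (_+ 0ℚ) (div-unique {x = 1ℚ} _ 1ℚ (λ ()) refl)
  sum-τ (suc r) 1+r≤N = begin
    sum (τ p (suc r)) (upTo (2 ℕ.+ r))                       ≡⟨ sum-upTo-sucˡ (τ p (suc r)) (suc r) ⟩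
    τ p (suc r) 0 + sum (τ p (suc r) ∘ suc) (upTo (suc r))     ≡⟨ cong₂ _+_ τ-0 (sum-cong (upTo (suc r)) (λ k _ → τ-suc k)) ⟩
    p ^ℚ suc r + sum (λ k → (1ℚ - p ^ℚ suc r) * τ p r k) (upTo (suc r))
      ≡⟨ cong (p ^ℚ suc r +_) (trans (sum-*ˡ (1ℚ - p ^ℚ suc r) (τ p r) (upTo (suc r))) (cong ((1ℚ - p ^ℚ suc r) *_) (sum-τ r (ℕₚ.<⇒≤ 1+r≤N)))) ⟩
    p ^ℚ suc r + (1ℚ - p ^ℚ suc r) * 1ℚ                      ≡⟨ solve 1 (λ y → y :+ (con 1ℚ :- y) :* con 1ℚ := con 1ℚ) refl (p ^ℚ suc r) ⟩
    1ℚ                                                       ∎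
    where
    τ-0 : τ p (suc r) 0 ≡ p ^ℚ suc r
    τ-0 = div-unique _ (qfact p (suc r)) (qfact≢0 (suc r) 1+r≤N)
            (solve 2 (λ y z → y :* z := y :* (z :* con 1ℚ)) refl (p ^ℚ suc r) (qfact p (suc r)))
    τ-suc : ∀ k → τ p (suc r) (suc k) ≡ (1ℚ - p ^ℚ suc r) * τ p r k
    τ-suc k = div-unique _ (qfact p (r ∸ k)) [r-k]!≢0 (begin
      (1ℚ - p ^ℚ suc r) * τ p r k * qfact p (r ∸ k)
        ≡⟨ ℚₚ.*-assoc (1ℚ - p ^ℚ suc r) (τ p r k) (qfact p (r ∸ k)) ⟩
      (1ℚ - p ^ℚ suc r) * (τ p r k * qfact p (r ∸ k))
        ≡⟨ cong₂ _*_ (1-^ℚ p (suc r)) (div-*-cancel _ (qfact p (r ∸ k)) [r-k]!≢0) ⟩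
      (1ℚ - p) * qint p (suc r) * (p ^ℚ (r ∸ k) * (qfact p r * (1ℚ - p) ^ℚ k))
        ≡⟨ solve 5 (λ c d e f g → (c :* d) :* (e :* (f :* g)) := e :* ((d :* f) :* (c :* g))) refl
             (1ℚ - p) (qint p (suc r)) (p ^ℚ (r ∸ k)) (qfact p r) ((1ℚ - p) ^ℚ k) ⟩
      p ^ℚ (r ∸ k) * (qfact p (suc r) * (1ℚ - p) ^ℚ suc k) ∎)
      where
      [r-k]!≢0 = qfact≢0 (r ∸ k) (ℕₚ.≤-trans (ℕₚ.m∸n≤m r k) (ℕₚ.<⇒≤ 1+r≤N))

  ω-split : ∀ n → suc n < N → ∀ k → k < suc n → ω p (suc n) k ≡ ω p n k + τ p (suc n) k
  ω-split n 2+n≤N k k<1+n = div-unique _ D D≢0 (begin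
    (ω p n k + τ p (suc n) k) * D
      ≡⟨ cong (λ z → (ω p n k + τ p (suc n) k) * (qint p (suc k) * qfact p z)) 1+n∸k≡ ⟩
    (ω p n k + τ p (suc n) k) * (qint p (suc k) * qfact p (suc (n ∸ k)))
      ≡⟨ solve 5 (λ w t a b c → (w :+ t) :* (a :* (b :* c)) := (w :* (a :* c)) :* b :+ (t :* (b :* c)) :* a) refl
           (ω p n k) (τ p (suc n) k) (qint p (suc k)) (qint p (suc (n ∸ k))) (qfact p (n ∸ k)) ⟩
    ω p n k * (qint p (suc k) * qfact p (n ∸ k)) * qint p (suc (n ∸ k)) + τ p (suc n) k * qfact p (suc (n ∸ k)) * qint p (suc k)
      ≡⟨ cong₂ (λ u v → u * qint p (suc (n ∸ k)) + v * qint p (suc k))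
           (div-*-cancel _ _ (*-≢0 (qint≢0 k (≤N k<1+n)) (qfact≢0 (n ∸ k) (≤N (ℕₚ.m≤n⇒m≤1+n (ℕₚ.m∸n≤m n k))))))
           (trans (cong (λ z → τ p (suc n) k * qfact p z) (sym 1+n∸k≡)) (div-*-cancel _ _ (qfact≢0 (suc n ∸ k) (≤N (ℕₚ.m∸n≤m (suc n) k))))) ⟩
    (1ℚ - p) ^ℚ k * qfact p (suc n) * qint p (suc (n ∸ k)) + p ^ℚ (suc n ∸ k) * (qfact p (suc n) * (1ℚ - p) ^ℚ k) * qint p (suc k)
      ≡⟨ solve 5 (λ e f g h i → (e :* f) :* g :+ (h :* (f :* e)) :* i := (e :* f) :* (g :+ h :* i)) refl
           ((1ℚ - p) ^ℚ k) (qfact p (suc n)) (qint p (suc (n ∸ k))) (p ^ℚ (suc n ∸ k)) (qint p (suc k)) ⟩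
    (1ℚ - p) ^ℚ k * qfact p (suc n) * (qint p (suc (n ∸ k)) + p ^ℚ (suc n ∸ k) * qint p (suc k))
      ≡⟨ cong (λ z → (1ℚ - p) ^ℚ k * qfact p (suc n) * (qint p z + p ^ℚ (suc n ∸ k) * qint p (suc k))) (sym 1+n∸k≡) ⟩
    (1ℚ - p) ^ℚ k * qfact p (suc n) * (qint p (suc n ∸ k) + p ^ℚ (suc n ∸ k) * qint p (suc k))
      ≡⟨ cong ((1ℚ - p) ^ℚ k * qfact p (suc n) *_) (sym (qint-+ p (suc n ∸ k) (suc k))) ⟩
    (1ℚ - p) ^ℚ k * qfact p (suc n) * qint p (suc n ∸ k ℕ.+ suc k)
      ≡⟨ cong (λ z → (1ℚ - p) ^ℚ k * qfact p (suc n) * qint p z) (trans (ℕₚ.+-suc (suc n ∸ k) k) (cong suc (ℕₚ.m∸n+n≡m (ℕₚ.<⇒≤ k<1+n)))) ⟩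
    (1ℚ - p) ^ℚ k * qfact p (suc n) * qint p (2 ℕ.+ n)
      ≡⟨ solve 3 (λ e f g → (e :* f) :* g := e :* (g :* f)) refl ((1ℚ - p) ^ℚ k) (qfact p (suc n)) (qint p (2 ℕ.+ n)) ⟩
    (1ℚ - p) ^ℚ k * qfact p (2 ℕ.+ n) ∎)
    where
    ≤N : ∀ {i} → i ≤ suc n → i ≤ N
    ≤N i≤1+n = ℕₚ.≤-trans i≤1+n (ℕₚ.<⇒≤ 2+n≤N)
    1+n∸k≡ : suc n ∸ k ≡ suc (n ∸ k)
    1+n∸k≡ = ℕₚ.+-∸-assoc 1 (ℕₚ.≤-pred k<1+n)
    D = qint p (suc k) * qfact p (suc n ∸ k)
    D≢0 : D ≢ 0ℚ
    D≢0 = *-≢0 (qint≢0 k (≤N k<1+n)) (qfact≢0 (suc n ∸ k) (≤N (ℕₚ.m∸n≤m (suc n) k)))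

  ω-diagonal : ∀ n → suc n < N → ω p (suc n) (suc n) ≡ τ p (suc n) (suc n)
  ω-diagonal n 2+n≤N = begin
    ((1ℚ - p) ^ℚ suc n * qfact p (2 ℕ.+ n)) div (qint p (2 ℕ.+ n) * qfact p (n ∸ n))
      ≡⟨ cong (λ z → ((1ℚ - p) ^ℚ suc n * qfact p (2 ℕ.+ n)) div (qint p (2 ℕ.+ n) * qfact p z)) (ℕₚ.n∸n≡0 n) ⟩
    ((1ℚ - p) ^ℚ suc n * qfact p (2 ℕ.+ n)) div (qint p (2 ℕ.+ n) * 1ℚ)
      ≡⟨ div-unique _ (qint p (2 ℕ.+ n) * 1ℚ) (*-≢0 {qint p (2 ℕ.+ n)} {1ℚ} (qint≢0 (suc n) 2+n≤N) (λ ()))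
           (solve 3 (λ e f g → con 1ℚ :* (f :* e) :* (g :* con 1ℚ) := e :* (g :* f)) refl ((1ℚ - p) ^ℚ suc n) (qfact p (suc n)) (qint p (2 ℕ.+ n))) ⟩
    1ℚ * (qfact p (suc n) * (1ℚ - p) ^ℚ suc n)
      ≡⟨ sym (div-unique (1ℚ * (qfact p (suc n) * (1ℚ - p) ^ℚ suc n)) 1ℚ (λ ()) (ℚₚ.*-identityʳ _)) ⟩
    (1ℚ * (qfact p (suc n) * (1ℚ - p) ^ℚ suc n)) div 1ℚ
      ≡⟨ cong (λ z → (p ^ℚ z * (qfact p (suc n) * (1ℚ - p) ^ℚ suc n)) div qfact p z) (sym (ℕₚ.n∸n≡0 n)) ⟩
    τ p (suc n) (suc n) ∎

  sum-ω : ∀ n → suc n ≤ N → sum (ω p n) (upTo (suc n)) ≡ fromℕ (suc n)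
  sum-ω zero    1≤N   = cong (_+ 0ℚ) (div-unique {x = 1ℚ} ((1ℚ - p) ^ℚ 0 * qfact p 1) (qint p 1 * qfact p 0) (*-≢0 {qint p 1} {1ℚ} (qint≢0 0 1≤N) (λ ())) refl)
  sum-ω (suc n) 2+n≤N = begin
    sum (ω p (suc n)) (upTo (2 ℕ.+ n))
      ≡⟨ sum-upTo-sucʳ (ω p (suc n)) (suc n) ⟩
    sum (ω p (suc n)) (upTo (suc n)) + ω p (suc n) (suc n)
      ≡⟨ cong₂ _+_ (sum-upTo-cong (suc n) (ω-split n 2+n≤N)) (ω-diagonal n 2+n≤N) ⟩
    sum (λ k → ω p n k + τ p (suc n) k) (upTo (suc n)) + τ p (suc n) (suc n)
      ≡⟨ cong (_+ τ p (suc n) (suc n)) (sum-+ (ω p n) (τ p (suc n)) (upTo (suc n))) ⟩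
    sum (ω p n) (upTo (suc n)) + sum (τ p (suc n)) (upTo (suc n)) + τ p (suc n) (suc n)
      ≡⟨ ℚₚ.+-assoc (sum (ω p n) (upTo (suc n))) (sum (τ p (suc n)) (upTo (suc n))) (τ p (suc n) (suc n)) ⟩
    sum (ω p n) (upTo (suc n)) + (sum (τ p (suc n)) (upTo (suc n)) + τ p (suc n) (suc n))
      ≡⟨ cong (sum (ω p n) (upTo (suc n)) +_) (sym (sum-upTo-sucʳ (τ p (suc n)) (suc n))) ⟩
    sum (ω p n) (upTo (suc n)) + sum (τ p (suc n)) (upTo (2 ℕ.+ n))
      ≡⟨ cong₂ _+_ (sum-ω n (ℕₚ.<⇒≤ 2+n≤N)) (sum-τ (suc n) (ℕₚ.<⇒≤ 2+n≤N)) ⟩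
    fromℕ (suc n) + 1ℚ
      ≡⟨ ℚₚ.+-comm (fromℕ (suc n)) 1ℚ ⟩
    fromℕ (2 ℕ.+ n) ∎

module Coefficients (p q : ℚ) where

  x : ℚ
  x = (1ℚ - p) * (1ℚ - q)

  a : ℕ → ℚ
  a zero    = 0ℚ
  a (suc k) = (x ^ℚ k) div (qint p (suc k) * qint q (suc k))

  γ : ℕ → ℚ
  γ k = a k * qint q k

  β : ℕ → ℚ
  β k = ((1ℚ - q) ^ℚ k) div qfact p k

  β⁺ : ℕ → ℚ
  β⁺ zero    = 0ℚ
  β⁺ (suc k) = ((1ℚ - q) ^ℚ k) div qfact p (suc k)

  module _ {N : ℕ} (nzp : QIntsNonZero p N) (nzq : QIntsNonZero q N) where

    γ*β≡ω*β⁺ : ∀ n → suc n ≤ N → ∀ i → i ≤ n → γ (suc n ∸ i) * β i ≡ ω p n (n ∸ i) * β⁺ (suc n)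
    γ*β≡ω*β⁺ n 1+n≤N i i≤n = *-cancelʳ-≢0 D D≢0 (begin
      γ (suc n ∸ i) * β i * D
        ≡⟨ cong (λ z → γ z * β i * D) (ℕₚ.+-∸-assoc 1 i≤n) ⟩
      a (suc m) * qint q (suc m) * β i * (qint p (suc m) * qfact p i * qfact p (suc n))
        ≡⟨ solve 6 (λ g c bi a pi pn → (g :* c) :* bi :* (a :* pi :* pn) := (g :* (a :* c)) :* (bi :* pi) :* pn) refl
             (a (suc m)) (qint q (suc m)) (β i) (qint p (suc m)) (qfact p i) (qfact p (suc n)) ⟩
      a (suc m) * (qint p (suc m) * qint q (suc m)) * (β i * qfact p i) * qfact p (suc n)
        ≡⟨ cong₂ (λ u v → u * v * qfact p (suc n))
             (div-*-cancel _ _ (*-≢0 (nzp (suc m) (s≤s z≤n) (≤N (suc m) (s≤s m≤n))) (nzq (suc m) (s≤s z≤n) (≤N (suc m) (s≤s m≤n)))))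
             (div-*-cancel _ _ (qfact-≢0 nzp i (≤N i (ℕₚ.m≤n⇒m≤1+n i≤n)))) ⟩
      x ^ℚ m * (1ℚ - q) ^ℚ i * qfact p (suc n)
        ≡⟨ cong (λ z → z * (1ℚ - q) ^ℚ i * qfact p (suc n)) (^ℚ-distrib-* (1ℚ - p) (1ℚ - q) m) ⟩
      (1ℚ - p) ^ℚ m * (1ℚ - q) ^ℚ m * (1ℚ - q) ^ℚ i * qfact p (suc n)
        ≡⟨ solve 4 (λ a b c d → a :* b :* c :* d := (a :* d) :* (b :* c)) refl ((1ℚ - p) ^ℚ m) ((1ℚ - q) ^ℚ m) ((1ℚ - q) ^ℚ i) (qfact p (suc n)) ⟩
      (1ℚ - p) ^ℚ m * qfact p (suc n) * ((1ℚ - q) ^ℚ m * (1ℚ - q) ^ℚ i)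
        ≡⟨ cong ((1ℚ - p) ^ℚ m * qfact p (suc n) *_) (trans (sym (^ℚ-+ (1ℚ - q) m i)) (cong ((1ℚ - q) ^ℚ_) (ℕₚ.m∸n+n≡m i≤n))) ⟩
      (1ℚ - p) ^ℚ m * qfact p (suc n) * (1ℚ - q) ^ℚ n
        ≡⟨ cong₂ _*_ (sym ω*D′) (sym (div-*-cancel _ _ (qfact-≢0 nzp (suc n) 1+n≤N))) ⟩
      ω p n m * (qint p (suc m) * qfact p i) * (β⁺ (suc n) * qfact p (suc n))
        ≡⟨ solve 5 (λ w a pi v pn → (w :* (a :* pi)) :* (v :* pn) := w :* v :* (a :* pi :* pn)) refl
             (ω p n m) (qint p (suc m)) (qfact p i) (β⁺ (suc n)) (qfact p (suc n)) ⟩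
      ω p n (n ∸ i) * β⁺ (suc n) * D ∎)
      where
      ≤N : ∀ k → k ≤ suc n → k ≤ N
      ≤N k k≤1+n = ℕₚ.≤-trans k≤1+n 1+n≤N
      m = n ∸ i
      m≤n : m ≤ n
      m≤n = ℕₚ.m∸n≤m n i
      D = qint p (suc m) * qfact p i * qfact p (suc n)
      D≢0 : D ≢ 0ℚ
      D≢0 = *-≢0 (*-≢0 (nzp (suc m) (s≤s z≤n) (≤N (suc m) (s≤s m≤n))) (qfact-≢0 nzp i (≤N i (ℕₚ.m≤n⇒m≤1+n i≤n)))) (qfact-≢0 nzp (suc n) 1+n≤N)
      ω*D′ : ω p n m * (qint p (suc m) * qfact p i) ≡ (1ℚ - p) ^ℚ m * qfact p (suc n)
      ω*D′ = trans (cong (λ z → ω p n m * (qint p (suc m) * qfact p z)) (sym (ℕₚ.m∸[m∸n]≡n i≤n)))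
                   (div-*-cancel _ _ (*-≢0 (nzp (suc m) (s≤s z≤n) (≤N (suc m) (s≤s m≤n)))
                                          (qfact-≢0 nzp (n ∸ m) (≤N (n ∸ m) (ℕₚ.≤-trans (ℕₚ.m∸n≤m n m) (ℕₚ.n≤1+n n))))))

    fromℕ*β⁺ : ∀ r → r ≤ N → fromℕ r * β⁺ r ≡ (γ ⋆ β) r
    fromℕ*β⁺ zero    _     = refl
    fromℕ*β⁺ (suc n) 1+n≤N = begin
      fromℕ (suc n) * β⁺ (suc n)                          ≡⟨ cong (_* β⁺ (suc n)) (sym (sum-ω nzp n 1+n≤N)) ⟩
      sum (ω p n) (upTo (suc n)) * β⁺ (suc n)             ≡⟨ sym (sum-*ʳ (β⁺ (suc n)) (ω p n) (upTo (suc n))) ⟩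
      sum (λ k → ω p n k * β⁺ (suc n)) (upTo (suc n))     ≡⟨ sum-upTo-reverse (λ k → ω p n k * β⁺ (suc n)) n ⟩
      sum (λ i → ω p n (n ∸ i) * β⁺ (suc n)) (upTo (suc n)) ≡⟨ sum-upTo-cong (suc n) (λ i i<1+n → sym (γ*β≡ω*β⁺ n 1+n≤N i (ℕₚ.≤-pred i<1+n))) ⟩
      sum (λ i → γ (suc n ∸ i) * β i) (upTo (suc n))      ≡⟨ sym (ℚₚ.+-identityʳ _) ⟩
      sum (λ i → γ (suc n ∸ i) * β i) (upTo (suc n)) + 0ℚ ≡⟨ cong (sum (λ i → γ (suc n ∸ i) * β i) (upTo (suc n)) +_) (sym last-term) ⟩
      sum (λ i → γ (suc n ∸ i) * β i) (upTo (suc n)) + γ (suc n ∸ suc n) * β (suc n) ≡⟨ sym (sum-upTo-sucʳ (λ i → γ (suc n ∸ i) * β i) (suc n)) ⟩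
      (γ ⋆ β) (suc n) ∎
      where
      last-term : γ (suc n ∸ suc n) * β (suc n) ≡ 0ℚ
      last-term = trans (cong (λ z → γ z * β (suc n)) (ℕₚ.n∸n≡0 n)) (trans (cong (_* β (suc n)) (ℚₚ.*-zeroˡ 0ℚ)) (ℚₚ.*-zeroˡ (β (suc n))))

    β≡e₀+β⁺ : ∀ k → k ≤ N → β k ≡ e₀ k + (1ℚ - q) * β⁺ k
    β≡e₀+β⁺ zero    _   = sym (trans (cong (1ℚ +_) (ℚₚ.*-zeroʳ (1ℚ - q))) (ℚₚ.+-identityʳ 1ℚ))
    β≡e₀+β⁺ (suc r) 1+r≤N = trans
      (div-unique {x = (1ℚ - q) * β⁺ (suc r)} _ (qfact p (suc r)) (qfact-≢0 nzp (suc r) 1+r≤N)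
        (trans (ℚₚ.*-assoc (1ℚ - q) (β⁺ (suc r)) (qfact p (suc r)))
               (cong ((1ℚ - q) *_) (div-*-cancel _ _ (qfact-≢0 nzp (suc r) 1+r≤N)))))
      (sym (ℚₚ.+-identityˡ _))

    module _ (A : ℕ → ℚ) (newton : ∀ n → n ≤ N → fromℕ n * A n ≡ (a ⋆ A) n) where

      qA : ℕ → ℚ
      qA k = q ^ℚ k * A k

      -- Y is the recurrence for H with Hⱼ = [j]_p! [j]_q! Aⱼ substituted; Y ≡ Z closes the induction.
      Y Z : ℕ → ℚ
      Y n = (β⁺ ⋆ qA) n
      Z n = qint q n * A n

      private
        qa : ℕ → ℚ
        qa k = q ^ℚ k * a k

        β⋆qA : ∀ i → i ≤ N → (β ⋆ qA) i ≡ qA i + (1ℚ - q) * Y i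
        β⋆qA i i≤N = begin
          (β ⋆ qA) i                                           ≡⟨ ⋆-comm β qA i ⟩
          (qA ⋆ β) i                                           ≡⟨ ⋆-cong {qA} {qA} i (λ _ _ → refl) (λ k k≤i → β≡e₀+β⁺ k (ℕₚ.≤-trans k≤i i≤N)) ⟩
          (qA ⋆ (λ k → e₀ k + (1ℚ - q) * β⁺ k)) i              ≡⟨ ⋆-distribˡ-+ qA e₀ (λ k → (1ℚ - q) * β⁺ k) i ⟩
          (qA ⋆ e₀) i + (qA ⋆ (λ k → (1ℚ - q) * β⁺ k)) i       ≡⟨ cong₂ _+_ (⋆-identityʳ qA i) (trans (⋆-*ˡ (1ℚ - q) qA β⁺ i) (cong ((1ℚ - q) *_) (⋆-comm qA β⁺ i))) ⟩
          qA i + (1ℚ - q) * Y i                                ∎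

        -- Both n Y n and n Z n expand to (γ ⋆ A) n + (qa ⋆ Z) n, the first using Y ≡ Z below n.
        fromℕ*Y : ∀ n → n ≤ N → (∀ i → i < n → Y i ≡ Z i) → fromℕ n * Y n ≡ (γ ⋆ A) n + (qa ⋆ Z) n
        fromℕ*Y n n≤N Y≡Z = begin
          fromℕ n * (β⁺ ⋆ qA) n                                              ≡⟨ ⋆-leibniz β⁺ qA n ⟩
          ((λ k → fromℕ k * β⁺ k) ⋆ qA) n + (β⁺ ⋆ (λ k → fromℕ k * qA k)) n ≡⟨ cong₂ _+_ γ-part qa-part ⟩
          (γ ⋆ A) n + (qa ⋆ Z) n                                             ∎
          where
          ≤N : ∀ k → k ≤ n → k ≤ N
          ≤N k k≤n = ℕₚ.≤-trans k≤n n≤N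
          γ-part : ((λ k → fromℕ k * β⁺ k) ⋆ qA) n ≡ (γ ⋆ A) n
          γ-part = begin
            ((λ k → fromℕ k * β⁺ k) ⋆ qA) n   ≡⟨ ⋆-cong {g = qA} {g′ = qA} n (λ k k≤n → fromℕ*β⁺ k (≤N k k≤n)) (λ _ _ → refl) ⟩
            ((γ ⋆ β) ⋆ qA) n                  ≡⟨ sym (⋆-assoc γ β qA n) ⟩
            (γ ⋆ (β ⋆ qA)) n                  ≡⟨ ⋆-congʳ-< γ n (ℚₚ.*-zeroˡ 0ℚ) (λ i i<n → trans (β⋆qA i (≤N i (ℕₚ.<⇒≤ i<n))) (collapse i (Y≡Z i i<n))) ⟩
            (γ ⋆ A) n                         ∎
            where
            collapse : ∀ i → Y i ≡ Z i → qA i + (1ℚ - q) * Y i ≡ A i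
            collapse i Yi≡Zi = begin
              q ^ℚ i * A i + (1ℚ - q) * Y i                 ≡⟨ cong (λ z → q ^ℚ i * A i + (1ℚ - q) * z) Yi≡Zi ⟩
              q ^ℚ i * A i + (1ℚ - q) * (qint q i * A i)    ≡⟨ solve 4 (λ t u v c → t :* v :+ c :* (u :* v) := (t :+ c :* u) :* v) refl (q ^ℚ i) (qint q i) (A i) (1ℚ - q) ⟩
              (q ^ℚ i + (1ℚ - q) * qint q i) * A i          ≡⟨ cong (λ z → (q ^ℚ i + z) * A i) (sym (1-^ℚ q i)) ⟩
              (q ^ℚ i + (1ℚ - q ^ℚ i)) * A i                ≡⟨ solve 2 (λ t v → (t :+ (con 1ℚ :- t)) :* v := v) refl (q ^ℚ i) (A i) ⟩
              A i                                           ∎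
          qa-part : (β⁺ ⋆ (λ k → fromℕ k * qA k)) n ≡ (qa ⋆ Z) n
          qa-part = begin
            (β⁺ ⋆ (λ k → fromℕ k * qA k)) n  ≡⟨ ⋆-cong {β⁺} {β⁺} n (λ _ _ → refl) (λ k k≤n → newton-q k (≤N k k≤n)) ⟩
            (β⁺ ⋆ (qa ⋆ qA)) n               ≡⟨ ⋆-assoc β⁺ qa qA n ⟩
            ((β⁺ ⋆ qa) ⋆ qA) n               ≡⟨ ⋆-cong {g = qA} {g′ = qA} n (λ k _ → ⋆-comm β⁺ qa k) (λ _ _ → refl) ⟩
            ((qa ⋆ β⁺) ⋆ qA) n               ≡⟨ sym (⋆-assoc qa β⁺ qA n) ⟩
            (qa ⋆ Y) n                       ≡⟨ ⋆-congʳ-< qa n (ℚₚ.*-zeroʳ 1ℚ) Y≡Z ⟩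
            (qa ⋆ Z) n                       ∎
            where
            newton-q : ∀ k → k ≤ N → fromℕ k * qA k ≡ (qa ⋆ qA) k
            newton-q k k≤N = begin
              fromℕ k * (q ^ℚ k * A k)   ≡⟨ solve 3 (λ c d e → c :* (d :* e) := d :* (c :* e)) refl (fromℕ k) (q ^ℚ k) (A k) ⟩
              q ^ℚ k * (fromℕ k * A k)   ≡⟨ cong (q ^ℚ k *_) (newton k k≤N) ⟩
              q ^ℚ k * (a ⋆ A) k         ≡⟨ ⋆-scale a A q k ⟩
              (qa ⋆ qA) k                ∎

        fromℕ*Z : ∀ n → n ≤ N → fromℕ n * Z n ≡ (γ ⋆ A) n + (qa ⋆ Z) n
        fromℕ*Z n n≤N = begin
          fromℕ n * (qint q n * A n)                                  ≡⟨ solve 3 (λ c d e → c :* (d :* e) := d :* (c :* e)) refl (fromℕ n) (qint q n) (A n) ⟩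
          qint q n * (fromℕ n * A n)                                  ≡⟨ cong (qint q n *_) (newton n n≤N) ⟩
          qint q n * (a ⋆ A) n                                        ≡⟨ sym (sum-*ˡ (qint q n) (λ i → a (n ∸ i) * A i) (upTo (suc n))) ⟩
          sum (λ i → qint q n * (a (n ∸ i) * A i)) (upTo (suc n))     ≡⟨ sum-upTo-cong (suc n) (λ i i<1+n → split i (ℕₚ.≤-pred i<1+n)) ⟩
          sum (λ i → γ (n ∸ i) * A i + qa (n ∸ i) * Z i) (upTo (suc n)) ≡⟨ sum-+ (λ i → γ (n ∸ i) * A i) (λ i → qa (n ∸ i) * Z i) (upTo (suc n)) ⟩
          (γ ⋆ A) n + (qa ⋆ Z) n                                      ∎
          where
          split : ∀ i → i ≤ n → qint q n * (a (n ∸ i) * A i) ≡ γ (n ∸ i) * A i + qa (n ∸ i) * Z i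
          split i i≤n = begin
            qint q n * (a (n ∸ i) * A i)                                   ≡⟨ cong (λ z → qint q z * (a (n ∸ i) * A i)) (sym (ℕₚ.m∸n+n≡m i≤n)) ⟩
            qint q (n ∸ i ℕ.+ i) * (a (n ∸ i) * A i)                       ≡⟨ cong (_* (a (n ∸ i) * A i)) (qint-+ q (n ∸ i) i) ⟩
            (qint q (n ∸ i) + q ^ℚ (n ∸ i) * qint q i) * (a (n ∸ i) * A i) ≡⟨ solve 5 (λ u v w x y → (u :+ v :* w) :* (x :* y) := x :* u :* y :+ v :* x :* (w :* y)) refl
                                                                                (qint q (n ∸ i)) (q ^ℚ (n ∸ i)) (qint q i) (a (n ∸ i)) (A i) ⟩
            γ (n ∸ i) * A i + qa (n ∸ i) * Z i                             ∎

        Y≡Z-upTo : ∀ n → n ≤ N → ∀ i → i ≤ n → Y i ≡ Z i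
        Y≡Z-upTo zero    _     .zero z≤n = trans (ℚₚ.+-identityʳ _) (trans (ℚₚ.*-zeroˡ (qA 0)) (sym (ℚₚ.*-zeroˡ (A 0))))
        Y≡Z-upTo (suc n) 1+n≤N i i≤1+n with ℕₚ.m≤n⇒m<n∨m≡n i≤1+n
        ... | inj₁ i<1+n = Y≡Z-upTo n (ℕₚ.<⇒≤ 1+n≤N) i (ℕₚ.≤-pred i<1+n)
        ... | inj₂ refl  = *-cancelˡ-≢0 (fromℕ (suc n)) (fromℕ-suc≢0 n)
                             (trans (fromℕ*Y (suc n) 1+n≤N below) (sym (fromℕ*Z (suc n) 1+n≤N)))
          where
          below : ∀ j → j < suc n → Y j ≡ Z j
          below j j<1+n = Y≡Z-upTo n (ℕₚ.<⇒≤ 1+n≤N) j (ℕₚ.≤-pred j<1+n)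

      Y≡Z : ∀ n → n ≤ N → Y n ≡ Z n
      Y≡Z n n≤N = Y≡Z-upTo n n≤N n ℕₚ.≤-refl

      private
        recurrence-term : ∀ n → suc n ≤ N → ∀ j → j ≤ n →
          q ^ℚ j * qPochhammer q (suc j) (n ∸ j) * (qBinomial p (suc n) (suc n ∸ j) * (qfact p j * qfact q j * A j))
            ≡ qfact q n * qfact p (suc n) * (β⁺ (suc n ∸ j) * qA j)
        recurrence-term n 1+n≤N j j≤n rewrite ℕₚ.+-∸-assoc 1 j≤n = *-cancelʳ-≢0 ([1+m]! ) [1+m]!≢0 (begin
          q ^ℚ j * qPochhammer q (suc j) m * (qBinomial p (suc n) (suc m) * (qfact p j * qfact q j * A j)) * [1+m]!
            ≡⟨ solve 7 (λ t r b pj qj aj s → t :* r :* (b :* (pj :* qj :* aj)) :* s := t :* (r :* qj) :* (b :* s :* pj) :* aj) refl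
                 (q ^ℚ j) (qPochhammer q (suc j) m) (qBinomial p (suc n) (suc m)) (qfact p j) (qfact q j) (A j) [1+m]! ⟩
          q ^ℚ j * (qPochhammer q (suc j) m * qfact q j) * (qBinomial p (suc n) (suc m) * [1+m]! * qfact p j) * A j
            ≡⟨ cong₂ (λ u v → q ^ℚ j * u * v * A j)
                 (trans (qPochhammer-qfact q j m) (cong (λ z → (1ℚ - q) ^ℚ m * qfact q z) (ℕₚ.m+[n∸m]≡n j≤n)))
                 (trans (cong (λ z → qBinomial p (suc n) (suc m) * [1+m]! * qfact p z) (sym (ℕₚ.m∸[m∸n]≡n j≤n)))
                        (qBinomial-qfact p (suc n) (suc m) (s≤s (ℕₚ.m∸n≤m n j)))) ⟩
          q ^ℚ j * ((1ℚ - q) ^ℚ m * qfact q n) * qfact p (suc n) * A j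
            ≡⟨ cong (λ z → q ^ℚ j * (z * qfact q n) * qfact p (suc n) * A j) (sym (div-*-cancel _ _ [1+m]!≢0)) ⟩
          q ^ℚ j * (β⁺ (suc m) * [1+m]! * qfact q n) * qfact p (suc n) * A j
            ≡⟨ solve 6 (λ t b s qn pn aj → t :* (b :* s :* qn) :* pn :* aj := qn :* pn :* (b :* (t :* aj)) :* s) refl
                 (q ^ℚ j) (β⁺ (suc m)) [1+m]! (qfact q n) (qfact p (suc n)) (A j) ⟩
          qfact q n * qfact p (suc n) * (β⁺ (suc m) * qA j) * [1+m]! ∎)
          where
          m = n ∸ j
          [1+m]! = qfact p (suc m)
          [1+m]!≢0 : [1+m]! ≢ 0ℚ
          [1+m]!≢0 = qfact-≢0 nzp (suc m) (ℕₚ.≤-trans (s≤s (ℕₚ.m∸n≤m n j)) 1+n≤N)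

        H≡-upTo : A 0 ≡ 1ℚ → ∀ n → n ≤ N → ∀ j → j ≤ n → H j p q ≡ qfact p j * qfact q j * A j
        H≡-upTo A0≡1 zero    _     .zero z≤n = cong (1ℚ * 1ℚ *_) (sym A0≡1)
        H≡-upTo A0≡1 (suc n) 1+n≤N j j≤1+n with ℕₚ.m≤n⇒m<n∨m≡n j≤1+n
        ... | inj₁ j<1+n = H≡-upTo A0≡1 n (ℕₚ.<⇒≤ 1+n≤N) j (ℕₚ.≤-pred j<1+n)
        ... | inj₂ refl  = begin
          H (suc n) p q
            ≡⟨ H-recurrence p q n ⟩
          sum (λ j → q ^ℚ j * qPochhammer q (suc j) (n ∸ j) * (qBinomial p (suc n) (suc n ∸ j) * H j p q)) (upTo (suc n))
            ≡⟨ sum-upTo-cong (suc n) (λ i i<1+n → trans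
                 (cong (λ z → q ^ℚ i * qPochhammer q (suc i) (n ∸ i) * (qBinomial p (suc n) (suc n ∸ i) * z))
                       (H≡-upTo A0≡1 n (ℕₚ.<⇒≤ 1+n≤N) i (ℕₚ.≤-pred i<1+n)))
                 (recurrence-term n 1+n≤N i (ℕₚ.≤-pred i<1+n))) ⟩
          sum (λ j → qfact q n * qfact p (suc n) * (β⁺ (suc n ∸ j) * qA j)) (upTo (suc n))
            ≡⟨ sum-*ˡ (qfact q n * qfact p (suc n)) (λ j → β⁺ (suc n ∸ j) * qA j) (upTo (suc n)) ⟩
          qfact q n * qfact p (suc n) * sum (λ j → β⁺ (suc n ∸ j) * qA j) (upTo (suc n))
            ≡⟨ cong (qfact q n * qfact p (suc n) *_) Y-without-last ⟩
          qfact q n * qfact p (suc n) * Y (suc n)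
            ≡⟨ cong (qfact q n * qfact p (suc n) *_) (Y≡Z (suc n) 1+n≤N) ⟩
          qfact q n * qfact p (suc n) * (qint q (suc n) * A (suc n))
            ≡⟨ solve 4 (λ qn pn qi a → qn :* pn :* (qi :* a) := pn :* (qi :* qn) :* a) refl (qfact q n) (qfact p (suc n)) (qint q (suc n)) (A (suc n)) ⟩
          qfact p (suc n) * qfact q (suc n) * A (suc n) ∎
          where
          Y-without-last : sum (λ j → β⁺ (suc n ∸ j) * qA j) (upTo (suc n)) ≡ Y (suc n)
          Y-without-last = sym (begin
            Y (suc n)                                                          ≡⟨ sum-upTo-sucʳ (λ j → β⁺ (suc n ∸ j) * qA j) (suc n) ⟩
            sum (λ j → β⁺ (suc n ∸ j) * qA j) (upTo (suc n)) + β⁺ (suc n ∸ suc n) * qA (suc n)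
              ≡⟨ cong (λ z → sum (λ j → β⁺ (suc n ∸ j) * qA j) (upTo (suc n)) + β⁺ z * qA (suc n)) (ℕₚ.n∸n≡0 n) ⟩
            sum (λ j → β⁺ (suc n ∸ j) * qA j) (upTo (suc n)) + 0ℚ * qA (suc n)
              ≡⟨ trans (cong (sum (λ j → β⁺ (suc n ∸ j) * qA j) (upTo (suc n)) +_) (ℚₚ.*-zeroˡ (qA (suc n)))) (ℚₚ.+-identityʳ _) ⟩
            sum (λ j → β⁺ (suc n ∸ j) * qA j) (upTo (suc n))                    ∎)

      H≡qfact*qfact* : A 0 ≡ 1ℚ → ∀ n → n ≤ N → H n p q ≡ qfact p n * qfact q n * A n
      H≡qfact*qfact* A0≡1 n n≤N = H≡-upTo A0≡1 n n≤N n ℕₚ.≤-refl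

P*[n∸k]!≡n! : ∀ n k → k ≤ n → (n P k) ℕ.* (n ∸ k) ! ≡ n !
P*[n∸k]!≡n! n k k≤n = trans (cong (ℕ._* (n ∸ k) !) (nPk≡n!/[n∸k]! k≤n))
                             (m/n*n≡m {{(n ∸ k) ℕₚ.!≢0}} (∣-trans (m∣m*n (k !)) ([n∸k]!k!∣n! k≤n)))

-- compositions′ f n lists the compositions of n (by first part) as long as n ≤ f; the fuel f makes the recursion structural.
compositions′ : ℕ → ℕ → List (List ℕ)
compositions′ zero    n       = [] ∷ []
compositions′ (suc f) zero    = [] ∷ []
compositions′ (suc f) (suc n) = concatMap (λ i → map ((suc n ∸ i) ∷_) (compositions′ f i)) (upTo (suc n))

compositions : ℕ → List (List ℕ)
compositions n = compositions′ n n

concatMap-cong : {A B : Set} {f g : A → List B} (xs : List A) → (∀ x → x ∈ xs → f x ≡ g x) → concatMap f xs ≡ concatMap g xs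
concatMap-cong []       eq = refl
concatMap-cong (x ∷ xs) eq = cong₂ _++_ (eq x (here refl)) (concatMap-cong xs (λ y y∈ → eq y (there y∈)))

compositions′-fuel : ∀ f f′ n → n ≤ f → n ≤ f′ → compositions′ f n ≡ compositions′ f′ n
compositions′-fuel zero    zero     zero    _         _          = refl
compositions′-fuel zero    (suc f′) zero    _         _          = refl
compositions′-fuel (suc f) zero     zero    _         _          = refl
compositions′-fuel (suc f) (suc f′) zero    _         _          = refl
compositions′-fuel (suc f) (suc f′) (suc n) (s≤s n≤f) (s≤s n≤f′) = concatMap-cong (upTo (suc n)) (λ i i∈ →
  cong (map ((suc n ∸ i) ∷_)) (compositions′-fuel f f′ i (ℕₚ.≤-trans (ℕₚ.≤-pred (∈-upTo⁻ i∈)) n≤f) (ℕₚ.≤-trans (ℕₚ.≤-pred (∈-upTo⁻ i∈)) n≤f′)))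

IsComposition : ℕ → List ℕ → Set
IsComposition n α = All (1 ≤_) α × sumℕ α ≡ n

∈-compositions′⁻ : ∀ f n {α} → n ≤ f → α ∈ compositions′ f n → IsComposition n α
∈-compositions′⁻ zero    zero    _         (here refl) = [] , refl
∈-compositions′⁻ (suc f) zero    _         (here refl) = [] , refl
∈-compositions′⁻ (suc f) (suc n) (s≤s n≤f) α∈
  with find (∈-concatMap⁻ (λ i → map ((suc n ∸ i) ∷_) (compositions′ f i)) {xs = upTo (suc n)} α∈)
... | i , i∈ , α∈′ with ∈-map⁻ ((suc n ∸ i) ∷_) α∈′
... | β , β∈ , refl with ∈-compositions′⁻ f i (ℕₚ.≤-trans (ℕₚ.≤-pred (∈-upTo⁻ i∈)) n≤f) β∈
... | β-pos , sum-β = ℕₚ.m<n⇒0<n∸m (∈-upTo⁻ i∈) ∷ β-pos , trans (cong ((suc n ∸ i) ℕ.+_) sum-β) (ℕₚ.m∸n+n≡m (ℕₚ.<⇒≤ (∈-upTo⁻ i∈)))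

∈-compositions⁻ : ∀ n {α} → α ∈ compositions n → IsComposition n α
∈-compositions⁻ n = ∈-compositions′⁻ n n ℕₚ.≤-refl

-- The number of permutations of {1, …, Σ α} whose cycles, ordered by least element, have lengths α₁, α₂, …
cycleArrangements : List ℕ → ℕ
cycleArrangements []      = 1
cycleArrangements (k ∷ β) = ((k ℕ.+ sumℕ β ∸ 1) P (k ∸ 1)) ℕ.* cycleArrangements β

module Exponential (a : ℕ → ℚ) (a0≡0 : a 0 ≡ 0ℚ) where

  compositionSum : ℕ → ℚ
  compositionSum n = sum (λ α → fromℕ (cycleArrangements α) * prodℚ (map a α)) (compositions n)

  compositionSum-suc : ∀ n → compositionSum (suc n) ≡ sum (λ i → fromℕ (n P (n ∸ i)) * a (suc n ∸ i) * compositionSum i) (upTo (suc n))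
  compositionSum-suc n = begin
    sum term (concatMap (λ i → map ((suc n ∸ i) ∷_) (compositions′ n i)) (upTo (suc n)))
      ≡⟨ sum-concatMap term (λ i → map ((suc n ∸ i) ∷_) (compositions′ n i)) (upTo (suc n)) ⟩
    sum (λ i → sum term (map ((suc n ∸ i) ∷_) (compositions′ n i))) (upTo (suc n))
      ≡⟨ sum-upTo-cong (suc n) (λ i i<1+n → first-part i (ℕₚ.≤-pred i<1+n)) ⟩
    sum (λ i → fromℕ (n P (n ∸ i)) * a (suc n ∸ i) * compositionSum i) (upTo (suc n)) ∎
    where
    term : List ℕ → ℚ
    term α = fromℕ (cycleArrangements α) * prodℚ (map a α)
    first-part : ∀ i → i ≤ n → sum term (map ((suc n ∸ i) ∷_) (compositions′ n i)) ≡ fromℕ (n P (n ∸ i)) * a (suc n ∸ i) * compositionSum i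
    first-part i i≤n = begin
      sum term (map ((suc n ∸ i) ∷_) (compositions′ n i))                    ≡⟨ sum-map term ((suc n ∸ i) ∷_) (compositions′ n i) ⟩
      sum (λ β → term ((suc n ∸ i) ∷ β)) (compositions′ n i)                 ≡⟨ sum-cong (compositions′ n i) term-∷ ⟩
      sum (λ β → c * term β) (compositions′ n i)                              ≡⟨ sum-*ˡ c term (compositions′ n i) ⟩
      c * sum term (compositions′ n i)                                        ≡⟨ cong (λ αs → c * sum term αs) (compositions′-fuel n i i i≤n ℕₚ.≤-refl) ⟩
      c * compositionSum i                                                    ∎
      where
      c = fromℕ (n P (n ∸ i)) * a (suc n ∸ i)
      term-∷ : ∀ β → β ∈ compositions′ n i → term ((suc n ∸ i) ∷ β) ≡ c * term β
      term-∷ β β∈ = begin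
        fromℕ (((suc n ∸ i ℕ.+ sumℕ β ∸ 1) P (suc n ∸ i ∸ 1)) ℕ.* cycleArrangements β) * (a (suc n ∸ i) * prodℚ (map a β))
          ≡⟨ cong (λ k → fromℕ (k ℕ.* cycleArrangements β) * (a (suc n ∸ i) * prodℚ (map a β))) (cong₂ _P_ total first) ⟩
        fromℕ ((n P (n ∸ i)) ℕ.* cycleArrangements β) * (a (suc n ∸ i) * prodℚ (map a β))
          ≡⟨ cong (_* (a (suc n ∸ i) * prodℚ (map a β))) (fromℕ-* (n P (n ∸ i)) (cycleArrangements β)) ⟩
        fromℕ (n P (n ∸ i)) * fromℕ (cycleArrangements β) * (a (suc n ∸ i) * prodℚ (map a β))
          ≡⟨ solve 4 (λ f w x y → f :* w :* (x :* y) := f :* x :* (w :* y)) refl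
               (fromℕ (n P (n ∸ i))) (fromℕ (cycleArrangements β)) (a (suc n ∸ i)) (prodℚ (map a β)) ⟩
        c * term β ∎
        where
        total : suc n ∸ i ℕ.+ sumℕ β ∸ 1 ≡ n
        total = cong (_∸ 1) (trans (cong (suc n ∸ i ℕ.+_) (proj₂ (∈-compositions′⁻ n i i≤n β∈))) (ℕₚ.m∸n+n≡m (ℕₚ.m≤n⇒m≤1+n i≤n)))
        first : suc n ∸ i ∸ 1 ≡ n ∸ i
        first = cong (_∸ 1) (ℕₚ.+-∸-assoc 1 i≤n)

  expCoefficient : ℕ → ℚ
  expCoefficient n = compositionSum n div fromℕ (n !)

  -- Newton's identity n Aₙ = Σᵢ aₙ₋ᵢ Aᵢ characterises A = exp (Σₖ aₖ tᵏ).
  fromℕ*expCoefficient : ∀ n → fromℕ n * expCoefficient n ≡ (a ⋆ expCoefficient) n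
  fromℕ*expCoefficient zero    = trans (ℚₚ.*-zeroˡ (A 0)) (sym (trans (ℚₚ.+-identityʳ _) (trans (cong (_* A 0) a0≡0) (ℚₚ.*-zeroˡ (A 0)))))
    where A = expCoefficient
  fromℕ*expCoefficient (suc n) = *-cancelʳ-≢0 (fromℕ (n !)) (fromℕ-!≢0 n) (begin
    fromℕ (suc n) * A (suc n) * fromℕ (n !)
      ≡⟨ solve 3 (λ c x m → c :* x :* m := x :* (c :* m)) refl (fromℕ (suc n)) (A (suc n)) (fromℕ (n !)) ⟩
    A (suc n) * (fromℕ (suc n) * fromℕ (n !))
      ≡⟨ cong (A (suc n) *_) (sym (fromℕ-* (suc n) (n !))) ⟩
    A (suc n) * fromℕ (suc n !)
      ≡⟨ div-*-cancel (compositionSum (suc n)) (fromℕ (suc n !)) (fromℕ-!≢0 (suc n)) ⟩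
    compositionSum (suc n)
      ≡⟨ compositionSum-suc n ⟩
    sum (λ i → fromℕ (n P (n ∸ i)) * a (suc n ∸ i) * compositionSum i) (upTo (suc n))
      ≡⟨ sum-upTo-cong (suc n) (λ i i<1+n → term i (ℕₚ.≤-pred i<1+n)) ⟩
    sum (λ i → a (suc n ∸ i) * A i * fromℕ (n !)) (upTo (suc n))
      ≡⟨ sum-*ʳ (fromℕ (n !)) (λ i → a (suc n ∸ i) * A i) (upTo (suc n)) ⟩
    sum (λ i → a (suc n ∸ i) * A i) (upTo (suc n)) * fromℕ (n !)
      ≡⟨ cong (_* fromℕ (n !)) (sym (trans (sum-upTo-sucʳ (λ i → a (suc n ∸ i) * A i) (suc n)) last-term)) ⟩
    (a ⋆ A) (suc n) * fromℕ (n !) ∎)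
    where
    A = expCoefficient
    last-term : sum (λ i → a (suc n ∸ i) * A i) (upTo (suc n)) + a (suc n ∸ suc n) * A (suc n) ≡ sum (λ i → a (suc n ∸ i) * A i) (upTo (suc n))
    last-term = begin
      sum (λ i → a (suc n ∸ i) * A i) (upTo (suc n)) + a (n ∸ n) * A (suc n)  ≡⟨ cong (λ k → sum (λ i → a (suc n ∸ i) * A i) (upTo (suc n)) + a k * A (suc n)) (ℕₚ.n∸n≡0 n) ⟩
      sum (λ i → a (suc n ∸ i) * A i) (upTo (suc n)) + a 0 * A (suc n)        ≡⟨ cong (λ z → sum (λ i → a (suc n ∸ i) * A i) (upTo (suc n)) + z * A (suc n)) a0≡0 ⟩
      sum (λ i → a (suc n ∸ i) * A i) (upTo (suc n)) + 0ℚ * A (suc n)         ≡⟨ trans (cong (sum (λ i → a (suc n ∸ i) * A i) (upTo (suc n)) +_) (ℚₚ.*-zeroˡ (A (suc n)))) (ℚₚ.+-identityʳ _) ⟩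
      sum (λ i → a (suc n ∸ i) * A i) (upTo (suc n))                          ∎
    term : ∀ i → i ≤ n → fromℕ (n P (n ∸ i)) * a (suc n ∸ i) * compositionSum i ≡ a (suc n ∸ i) * A i * fromℕ (n !)
    term i i≤n = begin
      fromℕ (n P (n ∸ i)) * a (suc n ∸ i) * compositionSum i
        ≡⟨ cong (fromℕ (n P (n ∸ i)) * a (suc n ∸ i) *_) (sym (div-*-cancel (compositionSum i) (fromℕ (i !)) (fromℕ-!≢0 i))) ⟩
      fromℕ (n P (n ∸ i)) * a (suc n ∸ i) * (A i * fromℕ (i !))
        ≡⟨ solve 4 (λ f x y g → f :* x :* (y :* g) := x :* y :* (f :* g)) refl (fromℕ (n P (n ∸ i))) (a (suc n ∸ i)) (A i) (fromℕ (i !)) ⟩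
      a (suc n ∸ i) * A i * (fromℕ (n P (n ∸ i)) * fromℕ (i !))
        ≡⟨ cong (a (suc n ∸ i) * A i *_) (sym (fromℕ-* (n P (n ∸ i)) (i !))) ⟩
      a (suc n ∸ i) * A i * fromℕ ((n P (n ∸ i)) ℕ.* i !)
        ≡⟨ cong (λ k → a (suc n ∸ i) * A i * fromℕ k)
             (trans (cong (λ k → (n P (n ∸ i)) ℕ.* k !) (sym (ℕₚ.m∸[m∸n]≡n i≤n))) (P*[n∸k]!≡n! n (n ∸ i) (ℕₚ.m∸n≤m n i))) ⟩
      a (suc n ∸ i) * A i * fromℕ (n !) ∎

module Descending = Sort (Flip.decTotalOrder ℕₚ.≤-decTotalOrder)

sortDesc : List ℕ → List ℕ
sortDesc = Descending.sort

prodℚ-↭ : ∀ {xs ys} → xs ↭ ys → prodℚ xs ≡ prodℚ ys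
prodℚ-↭ ↭.refl                         = refl
prodℚ-↭ (↭.prep x xs↭ys)               = cong (x *_) (prodℚ-↭ xs↭ys)
prodℚ-↭ (↭.swap {ys = ys} x y xs↭ys) = trans (cong (λ t → x * (y * t)) (prodℚ-↭ xs↭ys))
                                               (solve 3 (λ x y t → x :* (y :* t) := y :* (x :* t)) refl x y (prodℚ ys))
prodℚ-↭ (↭.trans ↭₁ ↭₂)                = trans (prodℚ-↭ ↭₁) (prodℚ-↭ ↭₂)

prodℚ-sortDesc : (g : ℕ → ℚ) (α : List ℕ) → prodℚ (map g (sortDesc α)) ≡ prodℚ (map g α)
prodℚ-sortDesc g α = prodℚ-↭ (map⁺ g (Descending.sort-↭ α))

sumℕ-sortDesc : ∀ α → sumℕ (sortDesc α) ≡ sumℕ α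
sumℕ-sortDesc α = sum-↭ (Descending.sort-↭ α)

length-sortDesc : ∀ α → length (sortDesc α) ≡ length α
length-sortDesc α = ↭-length (Descending.sort-↭ α)

All-sortDesc : {Q : ℕ → Set} → ∀ α → All Q α → All Q (sortDesc α)
All-sortDesc α = All-resp-↭ (↭-sym (Descending.sort-↭ α))

weaklyDecr-sortDesc : ∀ α → weaklyDecr (sortDesc α) ≡ true
weaklyDecr-sortDesc α = linked⇒weaklyDecr (Descending.sort-↗ α)
  where
  linked⇒weaklyDecr : ∀ {μ} → Linked (λ x y → y ≤ x) μ → weaklyDecr μ ≡ true
  linked⇒weaklyDecr []             = refl
  linked⇒weaklyDecr [-]            = refl
  linked⇒weaklyDecr (y≤x ∷ linked) = ∧-true⁺ (T⇒≡true (ℕₚ.≤⇒≤ᵇ y≤x)) (linked⇒weaklyDecr linked)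

allPos⁺ : ∀ μ → All (1 ≤_) μ → allPos μ ≡ true
allPos⁺ []      _             = refl
allPos⁺ (x ∷ μ) (1≤x ∷ 1≤μ) = ∧-true⁺ (T⇒≡true (ℕₚ.≤⇒≤ᵇ 1≤x)) (allPos⁺ μ 1≤μ)

allPos⁻ : ∀ μ → allPos μ ≡ true → All (1 ≤_) μ
allPos⁻ []      _   = []
allPos⁻ (x ∷ μ) pos with ∧-true⁻ {1 ≤ᵇ x} pos
... | 1≤x , μ-pos = ℕₚ.≤ᵇ⇒≤ 1 x (≡true⇒T 1≤x) ∷ allPos⁻ μ μ-pos

isPartitionOf⁻ : ∀ n μ → isPartitionOf n μ ≡ true → All (1 ≤_) μ × sumℕ μ ≡ n
isPartitionOf⁻ n μ μ⊢n with ∧-true⁻ {allPos μ} μ⊢n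
... | μ-pos , rest with ∧-true⁻ {weaklyDecr μ} rest
... | _ , sum≡ = allPos⁻ μ μ-pos , ℕₚ.≡ᵇ⇒≡ (sumℕ μ) n (≡true⇒T sum≡)

sortDesc-isPartitionOf : ∀ n α → IsComposition n α → isPartitionOf n (sortDesc α) ≡ true
sortDesc-isPartitionOf n α (α-pos , sum-α) =
  ∧-true⁺ (allPos⁺ (sortDesc α) (All-sortDesc α α-pos))
          (∧-true⁺ (weaklyDecr-sortDesc α) (T⇒≡true (ℕₚ.≡⇒≡ᵇ _ n (trans (sumℕ-sortDesc α) sum-α))))

part≤sum : ∀ β → All (_≤ sumℕ β) β
part≤sum []      = []
part≤sum (k ∷ β) = ℕₚ.m≤m+n k (sumℕ β) ∷ All.map (λ k′≤ → ℕₚ.≤-trans k′≤ (ℕₚ.m≤n+m (sumℕ β) k)) (part≤sum β)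

length≤sum : ∀ β → All (1 ≤_) β → length β ≤ sumℕ β
length≤sum []      _             = z≤n
length≤sum (k ∷ β) (1≤k ∷ 1≤β) = ℕₚ.+-mono-≤ 1≤k (length≤sum β 1≤β)

∈-partitionsWithLength⁻ : ∀ n k {μ} → μ ∈ partitionsWithLength n k →
                          All (1 ≤_) μ × sumℕ μ ≡ n × length μ ≡ k × All (_< suc n) μ
∈-partitionsWithLength⁻ n k μ∈ with ∈-filter⁻ (T? ∘ isPartitionOf n) {xs = words (suc n) k} μ∈
... | μ∈words , μ⊢n with isPartitionOf⁻ n _ (T⇒≡true μ⊢n) | ∈-words⁻ (suc n) k μ∈words
... | μ-pos , sum-μ | length-μ , μ<1+n = μ-pos , sum-μ , length-μ , μ<1+n

partitions : ℕ → List (List ℕ)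
partitions n = concatMap (λ d → partitionsWithLength n (n ∸ d)) (upTo (suc n))

∈-partitions⁻ : ∀ n {μ} → μ ∈ partitions n →
                Σ ℕ (λ d → d ≤ n × All (1 ≤_) μ × sumℕ μ ≡ n × length μ ≡ n ∸ d × All (_< suc n) μ)
∈-partitions⁻ n μ∈ with find (∈-concatMap⁻ (λ d → partitionsWithLength n (n ∸ d)) {xs = upTo (suc n)} μ∈)
... | d , d∈ , μ∈′ = d , ℕₚ.≤-pred (∈-upTo⁻ d∈) , ∈-partitionsWithLength⁻ n (n ∸ d) μ∈′

count-words-length : ∀ m k {w} → All (_< m) w → Countᴸ.count w (words m k) ≡ Countℕ.δ k (length w)
count-words-length m k {w} w<m with k ℕ.≟ length w
... | yes refl = trans (count-words m (length w) refl w<m) (sym (Countℕ.δ-refl (length w)))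
... | no k≢|w|   = trans (Countᴸ.count-∉ (words m k) (λ w∈ → k≢|w| (sym (proj₁ (∈-words⁻ m k w∈))))) (sym (Countℕ.δ-≢ k≢|w|))

count-sortDesc-partitions : ∀ n α → IsComposition n α → Countᴸ.count (sortDesc α) (partitions n) ≡ 1
count-sortDesc-partitions n α α⊨n@(α-pos , sum-α) = begin
  Countᴸ.count (sortDesc α) (partitions n)
    ≡⟨ count-concatMap (sortDesc α) (λ d → partitionsWithLength n (n ∸ d)) (upTo (suc n)) ⟩
  ℕΣ.sum (λ d → Countᴸ.count (sortDesc α) (partitionsWithLength n (n ∸ d))) (upTo (suc n))
    ≡⟨ ℕΣ.sum-cong (upTo (suc n)) (λ d _ → count-length d) ⟩
  ℕΣ.sum (λ d → Countℕ.δ (n ∸ d) ℓ) (upTo (suc n))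
    ≡⟨ ℕΣ.sum-upTo-cong (suc n) (λ d d<1+n → δ-flip d (ℕₚ.≤-pred d<1+n)) ⟩
  ℕΣ.sum (Countℕ.δ (n ∸ ℓ)) (upTo (suc n))
    ≡⟨ sym (count≡sum-δ ℕ._≟_ (n ∸ ℓ) (upTo (suc n))) ⟩
  Countℕ.count (n ∸ ℓ) (upTo (suc n))
    ≡⟨ count-upTo (s≤s (ℕₚ.m∸n≤m n ℓ)) ⟩
  1 ∎
  where
  ℓ = length (sortDesc α)
  ℓ≤n : ℓ ≤ n
  ℓ≤n = subst (_≤ n) (sym (length-sortDesc α)) (subst (length α ≤_) sum-α (length≤sum α α-pos))
  sorted<1+n : All (_< suc n) (sortDesc α)
  sorted<1+n = All-sortDesc α (All.map (λ k≤ → s≤s (subst (_ ≤_) sum-α k≤)) (part≤sum α))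
  count-length : ∀ d → Countᴸ.count (sortDesc α) (partitionsWithLength n (n ∸ d)) ≡ Countℕ.δ (n ∸ d) ℓ
  count-length d = trans (Countᴸ.count-filter (isPartitionOf n) (words (suc n) (n ∸ d)) (sortDesc-isPartitionOf n α α⊨n))
                           (count-words-length (suc n) (n ∸ d) sorted<1+n)
  δ-flip : ∀ d → d ≤ n → Countℕ.δ (n ∸ d) ℓ ≡ Countℕ.δ (n ∸ ℓ) d
  δ-flip d d≤n with (n ∸ d) ℕ.≟ ℓ | (n ∸ ℓ) ℕ.≟ d
  ... | yes n∸d≡ℓ | yes n∸ℓ≡d = trans (cong (λ k → Countℕ.δ k ℓ) n∸d≡ℓ)
                                  (trans (Countℕ.δ-refl ℓ) (sym (trans (cong (λ k → Countℕ.δ k d) n∸ℓ≡d) (Countℕ.δ-refl d))))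
  ... | no n∸d≢ℓ  | no n∸ℓ≢d  = trans (Countℕ.δ-≢ n∸d≢ℓ) (sym (Countℕ.δ-≢ n∸ℓ≢d))
  ... | yes n∸d≡ℓ | no n∸ℓ≢d = ⊥-elim (n∸ℓ≢d (trans (cong (n ∸_) (sym n∸d≡ℓ)) (ℕₚ.m∸[m∸n]≡n d≤n)))
  ... | no n∸d≢ℓ  | yes n∸ℓ≡d = ⊥-elim (n∸d≢ℓ (trans (cong (n ∸_) (sym n∸ℓ≡d)) (ℕₚ.m∸[m∸n]≡n ℓ≤n)))

partitionCoefficient : List ℕ → ℕ
partitionCoefficient μ = ℕΣ.sum (λ α → Countᴸ.δ (sortDesc α) μ ℕ.* cycleArrangements α) (compositions (sumℕ μ))

coefficient : List ℕ → ℤ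
coefficient μ = ℤ.+ partitionCoefficient μ

*-div-div : ∀ a s m → m ≢ 0ℚ → (a * (s div m)) div m ≡ (a div (m * m)) * s
*-div-div a s m m≢0 = div-unique (a * (s div m)) m m≢0 (*-cancelʳ-≢0 m m≢0 (begin
  (a div (m * m)) * s * m * m     ≡⟨ solve 3 (λ d s m → d :* s :* m :* m := d :* (m :* m) :* s) refl (a div (m * m)) s m ⟩
  (a div (m * m)) * (m * m) * s   ≡⟨ cong (_* s) (div-*-cancel a (m * m) (*-≢0 m≢0 m≢0)) ⟩
  a * s                           ≡⟨ cong (a *_) (sym (div-*-cancel s m m≢0)) ⟩
  a * ((s div m) * m)             ≡⟨ sym (ℚₚ.*-assoc a (s div m) m) ⟩
  a * (s div m) * m               ∎))

module MainIdentity (p q : ℚ) (n : ℕ) (nzp : QIntsNonZero p n) (nzq : QIntsNonZero q n) where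

  open Coefficients p q using (x; a; H≡qfact*qfact*)
  open Exponential a refl using (compositionSum; expCoefficient; fromℕ*expCoefficient)

  private
    qq : ℕ → ℚ
    qq m = qint p m * qint q m

    Bounded : ℕ → Set
    Bounded m = 1 ≤ m × m ≤ n

    prodℚ-qq≢0 : ∀ μ → All Bounded μ → prodℚ (map qq μ) ≢ 0ℚ
    prodℚ-qq≢0 []      _                  = λ ()
    prodℚ-qq≢0 (m ∷ μ) ((1≤m , m≤n) ∷ μ-range) = *-≢0 (*-≢0 (nzp m 1≤m m≤n) (nzq m 1≤m m≤n)) (prodℚ-qq≢0 μ μ-range)

    prodℚ-a*prodℚ-qq : ∀ μ → All Bounded μ → prodℚ (map a μ) * prodℚ (map qq μ) ≡ x ^ℚ (sumℕ μ ∸ length μ)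
    prodℚ-a*prodℚ-qq []            _                         = refl
    prodℚ-a*prodℚ-qq (suc m ∷ μ) ((1≤m , m≤n) ∷ μ-range) = begin
      a (suc m) * prodℚ (map a μ) * (qq (suc m) * prodℚ (map qq μ))
        ≡⟨ solve 4 (λ w x y z → (w :* x) :* (y :* z) := (w :* y) :* (x :* z)) refl (a (suc m)) (prodℚ (map a μ)) (qq (suc m)) (prodℚ (map qq μ)) ⟩
      a (suc m) * qq (suc m) * (prodℚ (map a μ) * prodℚ (map qq μ))
        ≡⟨ cong₂ _*_ (div-*-cancel (x ^ℚ m) (qq (suc m)) (*-≢0 (nzp (suc m) 1≤m m≤n) (nzq (suc m) 1≤m m≤n))) (prodℚ-a*prodℚ-qq μ μ-range) ⟩
      x ^ℚ m * x ^ℚ (sumℕ μ ∸ length μ)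
        ≡⟨ sym (^ℚ-+ x m (sumℕ μ ∸ length μ)) ⟩
      x ^ℚ (m ℕ.+ (sumℕ μ ∸ length μ))
        ≡⟨ cong (x ^ℚ_) (sym (ℕₚ.+-∸-assoc m (length≤sum μ (All.map proj₁ μ-range)))) ⟩
      x ^ℚ (m ℕ.+ sumℕ μ ∸ length μ) ∎

    -- For μ ⊢ n with n - d parts, x^d / Π [μᵢ]_p [μᵢ]_q = Π a_{μᵢ}.
    partition-term : ∀ d → d ≤ n → ∀ μ → μ ∈ partitionsWithLength n (n ∸ d) →
                     x ^ℚ d * (ℤtoℚ (coefficient μ) div prodℚ (map qq μ)) ≡ fromℕ (partitionCoefficient μ) * prodℚ (map a μ)
    partition-term d d≤n μ μ∈ with ∈-partitionsWithLength⁻ n (n ∸ d) μ∈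
    ... | μ-pos , sum-μ , length-μ , μ<1+n = *-cancelʳ-≢0 Πqq Πqq≢0 (begin
      x ^ℚ d * (ℕtoℚ k div Πqq) * Πqq       ≡⟨ ℚₚ.*-assoc (x ^ℚ d) _ Πqq ⟩
      x ^ℚ d * ((ℕtoℚ k div Πqq) * Πqq)     ≡⟨ cong (x ^ℚ d *_) (div-*-cancel (ℕtoℚ k) Πqq Πqq≢0) ⟩
      x ^ℚ d * ℕtoℚ k                       ≡⟨ cong₂ _*_ (cong (x ^ℚ_) (sym sum∸length≡d)) (sym (fromℕ≡ℕtoℚ k)) ⟩
      x ^ℚ (sumℕ μ ∸ length μ) * fromℕ k    ≡⟨ cong (_* fromℕ k) (sym (prodℚ-a*prodℚ-qq μ μ-range)) ⟩
      prodℚ (map a μ) * Πqq * fromℕ k       ≡⟨ solve 3 (λ x y z → x :* y :* z := z :* x :* y) refl (prodℚ (map a μ)) Πqq (fromℕ k) ⟩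
      fromℕ k * prodℚ (map a μ) * Πqq       ∎)
      where
      k = partitionCoefficient μ
      Πqq = prodℚ (map qq μ)
      μ-range : All Bounded μ
      μ-range = All.zipWith (λ (1≤m , m<1+n) → 1≤m , ℕₚ.≤-pred m<1+n) (μ-pos , μ<1+n)
      Πqq≢0 = prodℚ-qq≢0 μ μ-range
      sum∸length≡d : sumℕ μ ∸ length μ ≡ d
      sum∸length≡d = trans (cong₂ _∸_ sum-μ length-μ) (ℕₚ.m∸[m∸n]≡n d≤n)

    partition-expanded : ∀ μ → μ ∈ partitions n →
      fromℕ (partitionCoefficient μ) * prodℚ (map a μ)
        ≡ sum (λ α → fromℕ (Countᴸ.δ (sortDesc α) μ) * (fromℕ (cycleArrangements α) * prodℚ (map a μ))) (compositions n)
    partition-expanded μ μ∈ with ∈-partitions⁻ n μ∈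
    ... | _ , _ , _ , sum-μ , _ = begin
      fromℕ (ℕΣ.sum (λ α → Countᴸ.δ (sortDesc α) μ ℕ.* cycleArrangements α) (compositions (sumℕ μ))) * prodℚ (map a μ)
        ≡⟨ cong (λ k → fromℕ (ℕΣ.sum (λ α → Countᴸ.δ (sortDesc α) μ ℕ.* cycleArrangements α) (compositions k)) * prodℚ (map a μ)) sum-μ ⟩
      fromℕ (ℕΣ.sum (λ α → Countᴸ.δ (sortDesc α) μ ℕ.* cycleArrangements α) (compositions n)) * prodℚ (map a μ)
        ≡⟨ cong (_* prodℚ (map a μ)) (fromℕ-sum (λ α → Countᴸ.δ (sortDesc α) μ ℕ.* cycleArrangements α) (compositions n)) ⟩
      sum (λ α → fromℕ (Countᴸ.δ (sortDesc α) μ ℕ.* cycleArrangements α)) (compositions n) * prodℚ (map a μ)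
        ≡⟨ sym (sum-*ʳ (prodℚ (map a μ)) _ (compositions n)) ⟩
      sum (λ α → fromℕ (Countᴸ.δ (sortDesc α) μ ℕ.* cycleArrangements α) * prodℚ (map a μ)) (compositions n)
        ≡⟨ sum-cong (compositions n) (λ α _ → trans (cong (_* prodℚ (map a μ)) (fromℕ-* (Countᴸ.δ (sortDesc α) μ) (cycleArrangements α)))
                                                    (ℚₚ.*-assoc (fromℕ (Countᴸ.δ (sortDesc α) μ)) (fromℕ (cycleArrangements α)) (prodℚ (map a μ)))) ⟩
      sum (λ α → fromℕ (Countᴸ.δ (sortDesc α) μ) * (fromℕ (cycleArrangements α) * prodℚ (map a μ))) (compositions n) ∎
      where
      fromℕ-sum : (f : List ℕ → ℕ) (αs : List (List ℕ)) → fromℕ (ℕΣ.sum f αs) ≡ sum (λ α → fromℕ (f α)) αs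
      fromℕ-sum f []       = refl
      fromℕ-sum f (α ∷ αs) = trans (fromℕ-+ (f α) (ℕΣ.sum f αs)) (cong (fromℕ (f α) +_) (fromℕ-sum f αs))

  F≡compositionSum : F coefficient n p q ≡ compositionSum n
  F≡compositionSum = begin
    sum (λ d → x ^ℚ d * sum (λ μ → ℤtoℚ (coefficient μ) div prodℚ (map qq μ)) (partitionsWithLength n (n ∸ d))) (upTo (suc n))
      ≡⟨ sum-upTo-cong (suc n) (λ d d<1+n → trans (sym (sum-*ˡ (x ^ℚ d) _ (partitionsWithLength n (n ∸ d))))
                                                   (sum-cong (partitionsWithLength n (n ∸ d)) (partition-term d (ℕₚ.≤-pred d<1+n)))) ⟩
    sum (λ d → sum G (partitionsWithLength n (n ∸ d))) (upTo (suc n))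
      ≡⟨ sym (sum-concatMap G (λ d → partitionsWithLength n (n ∸ d)) (upTo (suc n))) ⟩
    sum G (partitions n)
      ≡⟨ sum-cong (partitions n) partition-expanded ⟩
    sum (λ μ → sum (λ α → fromℕ (Countᴸ.δ (sortDesc α) μ) * term α μ) (compositions n)) (partitions n)
      ≡⟨ sum-comm (λ μ α → fromℕ (Countᴸ.δ (sortDesc α) μ) * term α μ) (partitions n) (compositions n) ⟩
    sum (λ α → sum (λ μ → fromℕ (Countᴸ.δ (sortDesc α) μ) * term α μ) (partitions n)) (compositions n)
      ≡⟨ sum-cong (compositions n) (λ α α∈ → collapse α (∈-compositions⁻ n α∈)) ⟩
    compositionSum n ∎
    where
    G : List ℕ → ℚ
    G μ = fromℕ (partitionCoefficient μ) * prodℚ (map a μ)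
    term : List ℕ → List ℕ → ℚ
    term α μ = fromℕ (cycleArrangements α) * prodℚ (map a μ)
    collapse : ∀ α → IsComposition n α →
               sum (λ μ → fromℕ (Countᴸ.δ (sortDesc α) μ) * term α μ) (partitions n) ≡ fromℕ (cycleArrangements α) * prodℚ (map a α)
    collapse α α⊨n = begin
      sum (λ μ → fromℕ (Countᴸ.δ (sortDesc α) μ) * term α μ) (partitions n)  ≡⟨ sum-δ (≡-dec ℕ._≟_) (term α) (sortDesc α) (partitions n) ⟩
      fromℕ (Countᴸ.count (sortDesc α) (partitions n)) * term α (sortDesc α)   ≡⟨ cong (λ k → fromℕ k * term α (sortDesc α)) (count-sortDesc-partitions n α α⊨n) ⟩
      fromℕ 1 * term α (sortDesc α)                                           ≡⟨ fromℕ-1-* (term α (sortDesc α)) ⟩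
      fromℕ (cycleArrangements α) * prodℚ (map a (sortDesc α))                ≡⟨ cong (fromℕ (cycleArrangements α) *_) (prodℚ-sortDesc a α) ⟩
      fromℕ (cycleArrangements α) * prodℚ (map a α)                           ∎

  H≡qfact*qfact*compositionSum : H n p q ≡ qfact p n * qfact q n * (compositionSum n div fromℕ (n !))
  H≡qfact*qfact*compositionSum = H≡qfact*qfact* nzp nzq expCoefficient (λ k _ → fromℕ*expCoefficient k) refl n ℕₚ.≤-refl

  H/n!≡ : H n p q div ℕtoℚ (n !) ≡ ((qfact p n * qfact q n) div (ℕtoℚ (n !) * ℕtoℚ (n !))) * F coefficient n p q
  H/n!≡ = begin
    H n p q div ℕtoℚ (n !)                                             ≡⟨ cong₂ _div_ H≡qfact*qfact*compositionSum (sym (fromℕ≡ℕtoℚ (n !))) ⟩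
    (qfact p n * qfact q n * (compositionSum n div n!)) div n!         ≡⟨ *-div-div (qfact p n * qfact q n) (compositionSum n) n! (fromℕ-!≢0 n) ⟩
    ((qfact p n * qfact q n) div (n! * n!)) * compositionSum n         ≡⟨ cong₂ (λ m s → ((qfact p n * qfact q n) div (m * m)) * s) (fromℕ≡ℕtoℚ (n !)) (sym F≡compositionSum) ⟩
    ((qfact p n * qfact q n) div (ℕtoℚ (n !) * ℕtoℚ (n !))) * F coefficient n p q ∎
    where
    n! = fromℕ (n !)

theorem2p3 : ∃ λ (c : List ℕ → ℤ) →
    ∀ (n : ℕ) (p q : ℚ) →
    (∀ (k : ℕ) → 1 ≤ k → k ≤ n → (qint p k ≢ 0ℚ) × (qint q k ≢ 0ℚ)) →
    H n p q div ℕtoℚ (n !)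
    ≡ ((qfact p n * qfact q n) div (ℕtoℚ (n !) * ℕtoℚ (n !))) * F c n p q
theorem2p3 = coefficient , λ n p q nonzero →
  MainIdentity.H/n!≡ p q n (λ k 1≤k k≤n → proj₁ (nonzero k 1≤k k≤n)) (λ k 1≤k k≤n → proj₂ (nonzero k 1≤k k≤n))
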